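{- Let $r\ge1$ be an integer. For $n\ge1$ and $d\ge0$ let ${\bf w}_r(n,d)$ be the number of $r$-canonical RNA secondary structures of length $n$ with $5'$-$3'$ distance $d$, and let $$\mathbf W_r(z,u)=\sum_{n\ge1}\sum_{d\ge0}{\bf w}_r(n,d)\,z^nu^d .$$ Let $\mathbf S_r(z)=\sum_{n\ge0}s_{r,n}z^n$, where $s_{r,n}$ is the number of $r$-canonical RNA secondary structures of length $n$ (with $s_{r,0}=1$ for the empty structure). Then, as formal power series, $$\mathbf W_r(z,u)=\frac{u\,z^{2r}(\mathbf S_r(z)-1)}{(1-zu)^2(1-z^2+z^{2r})-(1-zu)u^2z^{2r}(\mathbf S_r(z)-1)}+\frac{z}{1-zu}.$$
   Context: An RNA secondary structure of length $n$ is a diagram on the vertex set $[n]=\{1,\dots,n\}$ with backbone edges $\{i,i+1\}$, $1\le i\le n-1$, together with a set of arcs $(i,j)$, $i<j$, such that every vertex lies in at most one arc, no two arcs cross (no arcs $(i,j),(k,l)$ with $i<k<j<l$), and there are no arcs $(i,i+1)$. Its $5'$-$3'$ distance is the minimal number of edges of a path from vertex $1$ to vertex $n$ in the graph whose edges are the backbone edges and the arcs. A stack of length $k$ is a maximal sequence of "parallel" arcs $(i,j),(i+1,j-1),\dots,(i+k-1,j-k+1)$ (maximal meaning neither $(i-1,j+1)$ nor $(i+k,j-k)$ is an arc). A secondary structure is $r$-canonical if every stack has length at least $r$. -}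

module Defs where

open import Data.Nat as ℕ using (ℕ; zero; suc; _<_; _≤_; _∸_; _≡ᵇ_)
open import Data.Integer as ℤ using (ℤ; +_; 0ℤ; 1ℤ)
open import Data.Bool using (Bool; true; false; if_then_else_; _∧_)
open import Data.List using (List; []; _∷_; [_]; map; foldr; upTo; length; filter; concatMap; allFin)
open import Data.Vec as Vec using (Vec; toList)
open import Data.Maybe as Maybe using (Maybe; just; nothing)
open import Data.Fin using (Fin; toℕ)
open import Data.Product using (Σ; ∃; _×_; _,_)
open import Data.Sum using (_⊎_)
open import Data.Empty using (⊥)
open import Relation.Nullary using (Dec; ¬_)
open import Relation.Binary.PropositionalEquality using (_≡_)

-- Formal power series in two variables z, u with integer coefficients:
-- f n d is the coefficient of z^n u^d.

Series : Set
Series = ℕ → ℕ → ℤ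

sumℤ : List ℤ → ℤ
sumℤ = foldr ℤ._+_ 0ℤ

Σ< : ℕ → (ℕ → ℤ) → ℤ
Σ< n f = sumℤ (map f (upTo n))

infixl 6 _⊕_ _⊖_
infixl 7 _⊛_

_⊕_ : Series → Series → Series
(f ⊕ g) n d = f n d ℤ.+ g n d

_⊖_ : Series → Series → Series
(f ⊖ g) n d = f n d ℤ.- g n d

_⊛_ : Series → Series → Series
(f ⊛ g) n d = Σ< (suc n) λ i → Σ< (suc d) λ j → f i j ℤ.* g (n ∸ i) (d ∸ j)

mono : ℕ → ℕ → Series
mono a b n d = if (n ≡ᵇ a) ∧ (d ≡ᵇ b) then 1ℤ else 0ℤ

𝟙 Z U : Series
𝟙 = mono 0 0
Z = mono 1 0
U = mono 0 1

_^ˢ_ : Series → ℕ → Series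
f ^ˢ zero = 𝟙
f ^ˢ suc k = f ⊛ (f ^ˢ k)

-- Multiplicative inverse of a series with constant term 1, via the
-- geometric (Neumann) series 1/f = Σ_k (1 - f)^k; since 1 - f has zero
-- constant term, only k ≤ n + d contribute to the coefficient of z^n u^d.
inv : Series → Series
inv f n d = Σ< (suc (n ℕ.+ d)) λ k → ((𝟙 ⊖ f) ^ˢ k) n d

liftZ : (ℕ → ℤ) → Series
liftZ s n d = if d ≡ᵇ 0 then s n else 0ℤ

-- Vertices of a length-n structure are 0,…,n-1
-- (vertex k here is vertex k+1 of the paper).  A structure is encoded by
-- its partner vector: entry i is (just j) if i is paired with j, nothing
-- if i is unpaired.

Struct : ℕ → Set
Struct n = Vec (Maybe (Fin n)) n

nth : List (Maybe ℕ) → ℕ → Maybe ℕ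
nth []       _       = nothing
nth (x ∷ xs) zero    = x
nth (x ∷ xs) (suc k) = nth xs k

partner : ∀ {n} → Struct n → ℕ → Maybe ℕ
partner p = nth (toList (Vec.map (Maybe.map toℕ) p))

Arc : ∀ {n} → Struct n → ℕ → ℕ → Set
Arc p a b = a < b × partner p a ≡ just b

IsDiagram : ∀ {n} → Struct n → Set
IsDiagram p = ∀ a b → partner p a ≡ just b →
  partner p b ≡ just a × (suc a < b ⊎ suc b < a)

NonCrossing : ∀ {n} → Struct n → Set
NonCrossing p = ∀ a b c d → Arc p a b → Arc p c d →
  a < c → c < b → b < d → ⊥

SecondaryStructure : ∀ {n} → Struct n → Set
SecondaryStructure p = IsDiagram p × NonCrossing p

-- every stack has length ≥ r: whenever an arc (a , b) is the outermost
-- arc of its stack (i.e. (a-1 , b+1) is not an arc), the arcs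
-- (a+t , b-t) exist for all t < r.
Canonical : ℕ → ∀ {n} → Struct n → Set
Canonical r p = ∀ a b → Arc p a b →
  ¬ (∃ λ a′ → a ≡ suc a′ × Arc p a′ (suc b)) →
  ∀ t → t < r → Arc p (a ℕ.+ t) (b ∸ t)

RCanonical : ℕ → ∀ {n} → Struct n → Set
RCanonical r p = SecondaryStructure p × Canonical r p

Edge : ∀ {n} → Struct n → ℕ → ℕ → Set
Edge {n} p a b =
  (suc a ≡ b × b < n) ⊎ (suc b ≡ a × a < n) ⊎ Arc p a b ⊎ Arc p b a

data Walk {n} (p : Struct n) : ℕ → ℕ → ℕ → Set where
  here : ∀ {a} → a < n → Walk p 0 a a
  step : ∀ {k a b c} → Edge p a b → Walk p k b c → Walk p (suc k) a c

Distance : ∀ {n} → Struct n → ℕ → Set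
Distance {n} p d =
  Walk p d 0 (n ∸ 1) × (∀ k → Walk p k 0 (n ∸ 1) → d ≤ k)

allVecs : ∀ {A : Set} → List A → (k : ℕ) → List (Vec A k)
allVecs xs zero    = [ Vec.[] ]
allVecs xs (suc k) = concatMap (λ x → map (x Vec.∷_) (allVecs xs k)) xs

structs : (n : ℕ) → List (Struct n)
structs n = allVecs (nothing ∷ map just (allFin n)) n

count : ∀ {A : Set} {P : A → Set} → (∀ a → Dec (P a)) → List A → ℕ
count dec xs = length (filter dec xs)

sCount : (r : ℕ) → (∀ n (p : Struct n) → Dec (RCanonical r p)) → ℕ → ℕ
sCount r decS n = count (decS n) (structs n)

wCount : (r : ℕ) → (∀ n d (p : Struct n) → Dec (RCanonical r p × Distance p d)) →
  ℕ → ℕ → ℕ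
wCount r decW n d = count (decW n d) (structs n)

𝐒 : (r : ℕ) → (∀ n (p : Struct n) → Dec (RCanonical r p)) → Series
𝐒 r decS = liftZ (λ n → + sCount r decS n)

𝐖 : (r : ℕ) → (∀ n d (p : Struct n) → Dec (RCanonical r p × Distance p d)) → Series
𝐖 r decW zero    d = 0ℤ
𝐖 r decW (suc n) d = + wCount r decW (suc n) d

RHS : ℕ → Series → Series
RHS r S =
  (U ⊛ z2r ⊛ (S ⊖ 𝟙)) ⊛ inv D ⊕ Z ⊛ inv (𝟙 ⊖ Z ⊛ U)
  where
  z2r = mono (r ℕ.+ r) 0
  D : Series
  D = (𝟙 ⊖ Z ⊛ U) ⊛ (𝟙 ⊖ Z ⊛ U) ⊛ (𝟙 ⊖ Z ⊛ Z ⊕ z2r)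
      ⊖ (𝟙 ⊖ Z ⊛ U) ⊛ U ⊛ U ⊛ z2r ⊛ (S ⊖ 𝟙)

-- Split an r-canonical structure by the partner of its first vertex: it is unpaired (a single vertex followed
-- by a structure whose 5'-3' distance is one less), paired with the last vertex (distance 1), or paired with
-- some j < n - 1 (a closed block followed by a structure whose distance is two less). With T the generating
-- function of closed structures, those whose first and last vertices are paired, this gives
-- W = zuW + u²TW + z + uT. Removing the outer arc of a closed structure either continues its stack or, once
-- the stack has r arcs, leaves an arbitrary nonempty structure that is not closed; this gives
-- T (1 - z² + z²ʳ) = z²ʳ (S - 1). Eliminating T between the two equations yields the formula.

module Submission where

module FiniteSum where

  open import Data.Nat as ℕ using (ℕ; zero; suc; _<_; _≤_; _∸_; z≤n; s≤s)
  import Data.Nat.Properties as ℕP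
  open import Data.Integer using (ℤ; _+_; _*_; -_; _-_; 0ℤ)
  import Data.Integer.Properties as ℤP
  open import Data.List using (applyUpTo)
  open import Data.List.Properties using (map-upTo)
  open import Function using (_∘_)
  open import Relation.Binary.PropositionalEquality
  open import Data.Integer.Solver using (module +-*-Solver)
  open +-*-Solver
  open import Defs using (sumℤ; Σ<)

  -- Opaque, so that conversion checking never unfolds the (large) coefficient sums.
  opaque
    ∑ : ℕ → (ℕ → ℤ) → ℤ
    ∑ n f = sumℤ (applyUpTo f n)

    Σ<≡∑ : ∀ n f → Σ< n f ≡ ∑ n f
    Σ<≡∑ n f = cong sumℤ (map-upTo f n)

    ∑-0 : ∀ (f : ℕ → ℤ) → ∑ 0 f ≡ 0ℤ
    ∑-0 f = refl

    ∑-suc : ∀ n (f : ℕ → ℤ) → ∑ (suc n) f ≡ f 0 + ∑ n (f ∘ suc)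
    ∑-suc n f = refl

    ∑-cong : ∀ n {f g : ℕ → ℤ} → (∀ i → i < n → f i ≡ g i) → ∑ n f ≡ ∑ n g
    ∑-cong zero h = refl
    ∑-cong (suc n) h = cong₂ _+_ (h 0 (s≤s z≤n)) (∑-cong n (λ i i<n → h (suc i) (s≤s i<n)))

    ∑-zero : ∀ n {f : ℕ → ℤ} → (∀ i → i < n → f i ≡ 0ℤ) → ∑ n f ≡ 0ℤ
    ∑-zero zero h = refl
    ∑-zero (suc n) h = cong₂ _+_ (h 0 (s≤s z≤n)) (∑-zero n (λ i i<n → h (suc i) (s≤s i<n)))

    ∑-distrib-+ : ∀ n (f g : ℕ → ℤ) → ∑ n (λ i → f i + g i) ≡ ∑ n f + ∑ n g
    ∑-distrib-+ zero f g = refl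
    ∑-distrib-+ (suc n) f g = trans (cong ((f 0 + g 0) +_) (∑-distrib-+ n (f ∘ suc) (g ∘ suc)))
      (solve 4 (λ a b c d → (a :+ b) :+ (c :+ d) := (a :+ c) :+ (b :+ d)) refl
        (f 0) (g 0) (∑ n (f ∘ suc)) (∑ n (g ∘ suc)))

    ∑-neg : ∀ n (f : ℕ → ℤ) → ∑ n (λ i → - f i) ≡ - ∑ n f
    ∑-neg zero f = refl
    ∑-neg (suc n) f = trans (cong (- f 0 +_) (∑-neg n (f ∘ suc))) (sym (ℤP.neg-distrib-+ (f 0) _))

    ∑-*ˡ : ∀ n c (f : ℕ → ℤ) → ∑ n (λ i → c * f i) ≡ c * ∑ n f
    ∑-*ˡ zero c f = sym (ℤP.*-zeroʳ c)
    ∑-*ˡ (suc n) c f = trans (cong (c * f 0 +_) (∑-*ˡ n c (f ∘ suc))) (sym (ℤP.*-distribˡ-+ c (f 0) _))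

    ∑-last : ∀ n (f : ℕ → ℤ) → ∑ (suc n) f ≡ ∑ n f + f n
    ∑-last zero f = ℤP.+-comm (f 0) 0ℤ
    ∑-last (suc n) f = trans (cong (f 0 +_) (∑-last n (f ∘ suc))) (sym (ℤP.+-assoc (f 0) _ _))

    ∑-split : ∀ a b (f : ℕ → ℤ) → ∑ (a ℕ.+ b) f ≡ ∑ a f + ∑ b (λ i → f (a ℕ.+ i))
    ∑-split zero b f = sym (ℤP.+-identityˡ _)
    ∑-split (suc a) b f = trans (cong (f 0 +_) (∑-split a b (f ∘ suc))) (sym (ℤP.+-assoc (f 0) _ _))

  ∑-ext : ∀ n {f g : ℕ → ℤ} → (∀ i → f i ≡ g i) → ∑ n f ≡ ∑ n g
  ∑-ext n h = ∑-cong n (λ i _ → h i)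

  ∑-*ʳ : ∀ n c (f : ℕ → ℤ) → ∑ n (λ i → f i * c) ≡ ∑ n f * c
  ∑-*ʳ n c f = trans (∑-ext n (λ i → ℤP.*-comm (f i) c)) (trans (∑-*ˡ n c f) (ℤP.*-comm c _))

  ∑-1 : ∀ (f : ℕ → ℤ) → ∑ 1 f ≡ f 0
  ∑-1 f = trans (∑-suc 0 f) (trans (cong (f 0 +_) (∑-0 (f ∘ suc))) (ℤP.+-identityʳ (f 0)))

  ∑-comm : ∀ a b (F : ℕ → ℕ → ℤ) → ∑ a (λ i → ∑ b (F i)) ≡ ∑ b (λ j → ∑ a (λ i → F i j))
  ∑-comm zero b F = trans (∑-0 _) (sym (∑-zero b (λ j _ → ∑-0 _)))
  ∑-comm (suc a) b F = begin
    ∑ (suc a) (λ i → ∑ b (F i))                              ≡⟨ ∑-suc a _ ⟩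
    ∑ b (F 0) + ∑ a (λ i → ∑ b (F (suc i)))                  ≡⟨ cong (∑ b (F 0) +_) (∑-comm a b (F ∘ suc)) ⟩
    ∑ b (F 0) + ∑ b (λ j → ∑ a (λ i → F (suc i) j))          ≡⟨ ∑-distrib-+ b _ _ ⟨
    ∑ b (λ j → F 0 j + ∑ a (λ i → F (suc i) j))              ≡⟨ ∑-ext b (λ j → ∑-suc a (λ i → F i j)) ⟨
    ∑ b (λ j → ∑ (suc a) (λ i → F i j))                      ∎
    where open ≡-Reasoning

  ∑-reverse : ∀ n (f : ℕ → ℤ) → ∑ n f ≡ ∑ n (λ i → f (n ∸ suc i))
  ∑-reverse zero f = trans (∑-0 f) (sym (∑-0 _))
  ∑-reverse (suc n) f = begin
    ∑ (suc n) f                                          ≡⟨ ∑-suc n f ⟩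
    f 0 + ∑ n (f ∘ suc)                                  ≡⟨ cong (f 0 +_) (∑-reverse n (f ∘ suc)) ⟩
    f 0 + ∑ n (λ i → f (suc (n ∸ suc i)))                ≡⟨ ℤP.+-comm (f 0) _ ⟩
    ∑ n (λ i → f (suc (n ∸ suc i))) + f 0                ≡⟨ cong₂ _+_ (∑-cong n (λ i i<n → cong f (sym (ℕP.+-∸-assoc 1 i<n))))
                                                                       (cong f (sym (ℕP.n∸n≡0 n))) ⟩
    ∑ n (λ i → f (suc n ∸ suc i)) + f (suc n ∸ suc n)    ≡⟨ ∑-last n _ ⟨
    ∑ (suc n) (λ i → f (suc n ∸ suc i))                  ∎
    where open ≡-Reasoning

  -- Both sides sum G m i over 0 ≤ i ≤ m ≤ n; peeling off the terms with i = 0 leaves the same identity for G ∘ suc ∘ suc.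
  ∑-triangle : ∀ n (G : ℕ → ℕ → ℤ) →
    ∑ (suc n) (λ m → ∑ (suc m) (G m)) ≡ ∑ (suc n) (λ i → ∑ (suc (n ∸ i)) (λ k → G (i ℕ.+ k) i))
  ∑-triangle zero G = trans (trans (∑-1 _) (∑-1 _)) (sym (trans (∑-1 _) (∑-1 _)))
  ∑-triangle (suc n) G = begin
    ∑ (suc (suc n)) (λ m → ∑ (suc m) (G m))
      ≡⟨ ∑-suc (suc n) _ ⟩
    ∑ 1 (G 0) + ∑ (suc n) (λ m → ∑ (suc (suc m)) (G (suc m)))
      ≡⟨ cong₂ _+_ (∑-1 (G 0)) (∑-ext (suc n) (λ m → ∑-suc (suc m) (G (suc m)))) ⟩
    G 0 0 + ∑ (suc n) (λ m → G (suc m) 0 + ∑ (suc m) (G′ m))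
      ≡⟨ cong (G 0 0 +_) (∑-distrib-+ (suc n) _ _) ⟩
    G 0 0 + (∑ (suc n) (λ m → G (suc m) 0) + ∑ (suc n) (λ m → ∑ (suc m) (G′ m)))
      ≡⟨ cong (λ x → G 0 0 + (∑ (suc n) (λ m → G (suc m) 0) + x)) (∑-triangle n G′) ⟩
    G 0 0 + (∑ (suc n) (λ m → G (suc m) 0) + rest)
      ≡⟨ trans (cong (_+ rest) (∑-suc (suc n) (λ k → G k 0))) (ℤP.+-assoc (G 0 0) _ _) ⟨
    ∑ (suc (suc n)) (λ k → G k 0) + rest
      ≡⟨ ∑-suc (suc n) _ ⟨
    ∑ (suc (suc n)) (λ i → ∑ (suc (suc n ∸ i)) (λ k → G (i ℕ.+ k) i))
      ∎
    where
    open ≡-Reasoning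
    G′ : ℕ → ℕ → ℤ
    G′ m i = G (suc m) (suc i)
    rest : ℤ
    rest = ∑ (suc n) (λ i → ∑ (suc (n ∸ i)) (λ k → G′ (i ℕ.+ k) i))

  ∑-single : ∀ N a (h : ℕ → ℤ) → a < N → (∀ i → i < N → i ≢ a → h i ≡ 0ℤ) → ∑ N h ≡ h a
  ∑-single (suc N) zero h _ z =
    trans (∑-suc N h) (trans (cong (h 0 +_) (∑-zero N (λ i i<N → z (suc i) (s≤s i<N) (λ ())))) (ℤP.+-identityʳ (h 0)))
  ∑-single (suc N) (suc a) h (s≤s a<N) z =
    trans (∑-suc N h) (trans (cong₂ _+_ (z 0 (s≤s z≤n) (λ ())) (∑-single N a (h ∘ suc) a<N
      (λ i i<N i≢a → z (suc i) (s≤s i<N) (i≢a ∘ ℕP.suc-injective)))) (ℤP.+-identityˡ _))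

  ∑-telescope : ∀ M (a : ℕ → ℤ) → ∑ M a - ∑ M (a ∘ suc) ≡ a 0 - a M
  ∑-telescope zero a = trans (cong₂ _-_ (∑-0 a) (∑-0 (a ∘ suc))) (sym (ℤP.+-inverseʳ (a 0)))
  ∑-telescope (suc M) a = begin
    ∑ (suc M) a - ∑ (suc M) (a ∘ suc)
      ≡⟨ cong₂ _-_ (∑-suc M a) (∑-last M (a ∘ suc)) ⟩
    (a 0 + ∑ M (a ∘ suc)) - (∑ M (a ∘ suc) + a (suc M))
      ≡⟨ solve 3 (λ x y z → (x :+ y) :- (y :+ z) := x :- z) refl (a 0) (∑ M (a ∘ suc)) (a (suc M)) ⟩
    a 0 - a (suc M) ∎
    where open ≡-Reasoning

module PowerSeries where

  open import Data.Nat as ℕ using (ℕ; zero; suc; _<_; _≤_; _∸_; z≤n; s≤s; _≡ᵇ_)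
  import Data.Nat.Properties as ℕP
  open import Data.Integer using (_+_; _*_; -_; _-_; 0ℤ; 1ℤ)
  import Data.Integer.Properties as ℤP
  open import Data.Bool using (true; false)
  open import Data.Empty using (⊥-elim)
  open import Relation.Binary.PropositionalEquality
  open import Data.Integer.Solver using (module +-*-Solver)
  open +-*-Solver
  open import Function using (_∘′_)
  open import Defs
  open FiniteSum

  infix 4 _≈_
  _≈_ : Series → Series → Set
  f ≈ g = ∀ n d → f n d ≡ g n d

  0ˢ : Series
  0ˢ n d = 0ℤ

  negˢ : Series → Series
  negˢ f n d = - f n d

  ⊛-coeff : ∀ f g n d → (f ⊛ g) n d ≡ ∑ (suc n) (λ i → ∑ (suc d) (λ j → f i j * g (n ∸ i) (d ∸ j)))
  ⊛-coeff f g n d = trans (Σ<≡∑ (suc n) _) (∑-ext (suc n) (λ i → Σ<≡∑ (suc d) _))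

  ⊕-cong : ∀ {f f′ g g′} → f ≈ f′ → g ≈ g′ → f ⊕ g ≈ f′ ⊕ g′
  ⊕-cong p q n d = cong₂ _+_ (p n d) (q n d)

  ⊛-cong : ∀ {f f' g g'} → f ≈ f' → g ≈ g' → f ⊛ g ≈ f' ⊛ g'
  ⊛-cong {f} {f'} {g} {g'} p q n d = trans (⊛-coeff f g n d) (trans
    (∑-ext (suc n) (λ i → ∑-ext (suc d) (λ j → cong₂ _*_ (p i j) (q (n ∸ i) (d ∸ j)))))
    (sym (⊛-coeff f' g' n d)))

  ⊛-coeff-congˡ : ∀ {f f'} g n d → (∀ i j → i ≤ n → j ≤ d → f i j ≡ f' i j) → (f ⊛ g) n d ≡ (f' ⊛ g) n d
  ⊛-coeff-congˡ {f} {f'} g n d p = trans (⊛-coeff f g n d) (trans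
    (∑-cong (suc n) (λ { i (s≤s i≤n) → ∑-cong (suc d) (λ { j (s≤s j≤d) → cong (_* g (n ∸ i) (d ∸ j)) (p i j i≤n j≤d) }) }))
    (sym (⊛-coeff f' g n d)))

  ⊛-comm : ∀ f g → f ⊛ g ≈ g ⊛ f
  ⊛-comm f g n d = begin
      (f ⊛ g) n d
    ≡⟨ ⊛-coeff f g n d ⟩
      ∑ (suc n) (λ i → ∑ (suc d) (λ j → f i j * g (n ∸ i) (d ∸ j)))
    ≡⟨ ∑-reverse (suc n) _ ⟩
      ∑ (suc n) (λ i → ∑ (suc d) (λ j → f (n ∸ i) j * g (n ∸ (n ∸ i)) (d ∸ j)))
    ≡⟨ ∑-ext (suc n) (λ i → ∑-reverse (suc d) _) ⟩
      ∑ (suc n) (λ i → ∑ (suc d) (λ j → f (n ∸ i) (d ∸ j) * g (n ∸ (n ∸ i)) (d ∸ (d ∸ j))))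
    ≡⟨ ∑-cong (suc n) (λ { i (s≤s i≤n) → ∑-cong (suc d) (λ { j (s≤s j≤d) →
         trans (ℤP.*-comm (f (n ∸ i) (d ∸ j)) (g (n ∸ (n ∸ i)) (d ∸ (d ∸ j))))
             (cong₂ (λ a b → g a b * f (n ∸ i) (d ∸ j)) (ℕP.m∸[m∸n]≡n i≤n) (ℕP.m∸[m∸n]≡n j≤d)) }) }) ⟩
      ∑ (suc n) (λ i → ∑ (suc d) (λ j → g i j * f (n ∸ i) (d ∸ j)))
    ≡⟨ sym (⊛-coeff g f n d) ⟩
      (g ⊛ f) n d ∎
    where open ≡-Reasoning

  ⊛-distribˡ : ∀ f g h → f ⊛ (g ⊕ h) ≈ (f ⊛ g) ⊕ (f ⊛ h)
  ⊛-distribˡ f g h n d = begin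
      (f ⊛ (g ⊕ h)) n d
    ≡⟨ ⊛-coeff f (g ⊕ h) n d ⟩
      ∑ (suc n) (λ i → ∑ (suc d) (λ j → f i j * (g (n ∸ i) (d ∸ j) + h (n ∸ i) (d ∸ j))))
    ≡⟨ ∑-ext (suc n) (λ i → trans (∑-ext (suc d) (λ j → ℤP.*-distribˡ-+ (f i j) _ _)) (∑-distrib-+ (suc d) _ _)) ⟩
      ∑ (suc n) (λ i → ∑ (suc d) (λ j → f i j * g (n ∸ i) (d ∸ j)) + ∑ (suc d) (λ j → f i j * h (n ∸ i) (d ∸ j)))
    ≡⟨ ∑-distrib-+ (suc n) _ _ ⟩
      ∑ (suc n) (λ i → ∑ (suc d) (λ j → f i j * g (n ∸ i) (d ∸ j))) + ∑ (suc n) (λ i → ∑ (suc d) (λ j → f i j * h (n ∸ i) (d ∸ j)))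
    ≡⟨ sym (cong₂ _+_ (⊛-coeff f g n d) (⊛-coeff f h n d)) ⟩
      ((f ⊛ g) ⊕ (f ⊛ h)) n d ∎
    where open ≡-Reasoning

  ⊛-assoc : ∀ f g h → (f ⊛ g) ⊛ h ≈ f ⊛ (g ⊛ h)
  ⊛-assoc f g h n d = begin
      ((f ⊛ g) ⊛ h) n d
    ≡⟨ ⊛-coeff (f ⊛ g) h n d ⟩
      ∑ (suc n) (λ m → ∑ (suc d) (λ e → (f ⊛ g) m e * h (n ∸ m) (d ∸ e)))
    ≡⟨ ∑-ext (suc n) (λ m → ∑-ext (suc d) (λ e → trans (cong (_* h (n ∸ m) (d ∸ e)) (⊛-coeff f g m e))
         (trans (sym (∑-*ʳ (suc m) _ _)) (∑-ext (suc m) (λ i → sym (∑-*ʳ (suc e) _ _)))))) ⟩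
      ∑ (suc n) (λ m → ∑ (suc d) (λ e → ∑ (suc m) (λ i → ∑ (suc e) (λ j → f i j * g (m ∸ i) (e ∸ j) * h (n ∸ m) (d ∸ e)))))
    ≡⟨ ∑-ext (suc n) (λ m → ∑-comm (suc d) (suc m) _) ⟩
      ∑ (suc n) (λ m → ∑ (suc m) (λ i → ∑ (suc d) (λ e → ∑ (suc e) (λ j → f i j * g (m ∸ i) (e ∸ j) * h (n ∸ m) (d ∸ e)))))
    ≡⟨ ∑-triangle n (λ m i → ∑ (suc d) (λ e → ∑ (suc e) (λ j → f i j * g (m ∸ i) (e ∸ j) * h (n ∸ m) (d ∸ e)))) ⟩
      ∑ (suc n) (λ i → ∑ (suc (n ∸ i))
          (λ k → ∑ (suc d) (λ e → ∑ (suc e) (λ j → f i j * g (i ℕ.+ k ∸ i) (e ∸ j) * h (n ∸ (i ℕ.+ k)) (d ∸ e)))))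
    ≡⟨ ∑-ext (suc n) (λ i → ∑-ext (suc (n ∸ i)) (λ k → ∑-triangle d _)) ⟩
      ∑ (suc n) (λ i → ∑ (suc (n ∸ i))
          (λ k → ∑ (suc d) (λ j → ∑ (suc (d ∸ j)) (λ l → f i j * g (i ℕ.+ k ∸ i) (j ℕ.+ l ∸ j) * h (n ∸ (i ℕ.+ k)) (d ∸ (j ℕ.+ l))))))
    ≡⟨ ∑-ext (suc n) (λ i → ∑-comm (suc (n ∸ i)) (suc d) _) ⟩
      ∑ (suc n) (λ i → ∑ (suc d)
          (λ j → ∑ (suc (n ∸ i)) (λ k → ∑ (suc (d ∸ j)) (λ l → f i j * g (i ℕ.+ k ∸ i) (j ℕ.+ l ∸ j) * h (n ∸ (i ℕ.+ k)) (d ∸ (j ℕ.+ l))))))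
    ≡⟨ ∑-ext (suc n) (λ i → ∑-ext (suc d) (λ j → inner i j)) ⟩
      ∑ (suc n) (λ i → ∑ (suc d) (λ j → f i j * ∑ (suc (n ∸ i)) (λ k → ∑ (suc (d ∸ j)) (λ l → g k l * h (n ∸ i ∸ k) (d ∸ j ∸ l)))))
    ≡⟨ sym (∑-ext (suc n) (λ i → ∑-ext (suc d) (λ j → cong (f i j *_) (⊛-coeff g h (n ∸ i) (d ∸ j))))) ⟩
      ∑ (suc n) (λ i → ∑ (suc d) (λ j → f i j * (g ⊛ h) (n ∸ i) (d ∸ j)))
    ≡⟨ sym (⊛-coeff f (g ⊛ h) n d) ⟩
      (f ⊛ (g ⊛ h)) n d ∎
    where
    open ≡-Reasoning
    inner : ∀ i j → ∑ (suc (n ∸ i)) (λ k → ∑ (suc (d ∸ j)) (λ l → f i j * g (i ℕ.+ k ∸ i) (j ℕ.+ l ∸ j) * h (n ∸ (i ℕ.+ k)) (d ∸ (j ℕ.+ l))))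
       ≡ f i j * ∑ (suc (n ∸ i)) (λ k → ∑ (suc (d ∸ j)) (λ l → g k l * h (n ∸ i ∸ k) (d ∸ j ∸ l)))
    inner i j = trans (∑-ext (suc (n ∸ i)) (λ k → trans (∑-ext (suc (d ∸ j)) (λ l → eqt k l)) (∑-*ˡ (suc (d ∸ j)) (f i j) _)))
                      (∑-*ˡ (suc (n ∸ i)) (f i j) _)
      where
      eqt : ∀ k l → f i j * g (i ℕ.+ k ∸ i) (j ℕ.+ l ∸ j) * h (n ∸ (i ℕ.+ k)) (d ∸ (j ℕ.+ l)) ≡ f i j * (g k l * h (n ∸ i ∸ k) (d ∸ j ∸ l))
      eqt k l rewrite ℕP.m+n∸m≡n i k | ℕP.m+n∸m≡n j l | sym (ℕP.∸-+-assoc n i k) | sym (ℕP.∸-+-assoc d j l) = ℤP.*-assoc (f i j) _ _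

  ≡ᵇ-refl : ∀ n → (n ≡ᵇ n) ≡ true
  ≡ᵇ-refl zero = refl
  ≡ᵇ-refl (suc n) = ≡ᵇ-refl n

  ≢⇒≡ᵇ-false : ∀ m n → m ≢ n → (m ≡ᵇ n) ≡ false
  ≢⇒≡ᵇ-false zero zero p = ⊥-elim (p refl)
  ≢⇒≡ᵇ-false zero (suc n) p = refl
  ≢⇒≡ᵇ-false (suc m) zero p = refl
  ≢⇒≡ᵇ-false (suc m) (suc n) p = ≢⇒≡ᵇ-false m n (p ∘′ cong suc)

  mono-hit : ∀ a b → mono a b a b ≡ 1ℤ
  mono-hit a b rewrite ≡ᵇ-refl a | ≡ᵇ-refl b = refl

  mono-missˡ : ∀ a b i j → i ≢ a → mono a b i j ≡ 0ℤ
  mono-missˡ a b i j p rewrite ≢⇒≡ᵇ-false i a p = refl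

  mono-missʳ : ∀ a b i j → j ≢ b → mono a b i j ≡ 0ℤ
  mono-missʳ a b i j p rewrite ≢⇒≡ᵇ-false j b p with i ≡ᵇ a
  ... | true = refl
  ... | false = refl

  mono-⊛ : ∀ a b f n d → a ≤ n → b ≤ d → (mono a b ⊛ f) n d ≡ f (n ∸ a) (d ∸ b)
  mono-⊛ a b f n d a≤n b≤d = begin
    (mono a b ⊛ f) n d
      ≡⟨ ⊛-coeff (mono a b) f n d ⟩
    ∑ (suc n) (λ i → ∑ (suc d) (λ j → mono a b i j * f (n ∸ i) (d ∸ j)))
      ≡⟨ ∑-single (suc n) a _ (s≤s a≤n) (λ i _ i≢a → ∑-zero (suc d) (λ j _ →
           cong (_* f (n ∸ i) (d ∸ j)) (mono-missˡ a b i j i≢a))) ⟩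
    ∑ (suc d) (λ j → mono a b a j * f (n ∸ a) (d ∸ j))
      ≡⟨ ∑-single (suc d) b _ (s≤s b≤d) (λ j _ j≢b → cong (_* f (n ∸ a) (d ∸ j)) (mono-missʳ a b a j j≢b)) ⟩
    mono a b a b * f (n ∸ a) (d ∸ b)
      ≡⟨ cong (_* f (n ∸ a) (d ∸ b)) (mono-hit a b) ⟩
    1ℤ * f (n ∸ a) (d ∸ b)
      ≡⟨ ℤP.*-identityˡ _ ⟩
    f (n ∸ a) (d ∸ b) ∎
    where open ≡-Reasoning

  mono-⊛-belowˡ : ∀ a b f n d → n < a → (mono a b ⊛ f) n d ≡ 0ℤ
  mono-⊛-belowˡ a b f n d n<a = trans (⊛-coeff (mono a b) f n d) (∑-zero (suc n) (λ { i (s≤s i≤n) → ∑-zero (suc d)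
    (λ j _ → cong (_* f (n ∸ i) (d ∸ j)) (mono-missˡ a b i j (ℕP.<⇒≢ (ℕP.≤-<-trans i≤n n<a)))) }))

  mono-⊛-belowʳ : ∀ a b f n d → d < b → (mono a b ⊛ f) n d ≡ 0ℤ
  mono-⊛-belowʳ a b f n d d<b = trans (⊛-coeff (mono a b) f n d) (∑-zero (suc n) (λ i _ → ∑-zero (suc d)
    (λ { j (s≤s j≤d) → cong (_* f (n ∸ i) (d ∸ j)) (mono-missʳ a b i j (ℕP.<⇒≢ (ℕP.≤-<-trans j≤d d<b))) })))

  ⊛-identityˡ : ∀ f → 𝟙 ⊛ f ≈ f
  ⊛-identityˡ f n d = mono-⊛ 0 0 f n d z≤n z≤n

  ⊛-negʳ : ∀ f g → f ⊛ negˢ g ≈ negˢ (f ⊛ g)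
  ⊛-negʳ f g n d = trans (⊛-coeff f (negˢ g) n d) (trans
    (∑-ext (suc n) (λ i → trans (∑-ext (suc d) (λ j → sym (ℤP.neg-distribʳ-* (f i j) (g (n ∸ i) (d ∸ j))))) (∑-neg (suc d) _)))
    (trans (∑-neg (suc n) _) (cong -_ (sym (⊛-coeff f g n d)))))

  ∑ˢ : ℕ → (ℕ → Series) → Series
  ∑ˢ M A n d = ∑ M (λ k → A k n d)

  ∑ˢ-⊛ : ∀ M A g → ∑ˢ M A ⊛ g ≈ ∑ˢ M (λ k → A k ⊛ g)
  ∑ˢ-⊛ M A g n d = begin
    (∑ˢ M A ⊛ g) n d
      ≡⟨ ⊛-coeff (∑ˢ M A) g n d ⟩
    ∑ (suc n) (λ i → ∑ (suc d) (λ j → ∑ M (λ k → A k i j) * g (n ∸ i) (d ∸ j)))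
      ≡⟨ ∑-ext (suc n) (λ i → trans (∑-ext (suc d) (λ j → sym (∑-*ʳ M _ _))) (∑-comm (suc d) M _)) ⟩
    ∑ (suc n) (λ i → ∑ M (λ k → ∑ (suc d) (λ j → A k i j * g (n ∸ i) (d ∸ j))))
      ≡⟨ ∑-comm (suc n) M _ ⟩
    ∑ M (λ k → ∑ (suc n) (λ i → ∑ (suc d) (λ j → A k i j * g (n ∸ i) (d ∸ j))))
      ≡⟨ ∑-ext M (λ k → sym (⊛-coeff (A k) g n d)) ⟩
    ∑ˢ M (λ k → A k ⊛ g) n d ∎
    where open ≡-Reasoning

  -- Every factor of a nonzero term of (g ^ˢ k) n d has total degree ≥ 1, so k ≤ n + d.
  ^ˢ-vanish : ∀ g → g 0 0 ≡ 0ℤ → ∀ k n d → n ℕ.+ d < k → (g ^ˢ k) n d ≡ 0ℤ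
  ^ˢ-vanish g g00 (suc k) n d (s≤s n+d<k) = trans (⊛-coeff g (g ^ˢ k) n d)
    (∑-zero (suc n) (λ { i (s≤s i≤n) → ∑-zero (suc d) (λ { j (s≤s j≤d) → term i j i≤n j≤d }) }))
    where
    term : ∀ i j → i ≤ n → j ≤ d → g i j * (g ^ˢ k) (n ∸ i) (d ∸ j) ≡ 0ℤ
    term zero zero _ _ = cong (_* (g ^ˢ k) n d) g00
    term (suc i) j i≤n j≤d = trans (cong (g (suc i) j *_) (^ˢ-vanish g g00 k (n ∸ suc i) (d ∸ j)
      (ℕP.<-≤-trans (ℕP.+-mono-<-≤ (ℕP.∸-monoʳ-< (s≤s z≤n) i≤n) (ℕP.m∸n≤m d j)) n+d<k))) (ℤP.*-zeroʳ (g (suc i) j))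
    term zero (suc j) i≤n j≤d = trans (cong (g 0 (suc j) *_) (^ˢ-vanish g g00 k n (d ∸ suc j)
      (ℕP.<-≤-trans (ℕP.+-mono-≤-< (ℕP.≤-refl {n}) (ℕP.∸-monoʳ-< (s≤s z≤n) j≤d)) n+d<k))) (ℤP.*-zeroʳ (g 0 (suc j)))

  module _ (f : Series) (f00 : f 0 0 ≡ 1ℤ) where

    private
      g : Series
      g = 𝟙 ⊖ f

      g00 : g 0 0 ≡ 0ℤ
      g00 = cong (λ x → 1ℤ - x) f00

    inv-truncate : ∀ M n d → n ℕ.+ d < M → inv f n d ≡ ∑ˢ M (g ^ˢ_) n d
    inv-truncate M n d n+d<M = begin
      inv f n d
        ≡⟨ Σ<≡∑ N _ ⟩
      ∑ N (λ k → (g ^ˢ k) n d)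
        ≡⟨ ℤP.+-identityʳ _ ⟨
      ∑ N (λ k → (g ^ˢ k) n d) + 0ℤ
        ≡⟨ cong (∑ N (λ k → (g ^ˢ k) n d) +_)
             (∑-zero (M ∸ N) (λ i _ → ^ˢ-vanish g g00 (N ℕ.+ i) n d (s≤s (ℕP.m≤m+n (n ℕ.+ d) i)))) ⟨
      ∑ N (λ k → (g ^ˢ k) n d) + ∑ (M ∸ N) (λ i → (g ^ˢ (N ℕ.+ i)) n d)
        ≡⟨ ∑-split N (M ∸ N) (λ k → (g ^ˢ k) n d) ⟨
      ∑ (N ℕ.+ (M ∸ N)) (λ k → (g ^ˢ k) n d)
        ≡⟨ cong (λ x → ∑ x (λ k → (g ^ˢ k) n d)) (ℕP.m+[n∸m]≡n n+d<M) ⟩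
      ∑ˢ M (g ^ˢ_) n d ∎
      where
      open ≡-Reasoning
      N : ℕ
      N = suc (n ℕ.+ d)

    -- The truncated geometric series telescopes: (∑_{k<M} g^k) (1 - g) = 1 - g^M.
    inv-inverseˡ : inv f ⊛ f ≈ 𝟙
    inv-inverseˡ n d = begin
      (inv f ⊛ f) n d
        ≡⟨ ⊛-coeff-congˡ f n d (λ i j i≤n j≤d → inv-truncate M i j (s≤s (ℕP.+-mono-≤ i≤n j≤d))) ⟩
      (P ⊛ f) n d
        ≡⟨ ⊛-cong {P} {P} {f} {𝟙 ⊕ negˢ g} (λ _ _ → refl) f≈1-g n d ⟩
      (P ⊛ (𝟙 ⊕ negˢ g)) n d
        ≡⟨ ⊛-distribˡ P 𝟙 (negˢ g) n d ⟩
      (P ⊛ 𝟙) n d + (P ⊛ negˢ g) n d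
        ≡⟨ cong₂ _+_ (trans (⊛-comm P 𝟙 n d) (⊛-identityˡ P n d)) (⊛-negʳ P g n d) ⟩
      P n d - (P ⊛ g) n d
        ≡⟨ cong (λ x → P n d - x) (trans (∑ˢ-⊛ M (g ^ˢ_) g n d) (∑-ext M (λ k → ⊛-comm (g ^ˢ k) g n d))) ⟩
      ∑ M (λ k → (g ^ˢ k) n d) - ∑ M (λ k → (g ^ˢ suc k) n d)
        ≡⟨ ∑-telescope M (λ k → (g ^ˢ k) n d) ⟩
      𝟙 n d - (g ^ˢ M) n d
        ≡⟨ cong (λ x → 𝟙 n d - x) (^ˢ-vanish g g00 M n d ℕP.≤-refl) ⟩
      𝟙 n d - 0ℤ
        ≡⟨ ℤP.+-identityʳ _ ⟩
      𝟙 n d ∎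
      where
      open ≡-Reasoning
      M : ℕ
      M = suc (n ℕ.+ d)
      P : Series
      P = ∑ˢ M (g ^ˢ_)
      f≈1-g : f ≈ 𝟙 ⊕ negˢ g
      f≈1-g i j = solve 2 (λ a b → b := a :+ (:- (a :- b))) refl (𝟙 i j) (f i j)

module SeriesRing where

  open import Data.Nat as ℕ using (suc)
  open import Data.Integer using (ℤ; _+_; _*_; -_; 0ℤ; 1ℤ)
  import Data.Integer.Properties as ℤP
  open import Data.Maybe using (Maybe; just; nothing)
  open import Relation.Nullary using (yes; no)
  open import Relation.Binary.PropositionalEquality
  open import Relation.Binary.Structures using (IsEquivalence)
  open import Algebra.Bundles using (CommutativeRing; RawRing)
  open import Data.Product using (_,_)
  open import Data.Bool using (true; false; if_then_else_; _∧_)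
  import Relation.Binary.Reasoning.Setoid as SetoidReasoning
  import Algebra.Solver.Ring.AlmostCommutativeRing as ACR
  open import Defs
  open FiniteSum
  open PowerSeries

  ≈-isEquivalence : IsEquivalence _≈_
  ≈-isEquivalence = record
    { refl = λ _ _ → refl
    ; sym = λ p n d → sym (p n d)
    ; trans = λ p q n d → trans (p n d) (q n d) }

  ⊛-distribʳ : ∀ f g h → (g ⊕ h) ⊛ f ≈ (g ⊛ f) ⊕ (h ⊛ f)
  ⊛-distribʳ f g h n d = trans (⊛-comm (g ⊕ h) f n d) (trans (⊛-distribˡ f g h n d)
    (cong₂ _+_ (⊛-comm f g n d) (⊛-comm f h n d)))

  seriesRing : CommutativeRing _ _
  seriesRing = record
    { Carrier = Series
    ; _≈_ = _≈_
    ; _+_ = _⊕_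
    ; _*_ = _⊛_
    ; -_ = negˢ
    ; 0# = 0ˢ
    ; 1# = 𝟙
    ; isCommutativeRing = record
      { isRing = record
        { +-isAbelianGroup = record
          { isGroup = record
            { isMonoid = record
              { isSemigroup = record
                { isMagma = record
                  { isEquivalence = ≈-isEquivalence
                  ; ∙-cong = λ {f} {f′} {g} {g′} → ⊕-cong {f} {f′} {g} {g′} }
                ; assoc = λ f g h n d → ℤP.+-assoc (f n d) (g n d) (h n d) }
              ; identity = (λ f n d → ℤP.+-identityˡ (f n d)) , (λ f n d → ℤP.+-identityʳ (f n d)) }
            ; inverse = (λ f n d → ℤP.+-inverseˡ (f n d)) , (λ f n d → ℤP.+-inverseʳ (f n d))
            ; ⁻¹-cong = λ p n d → cong -_ (p n d) }
          ; comm = λ f g n d → ℤP.+-comm (f n d) (g n d) }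
        ; *-cong = λ {f} {f′} {g} {g′} → ⊛-cong {f} {f′} {g} {g′}
        ; *-assoc = ⊛-assoc
        ; *-identity = ⊛-identityˡ , (λ f n d → trans (⊛-comm f 𝟙 n d) (⊛-identityˡ f n d))
        ; distrib = ⊛-distribˡ , ⊛-distribʳ }
      ; *-comm = ⊛-comm } }

  scale : ℤ → Series → Series
  scale c f n d = c * f n d

  scale-⊛ : ∀ c f g → scale c f ⊛ g ≈ scale c (f ⊛ g)
  scale-⊛ c f g n d = trans (⊛-coeff (scale c f) g n d) (trans
    (∑-ext (suc n) (λ i → trans (∑-ext (suc d) (λ j → ℤP.*-assoc c (f i j) _)) (∑-*ˡ (suc d) c _)))
    (trans (∑-*ˡ (suc n) c _) (cong (c *_) (sym (⊛-coeff f g n d)))))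

  const : ℤ → Series
  const c n d = if (n ℕ.≡ᵇ 0) ∧ (d ℕ.≡ᵇ 0) then c else 0ℤ

  const≈ : ∀ c → const c ≈ scale c 𝟙
  const≈ c n d with (n ℕ.≡ᵇ 0) ∧ (d ℕ.≡ᵇ 0)
  ... | true = sym (ℤP.*-identityʳ c)
  ... | false = sym (ℤP.*-zeroʳ c)

  const-+ : ∀ a b → const (a + b) ≈ const a ⊕ const b
  const-+ a b n d with (n ℕ.≡ᵇ 0) ∧ (d ℕ.≡ᵇ 0)
  ... | true = refl
  ... | false = refl

  const-neg : ∀ a → const (- a) ≈ negˢ (const a)
  const-neg a n d with (n ℕ.≡ᵇ 0) ∧ (d ℕ.≡ᵇ 0)
  ... | true = refl
  ... | false = refl

  seriesACR : ACR.AlmostCommutativeRing _ _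
  seriesACR = ACR.fromCommutativeRing seriesRing

  ℤ-rawRing : RawRing _ _
  ℤ-rawRing = CommutativeRing.rawRing ℤP.+-*-commutativeRing

  const-* : ∀ a b → const (a * b) ≈ const a ⊛ const b
  const-* a b n d = begin
    const (a * b) n d               ≡⟨ const≈ (a * b) n d ⟩
    a * b * 𝟙 n d                   ≡⟨ ℤP.*-assoc a b (𝟙 n d) ⟩
    a * (b * 𝟙 n d)                 ≡⟨ cong (a *_) (trans (⊛-identityˡ (const b) n d) (const≈ b n d)) ⟨
    a * (𝟙 ⊛ const b) n d           ≡⟨ scale-⊛ a 𝟙 (const b) n d ⟨
    (scale a 𝟙 ⊛ const b) n d       ≡⟨ ⊛-cong {const a} {scale a 𝟙} {const b} {const b} (const≈ a) (λ _ _ → refl) n d ⟨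
    (const a ⊛ const b) n d         ∎
    where open ≡-Reasoning

  const-morphism : ℤ-rawRing ACR.-Raw-AlmostCommutative⟶ seriesACR
  const-morphism = record
    { ⟦_⟧ = const
    ; +-homo = const-+
    ; *-homo = const-*
    ; -‿homo = const-neg
    ; 0-homo = const≈ 0ℤ
    ; 1-homo = λ _ _ → refl }

  const-≟ : ∀ (a b : ℤ) → Maybe (const a ≈ const b)
  const-≟ a b with a ℤP.≟ b
  ... | yes refl = just (λ _ _ → refl)
  ... | no _ = nothing

  open import Algebra.Solver.Ring ℤ-rawRing seriesACR const-morphism const-≟ public

  ⊛-coeff-00 : ∀ f g → (f ⊛ g) 0 0 ≡ f 0 0 * g 0 0
  ⊛-coeff-00 f g = trans (⊛-coeff f g 0 0) (trans (∑-1 _) (∑-1 _))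

  inverse-unique : ∀ x y y′ → x ⊛ y ≈ 𝟙 → x ⊛ y′ ≈ 𝟙 → y ≈ y′
  inverse-unique x y y′ xy≈1 xy′≈1 = begin
    y              ≈⟨ solve 1 (λ a → a := a :* con 1ℤ) (λ _ _ → refl) y ⟩
    y ⊛ 𝟙          ≈⟨ ⊛-cong {y} {y} (λ _ _ → refl) (≈-sym xy′≈1) ⟩
    y ⊛ (x ⊛ y′)   ≈⟨ solve 3 (λ a b c → b :* (a :* c) := (a :* b) :* c) (λ _ _ → refl) x y y′ ⟩
    (x ⊛ y) ⊛ y′   ≈⟨ ⊛-cong {x ⊛ y} {𝟙} {y′} {y′} xy≈1 (λ _ _ → refl) ⟩
    𝟙 ⊛ y′         ≈⟨ ⊛-identityˡ y′ ⟩
    y′             ∎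
    where
    open SetoidReasoning (CommutativeRing.setoid seriesRing)
    ≈-sym : ∀ {f g} → f ≈ g → g ≈ f
    ≈-sym p n d = sym (p n d)

  inv-inverseʳ : ∀ f → f 0 0 ≡ 1ℤ → f ⊛ inv f ≈ 𝟙
  inv-inverseʳ f f00 n d = trans (⊛-comm f (inv f) n d) (inv-inverseˡ f f00 n d)

module FunctionalEquations where

  open import Data.Nat as ℕ using (ℕ; _≤_)
  open import Data.Integer using (_+_; _*_; _-_; 0ℤ; 1ℤ)
  import Data.Nat.Properties as ℕP
  open import Relation.Binary.PropositionalEquality as ≡ using (_≡_)
  open import Algebra.Bundles using (CommutativeRing)
  import Relation.Binary.Reasoning.Setoid as SetoidReasoning
  open import Defs
  open PowerSeries
  open SeriesRing

  -- With E = 1 - zu - u²T, the denominator of RHS factors as (1 - zu) (1 - z² + z²ʳ) E,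
  -- and both W and RHS equal (z + uT) / E.
  module _ (r : ℕ) (1≤r : 1 ≤ r) (S T W : Series)
    (T-equation : T ⊛ (𝟙 ⊖ Z ⊛ Z ⊕ mono (r ℕ.+ r) 0) ≈ mono (r ℕ.+ r) 0 ⊛ (S ⊖ 𝟙))
    (W-equation : W ≈ Z ⊛ U ⊛ W ⊕ U ⊛ U ⊛ T ⊛ W ⊕ Z ⊕ U ⊛ T)
    (T00 : T 0 0 ≡ 0ℤ)
    where

    private
      open CommutativeRing seriesRing using (setoid) renaming (refl to ≈-refl; sym to ≈-sym; trans to ≈-trans)
      open SetoidReasoning setoid

      z²ʳ A B E D : Series
      z²ʳ = mono (r ℕ.+ r) 0
      A = 𝟙 ⊖ Z ⊛ U
      B = 𝟙 ⊖ Z ⊛ Z ⊕ z²ʳ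
      E = 𝟙 ⊖ Z ⊛ U ⊖ U ⊛ U ⊛ T
      D = (𝟙 ⊖ Z ⊛ U) ⊛ (𝟙 ⊖ Z ⊛ U) ⊛ (𝟙 ⊖ Z ⊛ Z ⊕ z²ʳ)
          ⊖ (𝟙 ⊖ Z ⊛ U) ⊛ U ⊛ U ⊛ z²ʳ ⊛ (S ⊖ 𝟙)

      A00 : A 0 0 ≡ 1ℤ
      A00 = ≡.cong (λ x → 1ℤ - x) (⊛-coeff-00 Z U)

      B00 : B 0 0 ≡ 1ℤ
      B00 = ≡.cong₂ (λ x y → 1ℤ - x + y) (⊛-coeff-00 Z Z)
              (mono-missˡ (r ℕ.+ r) 0 0 0 (ℕP.<⇒≢ (ℕP.≤-trans 1≤r (ℕP.m≤m+n r r))))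

      E00 : E 0 0 ≡ 1ℤ
      E00 = ≡.cong₂ (λ x y → 1ℤ - x - y) (⊛-coeff-00 Z U)
              (≡.trans (⊛-coeff-00 (U ⊛ U) T) (≡.cong ((U ⊛ U) 0 0 *_) T00))

      D-factorises : D ≈ A ⊛ B ⊛ E
      D-factorises = begin
        D
          ≈⟨ solve 6 (λ a b u z s t → a :* a :* b :- a :* u :* u :* z :* s := a :* a :* b :- a :* u :* u :* (z :* s))
               (λ _ _ → ≡.refl) A B U z²ʳ (S ⊖ 𝟙) T ⟩
        A ⊛ A ⊛ B ⊖ A ⊛ U ⊛ U ⊛ (z²ʳ ⊛ (S ⊖ 𝟙))
          ≈⟨ (λ n d → ≡.cong (λ x → (A ⊛ A ⊛ B) n d - x) (⊛-cong {A ⊛ U ⊛ U} ≈-refl (≈-sym T-equation) n d)) ⟩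
        A ⊛ A ⊛ B ⊖ A ⊛ U ⊛ U ⊛ (T ⊛ B)
          ≈⟨ solve 4 (λ z u t b → (con 1ℤ :- z :* u) :* (con 1ℤ :- z :* u) :* b :- (con 1ℤ :- z :* u) :* u :* u :* (t :* b)
                                  := (con 1ℤ :- z :* u) :* b :* (con 1ℤ :- z :* u :- u :* u :* t))
               (λ _ _ → ≡.refl) Z U T B ⟩
        A ⊛ B ⊛ E ∎

      A⊛A⁻¹ : A ⊛ inv A ≈ 𝟙
      A⊛A⁻¹ = inv-inverseʳ A A00
      B⊛B⁻¹ : B ⊛ inv B ≈ 𝟙
      B⊛B⁻¹ = inv-inverseʳ B B00
      E⊛E⁻¹ : E ⊛ inv E ≈ 𝟙
      E⊛E⁻¹ = inv-inverseʳ E E00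

      D00 : D 0 0 ≡ 1ℤ
      D00 = ≡.trans (D-factorises 0 0) (≡.trans (⊛-coeff-00 (A ⊛ B) E)
              (≡.cong₂ _*_ (≡.trans (⊛-coeff-00 A B) (≡.cong₂ _*_ A00 B00)) E00))

      D⁻¹-factorises : inv D ≈ inv A ⊛ inv B ⊛ inv E
      D⁻¹-factorises = inverse-unique D (inv D) (inv A ⊛ inv B ⊛ inv E) (inv-inverseʳ D D00) (begin
        D ⊛ (inv A ⊛ inv B ⊛ inv E)
          ≈⟨ ⊛-cong {D} {A ⊛ B ⊛ E} {inv A ⊛ inv B ⊛ inv E} D-factorises ≈-refl ⟩
        A ⊛ B ⊛ E ⊛ (inv A ⊛ inv B ⊛ inv E)
          ≈⟨ solve 6 (λ a b e x y z → a :* b :* e :* (x :* y :* z) := (a :* x) :* (b :* y) :* (e :* z))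
               (λ _ _ → ≡.refl) A B E (inv A) (inv B) (inv E) ⟩
        (A ⊛ inv A) ⊛ (B ⊛ inv B) ⊛ (E ⊛ inv E)
          ≈⟨ ⊛-cong {(A ⊛ inv A) ⊛ (B ⊛ inv B)} {𝟙 ⊛ 𝟙} (⊛-cong {A ⊛ inv A} {𝟙} {B ⊛ inv B} {𝟙} A⊛A⁻¹ B⊛B⁻¹) E⊛E⁻¹ ⟩
        𝟙 ⊛ 𝟙 ⊛ 𝟙
          ≈⟨ solve 0 (con 1ℤ :* con 1ℤ :* con 1ℤ := con 1ℤ) (λ _ _ → ≡.refl) ⟩
        𝟙 ∎)

      W⊛E : W ⊛ E ≈ Z ⊕ U ⊛ T
      W⊛E = begin
        W ⊛ E
          ≈⟨ solve 4 (λ w z u t → w :* (con 1ℤ :- z :* u :- u :* u :* t) := w :- z :* u :* w :- u :* u :* t :* w)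
               (λ _ _ → ≡.refl) W Z U T ⟩
        W ⊖ Z ⊛ U ⊛ W ⊖ U ⊛ U ⊛ T ⊛ W
          ≈⟨ (λ n d → ≡.cong (λ x → x - (Z ⊛ U ⊛ W) n d - (U ⊛ U ⊛ T ⊛ W) n d) (W-equation n d)) ⟩
        (Z ⊛ U ⊛ W ⊕ U ⊛ U ⊛ T ⊛ W ⊕ Z ⊕ U ⊛ T) ⊖ Z ⊛ U ⊛ W ⊖ U ⊛ U ⊛ T ⊛ W
          ≈⟨ solve 4 (λ w z u t → (z :* u :* w :+ u :* u :* t :* w :+ z :+ u :* t) :- z :* u :* w :- u :* u :* t :* w
                                  := z :+ u :* t) (λ _ _ → ≡.refl) W Z U T ⟩
        Z ⊕ U ⊛ T ∎

      W≈ : W ≈ (Z ⊕ U ⊛ T) ⊛ inv E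
      W≈ = begin
        W                        ≈⟨ solve 1 (λ w → w := w :* con 1ℤ) (λ _ _ → ≡.refl) W ⟩
        W ⊛ 𝟙                    ≈⟨ ⊛-cong {W} {W} ≈-refl (≈-sym E⊛E⁻¹) ⟩
        W ⊛ (E ⊛ inv E)          ≈⟨ solve 3 (λ w e i → w :* (e :* i) := (w :* e) :* i) (λ _ _ → ≡.refl) W E (inv E) ⟩
        (W ⊛ E) ⊛ inv E          ≈⟨ ⊛-cong {W ⊛ E} {Z ⊕ U ⊛ T} {inv E} {inv E} W⊛E ≈-refl ⟩
        (Z ⊕ U ⊛ T) ⊛ inv E      ∎

      RHS≈ : RHS r S ≈ (Z ⊕ U ⊛ T) ⊛ inv E
      RHS≈ = begin
        (U ⊛ z²ʳ ⊛ (S ⊖ 𝟙)) ⊛ inv D ⊕ Z ⊛ inv A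
          ≈⟨ ⊕-cong {(U ⊛ z²ʳ ⊛ (S ⊖ 𝟙)) ⊛ inv D} {(U ⊛ (T ⊛ B)) ⊛ (inv A ⊛ inv B ⊛ inv E)} {Z ⊛ inv A} {Z ⊛ inv A}
               (⊛-cong {U ⊛ z²ʳ ⊛ (S ⊖ 𝟙)} {U ⊛ (T ⊛ B)} {inv D} {inv A ⊛ inv B ⊛ inv E}
                 (≈-trans (solve 3 (λ u z s → u :* z :* s := u :* (z :* s)) (λ _ _ → ≡.refl) U z²ʳ (S ⊖ 𝟙))
                          (⊛-cong {U} {U} ≈-refl (≈-sym T-equation)))
                 D⁻¹-factorises) ≈-refl ⟩
        (U ⊛ (T ⊛ B)) ⊛ (inv A ⊛ inv B ⊛ inv E) ⊕ Z ⊛ inv A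
          ≈⟨ solve 7 (λ u t b ia ib ie z → (u :* (t :* b)) :* (ia :* ib :* ie) :+ z :* ia
                                          := u :* t :* ia :* ie :* (b :* ib) :+ z :* ia :* con 1ℤ)
               (λ _ _ → ≡.refl) U T B (inv A) (inv B) (inv E) Z ⟩
        U ⊛ T ⊛ inv A ⊛ inv E ⊛ (B ⊛ inv B) ⊕ Z ⊛ inv A ⊛ 𝟙
          ≈⟨ ⊕-cong {U ⊛ T ⊛ inv A ⊛ inv E ⊛ (B ⊛ inv B)} {U ⊛ T ⊛ inv A ⊛ inv E ⊛ 𝟙}
                    {Z ⊛ inv A ⊛ 𝟙} {Z ⊛ inv A ⊛ (E ⊛ inv E)}
               (⊛-cong {U ⊛ T ⊛ inv A ⊛ inv E} ≈-refl B⊛B⁻¹) (⊛-cong {Z ⊛ inv A} ≈-refl (≈-sym E⊛E⁻¹)) ⟩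
        U ⊛ T ⊛ inv A ⊛ inv E ⊛ 𝟙 ⊕ Z ⊛ inv A ⊛ (E ⊛ inv E)
          ≈⟨ solve 5 (λ u t z ia ie → u :* t :* ia :* ie :* con 1ℤ :+ z :* ia :* ((con 1ℤ :- z :* u :- u :* u :* t) :* ie)
                                     := ((con 1ℤ :- z :* u) :* ia) :* ((z :+ u :* t) :* ie))
               (λ _ _ → ≡.refl) U T Z (inv A) (inv E) ⟩
        (A ⊛ inv A) ⊛ ((Z ⊕ U ⊛ T) ⊛ inv E)
          ≈⟨ ⊛-cong {A ⊛ inv A} {𝟙} {(Z ⊕ U ⊛ T) ⊛ inv E} {(Z ⊕ U ⊛ T) ⊛ inv E} A⊛A⁻¹ ≈-refl ⟩
        𝟙 ⊛ ((Z ⊕ U ⊛ T) ⊛ inv E)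
          ≈⟨ ⊛-identityˡ ((Z ⊕ U ⊛ T) ⊛ inv E) ⟩
        (Z ⊕ U ⊛ T) ⊛ inv E ∎

    W≈RHS : W ≈ RHS r S
    W≈RHS = CommutativeRing.trans seriesRing W≈ (CommutativeRing.sym seriesRing RHS≈)

module Counting where

  open import Data.Nat as ℕ using (ℕ; zero; suc; _<_; _≤_; z≤n; s≤s)
  import Data.Nat.Properties as ℕP
  open import Data.Integer using (ℤ; +_; _+_; _*_; 0ℤ; 1ℤ)
  import Data.Integer.Properties as ℤP
  open import Data.List using
      (List; []; _∷_; [_]; map; length; filter; concatMap; concat; allFin; cartesianProductWith; cartesianProduct; _++_)
  import Data.List.Properties as LP
  open import Data.List.Membership.Propositional using (_∈_)
  open import Data.List.Membership.Propositional.Properties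
  open import Data.List.Relation.Unary.Any using (here; there)
  open import Data.List.Relation.Unary.All as All using (All; []; _∷_)
  open import Data.List.Relation.Unary.Unique.Propositional using (Unique)
  import Data.List.Relation.Unary.Unique.Propositional.Properties as UP
  open import Data.List.Relation.Unary.AllPairs using ([]; _∷_)
  open import Data.Vec as Vec using (Vec)
  import Data.Vec.Properties as VP
  import Data.Maybe.Properties as MP
  open import Data.Maybe using (Maybe; just; nothing)
  open import Data.Fin using (Fin)
  import Data.Fin.Properties as FP
  open import Data.Product using (∃; _×_; _,_; proj₁; proj₂)
  open import Data.Empty using (⊥-elim)
  open import Relation.Nullary using (Dec; yes; no; ¬_)
  open import Relation.Nullary.Decidable using (¬?; _×-dec_)
  import Relation.Nullary.Decidable
  open import Relation.Unary using (Pred; Decidable)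
  open import Relation.Binary.Definitions using (DecidableEquality)
  open import Relation.Binary.PropositionalEquality
  open import Level using (0ℓ)
  open import Defs using (count; allVecs; structs; Struct)
  open FiniteSum

  record Enumeration (A : Set) : Set where
    field
      elements : List A
      unique : Unique elements
      complete : ∀ a → a ∈ elements
      decEq : DecidableEquality A
  open Enumeration public

  length-filter-≢-< : ∀ {B : Set} (_≟_ : DecidableEquality B) x (l : List B) → x ∈ l → length (filter (λ y → ¬? (y ≟ x)) l) < length l
  length-filter-≢-< _≟_ x (y ∷ l) (here refl) with y ≟ y
  ... | yes _ = s≤s (LP.length-filter _ l)
  ... | no n = ⊥-elim (n refl)
  length-filter-≢-< _≟_ x (y ∷ l) (there m) with y ≟ x
  ... | yes _ = ℕP.<-trans (length-filter-≢-< _≟_ x l m) (ℕP.n<1+n _)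
  ... | no _ = s≤s (length-filter-≢-< _≟_ x l m)

  Unique-⊆⇒length-≤ : ∀ {B : Set} (_≟_ : DecidableEquality B) (l l' : List B) → Unique l → (∀ {x} → x ∈ l → x ∈ l') → length l ≤ length l'
  Unique-⊆⇒length-≤ _≟_ [] l' _ _ = z≤n
  Unique-⊆⇒length-≤ _≟_ (x ∷ xs) l' (x∉ ∷ u) sub =
    ℕP.<-≤-trans (s≤s (Unique-⊆⇒length-≤ _≟_ xs _ u sub'))  (length-filter-≢-< _≟_ x l' (sub (here refl)))
    where
    sub' : ∀ {y} → y ∈ xs → y ∈ filter (λ z → ¬? (z ≟ x)) l'
    sub' {y} m = ∈-filter⁺ (λ z → ¬? (z ≟ x)) (sub (there m)) (λ e → All.lookup x∉ m (sym e))

  Unique-map⁺ : ∀ {A B : Set} (f : A → B) (l : List A) → Unique l → (∀ {x y} → x ∈ l → y ∈ l → f x ≡ f y → x ≡ y) → Unique (map f l)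
  Unique-map⁺ f [] _ _ = []
  Unique-map⁺ {A} f (x ∷ l) (x∉ ∷ u) inj = aux l (λ m → m) x∉ ∷ Unique-map⁺ f l u (λ a b e → inj (there a) (there b) e)
    where
    aux : ∀ l' → (∀ {y} → y ∈ l' → y ∈ l) → All (x ≢_) l' → All (f x ≢_) (map f l')
    aux [] _ [] = []
    aux (y ∷ l') sub (x≢y ∷ rest) = (λ e → x≢y (inj (here refl) (there (sub (here refl))) e)) ∷ aux l' (λ m → sub (there m)) rest

  module _ {A B : Set} {P : Pred A 0ℓ} {Q : Pred B 0ℓ} (EA : Enumeration A) (EB : Enumeration B) (P? : Decidable P) (Q? : Decidable Q) where
    count-≤ : (f : A → B) (g : B → A) → (∀ {a} → P a → Q (f a)) → (∀ {a} → P a → g (f a) ≡ a) →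
      count P? (elements EA) ≤ count Q? (elements EB)
    count-≤ f g PQ gf = subst (_≤ length (filter Q? (elements EB))) (LP.length-map f (filter P? (elements EA)))
      (Unique-⊆⇒length-≤ (decEq EB) (map f (filter P? (elements EA))) (filter Q? (elements EB))
        (Unique-map⁺ f _ (UP.filter⁺ P? (unique EA)) inj) sub)
      where
      inj : ∀ {x y} → x ∈ filter P? (elements EA) → y ∈ filter P? (elements EA) → f x ≡ f y → x ≡ y
      inj mx my e = trans (sym (gf (proj₂ (∈-filter⁻ P? {xs = elements EA} mx))))
          (trans (cong g e) (gf (proj₂ (∈-filter⁻ P? {xs = elements EA} my))))
      sub : ∀ {z} → z ∈ map f (filter P? (elements EA)) → z ∈ filter Q? (elements EB)
      sub m with ∈-map⁻ f m
      ... | x , mx , refl = ∈-filter⁺ Q? (complete EB (f x)) (PQ (proj₂ (∈-filter⁻ P? {xs = elements EA} mx)))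

  count-bijection : ∀ {A B : Set} {P : Pred A 0ℓ} {Q : Pred B 0ℓ} (EA : Enumeration A) (EB : Enumeration B)
      (P? : Decidable P) (Q? : Decidable Q)
    (f : A → B) (g : B → A) → (∀ {a} → P a → Q (f a)) → (∀ {b} → Q b → P (g b)) →
    (∀ {a} → P a → g (f a) ≡ a) → (∀ {b} → Q b → f (g b) ≡ b) → count P? (elements EA) ≡ count Q? (elements EB)
  count-bijection EA EB P? Q? f g PQ QP gf fg = ℕP.≤-antisym (count-≤ EA EB P? Q? f g PQ gf) (count-≤ EB EA Q? P? g f QP fg)

  count-ext : ∀ {A : Set} {P Q : Pred A 0ℓ} (P? : Decidable P) (Q? : Decidable Q) → (∀ a → P a → Q a) → (∀ a → Q a → P a) →
    ∀ l → count P? l ≡ count Q? l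
  count-ext P? Q? pq qp [] = refl
  count-ext P? Q? pq qp (x ∷ l) with P? x | Q? x
  ... | yes _ | yes _ = cong suc (count-ext P? Q? pq qp l)
  ... | no _ | no _ = count-ext P? Q? pq qp l
  ... | yes p | no nq = ⊥-elim (nq (pq x p))
  ... | no np | yes q = ⊥-elim (np (qp x q))

  count-empty : ∀ {A : Set} {P : Pred A 0ℓ} (P? : Decidable P) → (∀ a → ¬ P a) → ∀ l → count P? l ≡ 0
  count-empty P? np [] = refl
  count-empty P? np (x ∷ l) with P? x
  ... | yes p = ⊥-elim (np x p)
  ... | no _ = count-empty P? np l

  count-partition : ∀ {A : Set} {P Q : Pred A 0ℓ} (P? : Decidable P) (Q? : Decidable Q) l →
    count P? l ≡ count (λ a → P? a ×-dec Q? a) l ℕ.+ count (λ a → P? a ×-dec ¬? (Q? a)) l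
  count-partition P? Q? [] = refl
  count-partition P? Q? (x ∷ l) with P? x | Q? x
  ... | yes _ | yes _ = cong suc (count-partition P? Q? l)
  ... | yes _ | no _ = trans (cong suc (count-partition P? Q? l)) (sym (ℕP.+-suc _ _))
  ... | no _ | _ = count-partition P? Q? l

  count-by-index : ∀ {A : Set} {P : Pred A 0ℓ} (Q : ℕ → Pred A 0ℓ) (P? : Decidable P) (Q? : ∀ m → Decidable (Q m)) N →
    (∀ a → P a → ∃ λ m → m < N × Q m a) → (∀ m a → m < N → Q m a → P a) → (∀ m m' a → Q m a → Q m' a → m ≡ m') →
    ∀ l → + count P? l ≡ ∑ N (λ m → + count (Q? m) l)
  count-by-index Q P? Q? N pq qp uq [] = sym (∑-zero N (λ _ _ → refl))
  count-by-index Q P? Q? N pq qp uq (x ∷ l) = trans (head-eq) (sym (trans (∑-ext N split) (∑-distrib-+ N ind (λ m → + count (Q? m) l))))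
    where
    ind : ℕ → ℤ
    ind m with Q? m x
    ... | yes _ = 1ℤ
    ... | no _ = 0ℤ
    split : ∀ m → + count (Q? m) (x ∷ l) ≡ ind m + + count (Q? m) l
    split m with Q? m x
    ... | yes _ = refl
    ... | no _ = sym (ℤP.+-identityˡ _)
    head-eq : + count P? (x ∷ l) ≡ ∑ N ind + ∑ N (λ m → + count (Q? m) l)
    head-eq with P? x
    ... | yes p with pq x p
    ...   | m0 , m0<N , qm0 = trans (cong (λ z → 1ℤ + z) (count-by-index Q P? Q? N pq qp uq l)) (cong (_+ ∑ N (λ m → + count (Q? m) l)) (sym
            (trans (∑-single N m0 ind m0<N (λ i _ i≢m0 → ind0 i i≢m0)) ind1)))
      where
      ind0 : ∀ i → i ≢ m0 → ind i ≡ 0ℤ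
      ind0 i ne with Q? i x
      ... | yes qi = ⊥-elim (ne (uq i m0 x qi qm0))
      ... | no _ = refl
      ind1 : ind m0 ≡ 1ℤ
      ind1 with Q? m0 x
      ... | yes _ = refl
      ... | no nq = ⊥-elim (nq qm0)
    head-eq | no np = trans (count-by-index Q P? Q? N pq qp uq l)
        (sym (trans (cong (_+ ∑ N (λ m → + count (Q? m) l)) (∑-zero N (λ m m<N → ind0 m m<N))) (ℤP.+-identityˡ _)))
      where
      ind0 : ∀ m → m < N → ind m ≡ 0ℤ
      ind0 m m<N with Q? m x
      ... | yes q = ⊥-elim (np (qp m x m<N q))
      ... | no _ = refl

  count-++ : ∀ {A : Set} {P : Pred A 0ℓ} (P? : Decidable P) l l' → count P? (l ++ l') ≡ count P? l ℕ.+ count P? l'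
  count-++ P? l l' = trans (cong length (LP.filter-++ P? l l')) (LP.length-++ (filter P? l))

  count-map : ∀ {A B : Set} {P : Pred B 0ℓ} (P? : Decidable P) (f : A → B) l → count P? (map f l) ≡ count (λ a → P? (f a)) l
  count-map P? f [] = refl
  count-map P? f (x ∷ l) with P? (f x)
  ... | yes _ = cong suc (count-map P? f l)
  ... | no _ = count-map P? f l

  _×?_ : ∀ {A B : Set} {P : Pred A 0ℓ} {Q : Pred B 0ℓ} → Decidable P → Decidable Q → Decidable (λ (ab : A × B) → P (proj₁ ab) × Q (proj₂ ab))
  (P? ×? Q?) (a , b) = P? a ×-dec Q? b

  count-cons-yes : ∀ {A : Set} {P : Pred A 0ℓ} (P? : Decidable P) x l → P x → count P? (x ∷ l) ≡ suc (count P? l)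
  count-cons-yes P? x l px with P? x
  ... | yes _ = refl
  ... | no n = ⊥-elim (n px)

  count-cons-no : ∀ {A : Set} {P : Pred A 0ℓ} (P? : Decidable P) x l → ¬ P x → count P? (x ∷ l) ≡ count P? l
  count-cons-no P? x l npx with P? x
  ... | yes p = ⊥-elim (npx p)
  ... | no _ = refl

  count-× : ∀ {A B : Set} {P : Pred A 0ℓ} {Q : Pred B 0ℓ} (P? : Decidable P) (Q? : Decidable Q) (la : List A) (lb : List B) →
    count (P? ×? Q?) (cartesianProduct la lb) ≡ count P? la ℕ.* count Q? lb
  count-× P? Q? [] lb = refl
  count-× {P = P} P? Q? (x ∷ la) lb = trans (count-++ (P? ×? Q?) (map (x ,_) lb) (cartesianProduct la lb))
    (trans (cong (ℕ._+ count (P? ×? Q?) (cartesianProduct la lb)) (count-map (P? ×? Q?) (x ,_) lb)) (step (P? x)))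
    where
    step : Dec (P x) → count (λ b → (P? ×? Q?) (x , b)) lb ℕ.+ count (P? ×? Q?) (cartesianProduct la lb) ≡ count P? (x ∷ la) ℕ.* count Q? lb
    step (yes px) = trans (cong₂ ℕ._+_ (count-ext (λ b → (P? ×? Q?) (x , b)) Q? (λ _ → proj₂) (λ _ q → px , q) lb) (count-× P? Q? la lb))
      (cong (ℕ._* count Q? lb) (sym (count-cons-yes P? x la px)))
    step (no npx) = trans (cong₂ ℕ._+_ (count-empty (λ b → (P? ×? Q?) (x , b)) (λ _ pq → npx (proj₁ pq)) lb) (count-× P? Q? la lb))
      (cong (ℕ._* count Q? lb) (sym (count-cons-no P? x la npx)))

  concatMap-map≡cartesianProductWith : ∀ {A B C : Set} (f : A → B → C) (xs : List A) (ys : List B) →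
    concatMap (λ x → map (f x) ys) xs ≡ cartesianProductWith f xs ys
  concatMap-map≡cartesianProductWith f [] ys = refl
  concatMap-map≡cartesianProductWith f (x ∷ xs) ys = cong (map (f x) ys ++_) (concatMap-map≡cartesianProductWith f xs ys)

  allVecs-unique : ∀ {A : Set} (xs : List A) → Unique xs → ∀ k → Unique (allVecs xs k)
  allVecs-unique xs u zero = [] ∷ []
  allVecs-unique xs u (suc k) = subst Unique (sym (concatMap-map≡cartesianProductWith Vec._∷_ xs (allVecs xs k)))
    (UP.cartesianProductWith⁺ Vec._∷_ VP.∷-injective u (allVecs-unique xs u k))

  allVecs-complete : ∀ {A : Set} (xs : List A) → (∀ a → a ∈ xs) → ∀ k (v : Vec A k) → v ∈ allVecs xs k
  allVecs-complete xs c zero Vec.[] = here refl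
  allVecs-complete xs c (suc k) (x Vec.∷ v) = subst (λ l → (x Vec.∷ v) ∈ l)
      (sym (concatMap-map≡cartesianProductWith Vec._∷_ xs (allVecs xs k)))
    (∈-cartesianProductWith⁺ Vec._∷_ (c x) (allVecs-complete xs c k v))

  partnerValues : (n : ℕ) → List (Maybe (Fin n))
  partnerValues n = nothing ∷ map just (allFin n)

  partnerValues-unique : ∀ n → Unique (partnerValues n)
  partnerValues-unique n = nothing∉ ∷ UP.map⁺ MP.just-injective (UP.allFin⁺ n)
    where
    nothing∉ : ∀ {l : List (Fin n)} → All (nothing ≢_) (map just l)
    nothing∉ {[]} = []
    nothing∉ {x ∷ l} = (λ ()) ∷ nothing∉ {l}

  partnerValues-complete : ∀ n a → a ∈ partnerValues n
  partnerValues-complete n nothing = here refl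
  partnerValues-complete n (just i) = there (∈-map⁺ just (∈-allFin i))

  structEnumeration : ∀ n → Enumeration (Struct n)
  structEnumeration n = record
    { elements = structs n
    ; unique = allVecs-unique (partnerValues n) (partnerValues-unique n) n
    ; complete = allVecs-complete (partnerValues n) (partnerValues-complete n) n
    ; decEq = VP.≡-dec (MP.≡-dec FP._≟_) }

  ×-enumeration : ∀ {A B : Set} → Enumeration A → Enumeration B → Enumeration (A × B)
  ×-enumeration EA EB = record
    { elements = cartesianProduct (elements EA) (elements EB)
    ; unique = UP.cartesianProduct⁺ (unique EA) (unique EB)
    ; complete = λ { (a , b) → ∈-cartesianProduct⁺ (complete EA a) (complete EB b) }
    ; decEq = λ { (a , b) (a' , b') → Relation.Nullary.Decidable.map′ (λ { (refl , refl) → refl }) (λ { refl → refl , refl })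
        (decEq EA a a' ×-dec decEq EB b b') } }

module PartnerFunction where

  open import Data.Nat as ℕ using (ℕ; zero; suc; _<_; _≤_; _∸_; z≤n; s≤s; _<?_)
  import Data.Nat.Properties as ℕP
  open import Data.Vec as Vec using (Vec; []; _∷_; toList)
  open import Data.Maybe as Maybe using (Maybe; just; nothing)
  import Data.Maybe.Properties as MP
  open import Data.Fin using (Fin; toℕ; fromℕ<)
  import Data.Fin.Properties as FP
  open import Data.Product using (∃; _×_; _,_)
  open import Data.Sum using (_⊎_; inj₁; inj₂)
  open import Data.Empty using (⊥; ⊥-elim)
  open import Relation.Nullary using (yes; no; ¬_)
  open import Relation.Binary.PropositionalEquality
  open import Function using (_∘_)
  open import Defs

  PartnerFn : Set
  PartnerFn = ℕ → Maybe ℕ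

  vecPartner : ∀ {m n} → Vec (Maybe (Fin m)) n → PartnerFn
  vecPartner v = nth (toList (Vec.map (Maybe.map toℕ) v))

  vecPartner-outside : ∀ {m n} (v : Vec (Maybe (Fin m)) n) k → n ≤ k → vecPartner v k ≡ nothing
  vecPartner-outside [] k _ = refl
  vecPartner-outside (x ∷ v) (suc k) (s≤s le) = vecPartner-outside v k le

  vecPartner-bounded : ∀ {m n} (v : Vec (Maybe (Fin m)) n) k j → vecPartner v k ≡ just j → j < m
  vecPartner-bounded (just i ∷ v) zero j refl = FP.toℕ<n i
  vecPartner-bounded (nothing ∷ v) zero j ()
  vecPartner-bounded (x ∷ v) (suc k) j e = vecPartner-bounded v k j e
  vecPartner-bounded [] k j ()

  vecPartner-domain : ∀ {m n} (v : Vec (Maybe (Fin m)) n) k j → vecPartner v k ≡ just j → k < n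
  vecPartner-domain [] k j ()
  vecPartner-domain (x ∷ v) zero j e = s≤s z≤n
  vecPartner-domain (x ∷ v) (suc k) j e = s≤s (vecPartner-domain v k j e)

  vecPartner-injective : ∀ {m n} (p q : Vec (Maybe (Fin m)) n) → (∀ k → k < n → vecPartner p k ≡ vecPartner q k) → p ≡ q
  vecPartner-injective [] [] _ = refl
  vecPartner-injective (x ∷ p) (y ∷ q) h =
    cong₂ _∷_ (MP.map-injective FP.toℕ-injective (h 0 (s≤s z≤n))) (vecPartner-injective p q (λ k k<n → h (suc k) (s≤s k<n)))

  toMaybeFin : (m : ℕ) → Maybe ℕ → Maybe (Fin m)
  toMaybeFin m nothing = nothing
  toMaybeFin m (just j) with j <? m
  ... | yes j<m = just (fromℕ< j<m)
  ... | no _ = nothing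

  fromPartnerFn′ : (m n : ℕ) → PartnerFn → Vec (Maybe (Fin m)) n
  fromPartnerFn′ m zero π = []
  fromPartnerFn′ m (suc n) π = toMaybeFin m (π 0) ∷ fromPartnerFn′ m n (π ∘ suc)

  fromPartnerFn : (n : ℕ) → PartnerFn → Struct n
  fromPartnerFn n = fromPartnerFn′ n n

  BoundedBy : ℕ → PartnerFn → Set
  BoundedBy m π = ∀ k j → π k ≡ just j → j < m

  vecPartner-fromPartnerFn′ : ∀ m n π → BoundedBy m π → ∀ k → k < n → vecPartner (fromPartnerFn′ m n π) k ≡ π k
  vecPartner-fromPartnerFn′ m (suc n) π b zero _ with π 0 in eq
  ... | nothing = refl
  ... | just j with j <? m
  ...   | yes j<m = cong just (FP.toℕ-fromℕ< j<m)
  ...   | no j≮m = ⊥-elim (j≮m (b 0 j eq))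
  vecPartner-fromPartnerFn′ m (suc n) π b (suc k) (s≤s k<n) = vecPartner-fromPartnerFn′ m n (π ∘ suc) (b ∘ suc) k k<n

  -- Exactly the partner functions of structures of length n (partner-fits, partner-fromPartnerFn).
  record Fits (n : ℕ) (π : PartnerFn) : Set where
    field
      outside : ∀ k → n ≤ k → π k ≡ nothing
      bounded : BoundedBy n π
  open Fits public

  fits-domain : ∀ {n π} → Fits n π → ∀ {k j} → π k ≡ just j → k < n
  fits-domain {n} fits {k} e with k <? n
  ... | yes k<n = k<n
  ... | no k≮n with () ← trans (sym (outside fits k (ℕP.≮⇒≥ k≮n))) e

  partner-fits : ∀ {n} (p : Struct n) → Fits n (partner p)
  partner-fits p = record { outside = vecPartner-outside p ; bounded = vecPartner-bounded p }

  partner-fromPartnerFn : ∀ n π → Fits n π → ∀ k → partner (fromPartnerFn n π) k ≡ π k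
  partner-fromPartnerFn n π fits k with k <? n
  ... | yes k<n = vecPartner-fromPartnerFn′ n n π (bounded fits) k k<n
  ... | no k≮n = trans (vecPartner-outside (fromPartnerFn n π) k (ℕP.≮⇒≥ k≮n)) (sym (outside fits k (ℕP.≮⇒≥ k≮n)))

  -- The predicates of Defs for partner functions; at π = partner p they agree with those of Defs definitionally.

  Arcᶠ : PartnerFn → ℕ → ℕ → Set
  Arcᶠ π a b = a < b × π a ≡ just b

  IsDiagramᶠ : PartnerFn → Set
  IsDiagramᶠ π = ∀ a b → π a ≡ just b → π b ≡ just a × (suc a < b ⊎ suc b < a)

  NonCrossingᶠ : PartnerFn → Set
  NonCrossingᶠ π = ∀ a b c d → Arcᶠ π a b → Arcᶠ π c d → a < c → c < b → b < d → ⊥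

  SecondaryStructureᶠ : PartnerFn → Set
  SecondaryStructureᶠ π = IsDiagramᶠ π × NonCrossingᶠ π

  Canonicalᶠ : ℕ → PartnerFn → Set
  Canonicalᶠ r π = ∀ a b → Arcᶠ π a b → ¬ (∃ λ a′ → a ≡ suc a′ × Arcᶠ π a′ (suc b)) →
    ∀ t → t < r → Arcᶠ π (a ℕ.+ t) (b ∸ t)

  RCanonicalᶠ : ℕ → PartnerFn → Set
  RCanonicalᶠ r π = SecondaryStructureᶠ π × Canonicalᶠ r π

  Arcᶠ-≗ : ∀ {π π'} → π ≗ π' → ∀ {a b} → Arcᶠ π a b → Arcᶠ π' a b
  Arcᶠ-≗ e (lt , eq) = lt , trans (sym (e _)) eq

  SecondaryStructureᶠ-≗ : ∀ {π π'} → π ≗ π' → SecondaryStructureᶠ π → SecondaryStructureᶠ π'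
  SecondaryStructureᶠ-≗ e (dia , nc) =
    (λ a b eq → let (x , y) = dia a b (trans (e a) eq) in trans (sym (e b)) x , y) ,
    (λ a b c d ab cd → nc a b c d (Arcᶠ-≗ (λ k → sym (e k)) ab) (Arcᶠ-≗ (λ k → sym (e k)) cd))

  Canonicalᶠ-≗ : ∀ {r π π'} → π ≗ π' → Canonicalᶠ r π → Canonicalᶠ r π'
  Canonicalᶠ-≗ e can a b ab outermost t t<r =
    Arcᶠ-≗ e (can a b (Arcᶠ-≗ (λ k → sym (e k)) ab) (λ { (a′ , eq , arc) → outermost (a′ , eq , Arcᶠ-≗ e arc) }) t t<r)

  RCanonicalᶠ-≗ : ∀ {r π π'} → π ≗ π' → RCanonicalᶠ r π → RCanonicalᶠ r π'
  RCanonicalᶠ-≗ e (ss , can) = SecondaryStructureᶠ-≗ e ss , Canonicalᶠ-≗ e can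

  Edgeᶠ : ℕ → PartnerFn → ℕ → ℕ → Set
  Edgeᶠ n π a b = (suc a ≡ b × b < n) ⊎ (suc b ≡ a × a < n) ⊎ Arcᶠ π a b ⊎ Arcᶠ π b a

  data Walkᶠ (n : ℕ) (π : PartnerFn) : ℕ → ℕ → ℕ → Set where
    here : ∀ {a} → a < n → Walkᶠ n π 0 a a
    step : ∀ {k a b c} → Edgeᶠ n π a b → Walkᶠ n π k b c → Walkᶠ n π (suc k) a c

  Distanceᶠ : ℕ → PartnerFn → ℕ → Set
  Distanceᶠ n π d = Walkᶠ n π d 0 (n ∸ 1) × (∀ k → Walkᶠ n π k 0 (n ∸ 1) → d ≤ k)

  toWalkᶠ : ∀ {n} (p : Struct n) {k a c} → Walk p k a c → Walkᶠ n (partner p) k a c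
  toWalkᶠ p (here x) = here x
  toWalkᶠ p (step e w) = step e (toWalkᶠ p w)

  fromWalkᶠ : ∀ {n} (p : Struct n) {k a c} → Walkᶠ n (partner p) k a c → Walk p k a c
  fromWalkᶠ p (here x) = here x
  fromWalkᶠ p (step e w) = step e (fromWalkᶠ p w)

  Edgeᶠ-≗ : ∀ {n π π'} → π ≗ π' → ∀ {a b} → Edgeᶠ n π a b → Edgeᶠ n π' a b
  Edgeᶠ-≗ e (inj₁ x) = inj₁ x
  Edgeᶠ-≗ e (inj₂ (inj₁ x)) = inj₂ (inj₁ x)
  Edgeᶠ-≗ e (inj₂ (inj₂ (inj₁ x))) = inj₂ (inj₂ (inj₁ (Arcᶠ-≗ e x)))
  Edgeᶠ-≗ e (inj₂ (inj₂ (inj₂ x))) = inj₂ (inj₂ (inj₂ (Arcᶠ-≗ e x)))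

  Walkᶠ-≗ : ∀ {n π π'} → π ≗ π' → ∀ {k a c} → Walkᶠ n π k a c → Walkᶠ n π' k a c
  Walkᶠ-≗ e (here x) = here x
  Walkᶠ-≗ e (step ed w) = step (Edgeᶠ-≗ e ed) (Walkᶠ-≗ e w)

  Distanceᶠ-≗ : ∀ {n π π' d} → π ≗ π' → Distanceᶠ n π d → Distanceᶠ n π' d
  Distanceᶠ-≗ e (w , m) = Walkᶠ-≗ e w , (λ k w' → m k (Walkᶠ-≗ (λ x → sym (e x)) w'))

  toDistanceᶠ : ∀ {n} (p : Struct n) {d} → Distance p d → Distanceᶠ n (partner p) d
  toDistanceᶠ p (w , m) = toWalkᶠ p w , (λ k w' → m k (fromWalkᶠ p w'))

  fromDistanceᶠ : ∀ {n} (p : Struct n) {d} → Distanceᶠ n (partner p) d → Distance p d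
  fromDistanceᶠ p (w , m) = fromWalkᶠ p w , (λ k w' → m k (toWalkᶠ p w'))

  walk-++ : ∀ {n π k k' a b c} → Walkᶠ n π k a b → Walkᶠ n π k' b c → Walkᶠ n π (k ℕ.+ k') a c
  walk-++ (here x) w' = w'
  walk-++ (step e w) w' = step e (walk-++ w w')

module Concatenation where

  open import Data.Nat as ℕ using (ℕ; zero; suc; _<_; _≤_; _∸_; z≤n; s≤s; _<?_)
  import Data.Nat.Properties as ℕP
  open import Data.Maybe as Maybe using (Maybe; just; nothing)
  import Data.Maybe.Properties as MP
  open import Data.Product using (∃; _×_; _,_; proj₁; proj₂)
  open import Data.Sum using (_⊎_; inj₁; inj₂)
  open import Data.Empty using (⊥; ⊥-elim)
  open import Relation.Nullary using (yes; no; ¬_)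
  open import Relation.Binary.PropositionalEquality
  open PartnerFunction

  concatᶠ : ℕ → PartnerFn → PartnerFn → PartnerFn
  concatᶠ m π1 π2 k with k <? m
  ... | yes _ = π1 k
  ... | no _ = Maybe.map (m ℕ.+_) (π2 (k ∸ m))

  concatᶠ-left : ∀ m π1 π2 k → k < m → concatᶠ m π1 π2 k ≡ π1 k
  concatᶠ-left m π1 π2 k k<m with k <? m
  ... | yes _ = refl
  ... | no k≮m = ⊥-elim (k≮m k<m)

  concatᶠ-right : ∀ m π1 π2 k → concatᶠ m π1 π2 (m ℕ.+ k) ≡ Maybe.map (m ℕ.+_) (π2 k)
  concatᶠ-right m π1 π2 k with (m ℕ.+ k) <? m
  ... | yes lt = ⊥-elim (ℕP.<-irrefl refl (ℕP.≤-<-trans (ℕP.m≤m+n m k) lt))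
  ... | no _ = cong (λ x → Maybe.map (m ℕ.+_) (π2 x)) (ℕP.m+n∸m≡n m k)

  data Position (m k : ℕ) : Set where
    before : k < m → Position m k
    after : ∀ k' → k ≡ m ℕ.+ k' → Position m k

  position : ∀ m k → Position m k
  position m k with k <? m
  ... | yes lt = before lt
  ... | no nlt = after (k ∸ m) (sym (ℕP.m+[n∸m]≡n (ℕP.≮⇒≥ nlt)))

  map-+-just⁻ : ∀ m (x : Maybe ℕ) b → Maybe.map (m ℕ.+_) x ≡ just b → ∃ λ b' → b ≡ m ℕ.+ b' × x ≡ just b'
  map-+-just⁻ m (just b') .(m ℕ.+ b') refl = b' , refl , refl

  map-+-just⁺ : ∀ m (x : Maybe ℕ) b → x ≡ just b → Maybe.map (m ℕ.+_) x ≡ just (m ℕ.+ b)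
  map-+-just⁺ m .(just b) b refl = refl

  cancelˡ-≡ : ∀ m {a b} → m ℕ.+ a ≡ m ℕ.+ b → a ≡ b
  cancelˡ-≡ m = ℕP.+-cancelˡ-≡ m _ _

  <∸⇒< : ∀ {x y t} → x < y ∸ t → t < y
  <∸⇒< {x} x<y∸t = ℕP.m∸n≢0⇒n<m (λ y∸t≡0 → ℕP.n≮0 (subst (x <_) y∸t≡0 x<y∸t))

  cancelˡ-< : ∀ m {a b} → m ℕ.+ a < m ℕ.+ b → a < b
  cancelˡ-< m = ℕP.+-cancelˡ-< m _ _

  module ConcatProperties (m l : ℕ) (π1 π2 : PartnerFn) (g1 : Fits m π1) (g2 : Fits l π2) where
    π : PartnerFn
    π = concatᶠ m π1 π2

    n : ℕ
    n = m ℕ.+ l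

    fits : Fits n π
    fits = record { outside = o ; bounded = b }
      where
      o : ∀ k → n ≤ k → π k ≡ nothing
      o k n≤k with position m k
      ... | before k<m = ⊥-elim (ℕP.<-irrefl refl (ℕP.<-≤-trans k<m (ℕP.≤-trans (ℕP.m≤m+n m l) n≤k)))
      ... | after k' refl = trans (concatᶠ-right m π1 π2 k') (cong (Maybe.map (m ℕ.+_)) (outside g2 k' (ℕP.+-cancelˡ-≤ m _ _ n≤k)))
      b : BoundedBy n π
      b k j e with position m k
      ... | before k<m = ℕP.<-≤-trans (bounded g1 k j (trans (sym (concatᶠ-left m π1 π2 k k<m)) e)) (ℕP.m≤m+n m l)
      ... | after k' refl with map-+-just⁻ m (π2 k') j (trans (sym (concatᶠ-right m π1 π2 k')) e)
      ...   | j' , refl , e2 = ℕP.+-monoʳ-< m (bounded g2 k' j' e2)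

    arc-left⁻ : ∀ {a b} → a < m → Arcᶠ π a b → Arcᶠ π1 a b
    arc-left⁻ a<m (lt , e) = lt , trans (sym (concatᶠ-left m π1 π2 _ a<m)) e
    arc-left⁺ : ∀ {a b} → Arcᶠ π1 a b → Arcᶠ π a b
    arc-left⁺ (lt , e) = lt , trans (concatᶠ-left m π1 π2 _ (fits-domain g1 e)) e
    arc-right⁻ : ∀ {a' b} → Arcᶠ π (m ℕ.+ a') b → ∃ λ b' → b ≡ m ℕ.+ b' × Arcᶠ π2 a' b'
    arc-right⁻ {a'} {b} (lt , e) with map-+-just⁻ m (π2 a') b (trans (sym (concatᶠ-right m π1 π2 a')) e)
    ... | b' , refl , e2 = b' , refl , (cancelˡ-< m lt , e2)
    arc-right⁺ : ∀ {a' b'} → Arcᶠ π2 a' b' → Arcᶠ π (m ℕ.+ a') (m ℕ.+ b')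
    arc-right⁺ {a'} {b'} (lt , e) = ℕP.+-monoʳ-< m lt , trans (concatᶠ-right m π1 π2 a') (map-+-just⁺ m (π2 a') b' e)
    arc-right⁻′ : ∀ {a' b'} → Arcᶠ π (m ℕ.+ a') (m ℕ.+ b') → Arcᶠ π2 a' b'
    arc-right⁻′ {a'} {b'} arc with arc-right⁻ arc
    ... | b'' , eq , arc2 rewrite cancelˡ-≡ m eq = arc2

    secondary⁺ : SecondaryStructureᶠ π1 → SecondaryStructureᶠ π2 → SecondaryStructureᶠ π
    secondary⁺ (dia1 , nc1) (dia2 , nc2) = dia , nc
      where
      dia : IsDiagramᶠ π
      dia a b e with position m a
      ... | before a<m with dia1 a b (trans (sym (concatᶠ-left m π1 π2 a a<m)) e)
      ...   | e' , gap = trans (concatᶠ-left m π1 π2 b (bounded g1 a b (trans (sym (concatᶠ-left m π1 π2 a a<m)) e))) e' , gap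
      dia a b e | after a' refl with map-+-just⁻ m (π2 a') b (trans (sym (concatᶠ-right m π1 π2 a')) e)
      ...   | b' , refl , e2 with dia2 a' b' e2
      ...     | e' , inj₁ gap = trans (concatᶠ-right m π1 π2 b') (map-+-just⁺ m (π2 b') a' e') , inj₁
          (subst (_< m ℕ.+ b') (ℕP.+-suc m a') (ℕP.+-monoʳ-< m gap))
      ...     | e' , inj₂ gap = trans (concatᶠ-right m π1 π2 b') (map-+-just⁺ m (π2 b') a' e') , inj₂
          (subst (_< m ℕ.+ a') (ℕP.+-suc m b') (ℕP.+-monoʳ-< m gap))
      nc : NonCrossingᶠ π
      nc a b c d ab cd a<c c<b b<d with position m a
      ... | before a<m = nc1 a b c d ab1 (arc-left⁻ c<m cd) a<c c<b b<d
        where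
        ab1 : Arcᶠ π1 a b
        ab1 = arc-left⁻ a<m ab
        c<m : c < m
        c<m = ℕP.<-trans c<b (bounded g1 a b (proj₂ ab1))
      ... | after a' refl with position m c
      ...   | before c<m = ⊥-elim (ℕP.<-irrefl refl (ℕP.<-trans (ℕP.≤-<-trans (ℕP.m≤m+n m a') a<c) c<m))
      ...   | after c' refl with arc-right⁻ ab | arc-right⁻ cd
      ...     | b' , refl , ab2 | d' , refl , cd2 = nc2 a' b' c' d' ab2 cd2 (cancelˡ-< m a<c) (cancelˡ-< m c<b) (cancelˡ-< m b<d)

    secondary⁻ : SecondaryStructureᶠ π → SecondaryStructureᶠ π1 × SecondaryStructureᶠ π2
    secondary⁻ (dia , nc) = (dia1 , nc1) , (dia2 , nc2)
      where
      dia1 : IsDiagramᶠ π1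
      dia1 a b e with dia a b (trans (concatᶠ-left m π1 π2 a (fits-domain g1 e)) e)
      ... | e' , gap = trans (sym (concatᶠ-left m π1 π2 b (bounded g1 a b e))) e' , gap
      nc1 : NonCrossingᶠ π1
      nc1 a b c d ab cd = nc a b c d (arc-left⁺ ab) (arc-left⁺ cd)
      dia2 : IsDiagramᶠ π2
      dia2 a b e with dia (m ℕ.+ a) (m ℕ.+ b) (trans (concatᶠ-right m π1 π2 a) (map-+-just⁺ m (π2 a) b e))
      ... | e' , gap with map-+-just⁻ m (π2 b) (m ℕ.+ a) (trans (sym (concatᶠ-right m π1 π2 b)) e')
      ...   | a'' , eq , e2 rewrite sym (cancelˡ-≡ m eq) = e2 , gap' gap
        where
        gap' : suc (m ℕ.+ a) < m ℕ.+ b ⊎ suc (m ℕ.+ b) < m ℕ.+ a → suc a < b ⊎ suc b < a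
        gap' (inj₁ x) = inj₁ (cancelˡ-< m (subst (_< m ℕ.+ b) (sym (ℕP.+-suc m a)) x))
        gap' (inj₂ x) = inj₂ (cancelˡ-< m (subst (_< m ℕ.+ a) (sym (ℕP.+-suc m b)) x))
      nc2 : NonCrossingᶠ π2
      nc2 a b c d ab cd a<c c<b b<d = nc _ _ _ _ (arc-right⁺ ab) (arc-right⁺ cd) (ℕP.+-monoʳ-< m a<c)
          (ℕP.+-monoʳ-< m c<b) (ℕP.+-monoʳ-< m b<d)

    canonical⁺ : ∀ {r} → Canonicalᶠ r π1 → Canonicalᶠ r π2 → Canonicalᶠ r π
    canonical⁺ can1 can2 a b ab nst t t<r with position m a
    ... | before a<m = arc-left⁺ (can1 a b (arc-left⁻ a<m ab) (λ { (a'' , eq , arc) → nst (a'' , eq , arc-left⁺ arc) }) t t<r)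
    ... | after a' refl with arc-right⁻ ab
    ...   | b' , refl , ab2 = subst₂ (Arcᶠ π) (sym (ℕP.+-assoc m a' t))
        (sym (ℕP.+-∸-assoc m {b'} {t} (ℕP.<⇒≤ (<∸⇒< (proj₁ c2))))) (arc-right⁺ c2)
      where
      nst2 : ¬ (∃ λ a'' → a' ≡ suc a'' × Arcᶠ π2 a'' (suc b'))
      nst2 (a'' , refl , arc) = nst (m ℕ.+ a'' , ℕP.+-suc m a'' , subst (Arcᶠ π (m ℕ.+ a'')) (ℕP.+-suc m b') (arc-right⁺ arc))
      c2 : Arcᶠ π2 (a' ℕ.+ t) (b' ∸ t)
      c2 = can2 a' b' ab2 nst2 t t<r

    canonical⁻ˡ : ∀ {r} → Canonicalᶠ r π → Canonicalᶠ r π1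
    canonical⁻ˡ can a b ab nst t t<r with can a b (arc-left⁺ ab)
        (λ { (a'' , refl , arc) → nst (a'' , refl , arc-left⁻ (ℕP.<-trans (ℕP.n<1+n a'') (fits-domain g1 (proj₂ ab))) arc) }) t t<r
    ... | arc with position m (a ℕ.+ t)
    ...   | before lt = arc-left⁻ lt arc
    ...   | after k' eq with arc-right⁻ (subst (λ x → Arcᶠ π x (b ∸ t)) eq arc)
    ...     | c , ceq , _ = ⊥-elim
        (ℕP.<-irrefl refl (ℕP.≤-<-trans (ℕP.≤-trans (ℕP.m≤m+n m c) (subst (_≤ b) ceq (ℕP.m∸n≤m b t))) (bounded g1 a b (proj₂ ab))))

    canonical⁻ʳ : ∀ {r} → Canonicalᶠ r π → Canonicalᶠ r π2
    canonical⁻ʳ can a' b' ab nst t t<r = result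
      where
      nstπ : ¬ (∃ λ x → m ℕ.+ a' ≡ suc x × Arcᶠ π x (suc (m ℕ.+ b')))
      nstπ (x , eq , arc) with position m x
      ... | before x<m = ℕP.<-irrefl refl
          (ℕP.<-trans (bounded g1 x _ (proj₂ (arc-left⁻ x<m arc))) (ℕP.≤-<-trans (ℕP.m≤m+n m b') (ℕP.n<1+n _)))
      ... | after x' refl = nst
          (x' , cancelˡ-≡ m (trans eq (sym (ℕP.+-suc m x'))) , arc-right⁻′ (subst (Arcᶠ π (m ℕ.+ x')) (sym (ℕP.+-suc m b')) arc))
      arc : Arcᶠ π (m ℕ.+ a' ℕ.+ t) (m ℕ.+ b' ∸ t)
      arc = can (m ℕ.+ a') (m ℕ.+ b') (arc-right⁺ ab) nstπ t t<r
      result : Arcᶠ π2 (a' ℕ.+ t) (b' ∸ t)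
      result with arc-right⁻ (subst (λ x → Arcᶠ π x ((m ℕ.+ b') ∸ t)) (ℕP.+-assoc m a' t) arc)
      ... | c , ceq , arc2 with t ℕ.≤? b'
      ...   | yes t≤b' = subst (Arcᶠ π2 (a' ℕ.+ t)) (sym (cancelˡ-≡ m (trans (sym (ℕP.+-∸-assoc m t≤b')) ceq))) arc2
      ...   | no t≰b' = ⊥-elim (ℕP.n≮0 (ℕP.<-≤-trans (proj₁ arc2) c≤0))
        where
        le1 : (m ℕ.+ b') ∸ t ≤ m
        le1 = subst ((m ℕ.+ b') ∸ t ≤_) (ℕP.m+n∸n≡m m t) (ℕP.∸-monoˡ-≤ t (ℕP.+-monoʳ-≤ m (ℕP.<⇒≤ (ℕP.≰⇒> t≰b'))))
        c≤0 : c ≤ 0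
        c≤0 = ℕP.+-cancelˡ-≤ m c 0 (subst (_≤ m ℕ.+ 0) ceq (subst ((m ℕ.+ b') ∸ t ≤_) (sym (ℕP.+-identityʳ m)) le1))

    edge-left⁺ : ∀ {a b} → Edgeᶠ m π1 a b → Edgeᶠ n π a b
    edge-left⁺ (inj₁ (e , b<m)) = inj₁ (e , ℕP.<-≤-trans b<m (ℕP.m≤m+n m l))
    edge-left⁺ (inj₂ (inj₁ (e , a<m))) = inj₂ (inj₁ (e , ℕP.<-≤-trans a<m (ℕP.m≤m+n m l)))
    edge-left⁺ (inj₂ (inj₂ (inj₁ arc))) = inj₂ (inj₂ (inj₁ (arc-left⁺ arc)))
    edge-left⁺ (inj₂ (inj₂ (inj₂ arc))) = inj₂ (inj₂ (inj₂ (arc-left⁺ arc)))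

    walk-left⁺ : ∀ {k a c} → Walkᶠ m π1 k a c → Walkᶠ n π k a c
    walk-left⁺ (here a<m) = here (ℕP.<-≤-trans a<m (ℕP.m≤m+n m l))
    walk-left⁺ (step e w) = step (edge-left⁺ e) (walk-left⁺ w)

    edge-right⁺ : ∀ {a b} → Edgeᶠ l π2 a b → Edgeᶠ n π (m ℕ.+ a) (m ℕ.+ b)
    edge-right⁺ {a} {b} (inj₁ (e , b<l)) = inj₁ (trans (sym (ℕP.+-suc m a)) (cong (m ℕ.+_) e) , ℕP.+-monoʳ-< m b<l)
    edge-right⁺ {a} {b} (inj₂ (inj₁ (e , a<l))) = inj₂ (inj₁ (trans (sym (ℕP.+-suc m b)) (cong (m ℕ.+_) e) , ℕP.+-monoʳ-< m a<l))
    edge-right⁺ (inj₂ (inj₂ (inj₁ arc))) = inj₂ (inj₂ (inj₁ (arc-right⁺ arc)))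
    edge-right⁺ (inj₂ (inj₂ (inj₂ arc))) = inj₂ (inj₂ (inj₂ (arc-right⁺ arc)))

    walk-right⁺ : ∀ {k a c} → Walkᶠ l π2 k a c → Walkᶠ n π k (m ℕ.+ a) (m ℕ.+ c)
    walk-right⁺ (here a<l) = here (ℕP.+-monoʳ-< m a<l)
    walk-right⁺ (step e w) = step (edge-right⁺ e) (walk-right⁺ w)

    edge-left⁻ : ∀ {a b} → Edgeᶠ n π a b → a < m → b < m → Edgeᶠ m π1 a b
    edge-left⁻ (inj₁ (e , _)) a<m b<m = inj₁ (e , b<m)
    edge-left⁻ (inj₂ (inj₁ (e , _))) a<m b<m = inj₂ (inj₁ (e , a<m))
    edge-left⁻ (inj₂ (inj₂ (inj₁ arc))) a<m b<m = inj₂ (inj₂ (inj₁ (arc-left⁻ a<m arc)))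
    edge-left⁻ (inj₂ (inj₂ (inj₂ arc))) a<m b<m = inj₂ (inj₂ (inj₂ (arc-left⁻ b<m arc)))

    crossing-edge : ∀ {a b'} → Edgeᶠ n π a (m ℕ.+ b') → a < m → a ≡ m ∸ 1 × b' ≡ 0
    crossing-edge {a} {b'} (inj₁ (e , _)) a<m = a≡ , b'≡
      where
      b'≡ : b' ≡ 0
      b'≡ = ℕP.n≤0⇒n≡0 (ℕP.+-cancelˡ-≤ m b' 0 (subst (_≤ m ℕ.+ 0) e (subst (suc a ≤_) (sym (ℕP.+-identityʳ m)) a<m)))
      a≡ : a ≡ m ∸ 1
      a≡ = trans (sym (ℕP.m+n∸n≡m a 1)) (cong (_∸ 1) (trans (ℕP.+-comm a 1) (trans e (trans (cong (m ℕ.+_) b'≡) (ℕP.+-identityʳ m)))))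
    crossing-edge {a} {b'} (inj₂ (inj₁ (e , _))) a<m = ⊥-elim
        (ℕP.<-irrefl refl (ℕP.<-trans (subst (_< m) (sym e) a<m) (ℕP.≤-<-trans (ℕP.m≤m+n m b') (ℕP.n<1+n _))))
    crossing-edge {a} {b'} (inj₂ (inj₂ (inj₁ arc))) a<m = ⊥-elim
        (ℕP.<-irrefl refl (ℕP.<-≤-trans (bounded g1 a _ (proj₂ (arc-left⁻ a<m arc))) (ℕP.m≤m+n m b')))
    crossing-edge {a} {b'} (inj₂ (inj₂ (inj₂ arc))) a<m = ⊥-elim
        (ℕP.<-irrefl refl (ℕP.<-trans (ℕP.≤-<-trans (ℕP.m≤m+n m b') (proj₁ arc)) a<m))

    edge-sym : ∀ {a b} → Edgeᶠ n π a b → Edgeᶠ n π b a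
    edge-sym (inj₁ x) = inj₂ (inj₁ x)
    edge-sym (inj₂ (inj₁ x)) = inj₁ x
    edge-sym (inj₂ (inj₂ (inj₁ x))) = inj₂ (inj₂ (inj₂ x))
    edge-sym (inj₂ (inj₂ (inj₂ x))) = inj₂ (inj₂ (inj₁ x))

    edge-right⁻ : ∀ {a b} → Edgeᶠ n π a b → Edgeᶠ l π2 (a ∸ m) (b ∸ m) ⊎ (a ∸ m ≡ b ∸ m)
    edge-right⁻ {a} {b} e with position m a | position m b
    ... | before a<m | before b<m = inj₂ (trans (ℕP.m≤n⇒m∸n≡0 (ℕP.<⇒≤ a<m)) (sym (ℕP.m≤n⇒m∸n≡0 (ℕP.<⇒≤ b<m))))
    ... | before a<m | after b' refl = inj₂ (trans (ℕP.m≤n⇒m∸n≡0 (ℕP.<⇒≤ a<m)) (sym (trans (ℕP.m+n∸m≡n m b') (proj₂ (crossing-edge e a<m)))))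
    ... | after a' refl | before b<m = inj₂
        (trans (trans (ℕP.m+n∸m≡n m a') (proj₂ (crossing-edge (edge-sym e) b<m))) (sym (ℕP.m≤n⇒m∸n≡0 (ℕP.<⇒≤ b<m))))
    ... | after a' refl | after b' refl rewrite ℕP.m+n∸m≡n m a' | ℕP.m+n∸m≡n m b' = inj₁ (e2 e)
      where
      e2 : Edgeᶠ n π (m ℕ.+ a') (m ℕ.+ b') → Edgeᶠ l π2 a' b'
      e2 (inj₁ (eq , lt)) = inj₁ (cancelˡ-≡ m (trans (ℕP.+-suc m a') eq) , ℕP.+-cancelˡ-< m _ _ lt)
      e2 (inj₂ (inj₁ (eq , lt))) = inj₂ (inj₁ (cancelˡ-≡ m (trans (ℕP.+-suc m b') eq) , ℕP.+-cancelˡ-< m _ _ lt))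
      e2 (inj₂ (inj₂ (inj₁ arc))) = inj₂ (inj₂ (inj₁ (arc-right⁻′ arc)))
      e2 (inj₂ (inj₂ (inj₂ arc))) = inj₂ (inj₂ (inj₂ (arc-right⁻′ arc)))

    walk-right⁻ : ∀ {k a c} → Walkᶠ n π k a c → m ≤ c → ∃ λ k' → k' ≤ k × Walkᶠ l π2 k' (a ∸ m) (c ∸ m)
    walk-right⁻ {c = c} (here c<n) m≤c = 0 , z≤n , here (ℕP.+-cancelˡ-< m _ _ (subst (_< n) (sym (ℕP.m+[n∸m]≡n m≤c)) c<n))
    walk-right⁻ {c = c} (step e w) m≤c with walk-right⁻ w m≤c | edge-right⁻ e
    ... | k' , le , w' | inj₁ e' = suc k' , s≤s le , step e' w'
    ... | k' , le , w' | inj₂ eq = k' , ℕP.m≤n⇒m≤1+n le , subst (λ x → Walkᶠ l π2 k' x (c ∸ m)) (sym eq) w'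

    split-walk : ∀ {k a c} → Walkᶠ n π k a c → a < m → m ≤ c →
      ∃ λ k1 → ∃ λ k2 → k1 ℕ.+ suc k2 ≤ k × Walkᶠ m π1 k1 a (m ∸ 1) × Walkᶠ l π2 k2 0 (c ∸ m)
    split-walk (here _) a<m m≤c = ⊥-elim (ℕP.<-irrefl refl (ℕP.<-≤-trans a<m m≤c))
    split-walk (step {b = b} e w) a<m m≤c with position m b
    ... | before b<m with split-walk w b<m m≤c
    ...   | k1 , k2 , le , w1 , w2 = suc k1 , k2 , s≤s le , step (edge-left⁻ e a<m b<m) w1 , w2
    split-walk {c = c} (step {a = a} {b = b} e w) a<m m≤c | after b' refl with crossing-edge e a<m | walk-right⁻ w m≤c
    ... | a≡ , refl | k2 , le , w2 = 0 , k2 , s≤s le , subst (λ x → Walkᶠ m π1 0 a x) a≡ (here a<m) ,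
            subst (λ x → Walkᶠ l π2 k2 x (c ∸ m)) (trans (cong (_∸ m) (ℕP.+-identityʳ m)) (ℕP.n∸n≡0 m)) w2

    module Distances (1≤m : 1 ≤ m) (1≤l : 1 ≤ l) where
      m-1<m : m ∸ 1 < m
      m-1<m = ℕP.∸-monoʳ-< (s≤s z≤n) 1≤m
      crossing : Edgeᶠ n π (m ∸ 1) (m ℕ.+ 0)
      crossing = inj₁ (trans (trans (ℕP.+-comm 1 (m ∸ 1)) (ℕP.m∸n+n≡m 1≤m)) (sym (ℕP.+-identityʳ m)) ,
                       ℕP.+-monoʳ-< m 1≤l)
      endEq : m ℕ.+ (l ∸ 1) ≡ n ∸ 1
      endEq = sym (ℕP.+-∸-assoc m 1≤l)

      joinWalks : ∀ {c k} → Walkᶠ m π1 c 0 (m ∸ 1) → Walkᶠ l π2 k 0 (l ∸ 1) → Walkᶠ n π (c ℕ.+ suc k) 0 (n ∸ 1)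
      joinWalks w1 w2 = walk-++ (walk-left⁺ w1) (step crossing (subst (Walkᶠ n π _ (m ℕ.+ 0)) endEq (walk-right⁺ w2)))

      m≤n-1 : m ≤ n ∸ 1
      m≤n-1 = subst (m ≤_) endEq (ℕP.m≤m+n m (l ∸ 1))

      n-1-m : (n ∸ 1) ∸ m ≡ l ∸ 1
      n-1-m = trans (cong (_∸ m) (sym endEq)) (ℕP.m+n∸m≡n m (l ∸ 1))

      distance⁻ : ∀ {c d} → Distanceᶠ m π1 c → Distanceᶠ n π d → ∃ λ d' → Distanceᶠ l π2 d' × d ≡ c ℕ.+ suc d'
      distance⁻ {c} {d} (w1 , min1) (w , min) with split-walk w (ℕP.<-≤-trans (s≤s z≤n) 1≤m) m≤n-1
      ... | k1 , k2 , le , v1 , v2 = k2 , (v2' , min2) , ℕP.≤-antisym (min _ (joinWalks w1 v2'))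
          (ℕP.≤-trans (ℕP.+-monoˡ-≤ (suc k2) (min1 k1 v1)) le)
        where
        v2' : Walkᶠ l π2 k2 0 (l ∸ 1)
        v2' = subst (Walkᶠ l π2 k2 0) n-1-m v2
        min2 : ∀ k' → Walkᶠ l π2 k' 0 (l ∸ 1) → k2 ≤ k'
        min2 k' w' = ℕP.≤-pred
            (ℕP.+-cancelˡ-≤ c _ _ (ℕP.≤-trans (ℕP.+-monoˡ-≤ (suc k2) (min1 k1 v1)) (ℕP.≤-trans le (min _ (joinWalks w1 w')))))

      distance⁺ : ∀ {c d'} → Distanceᶠ m π1 c → Distanceᶠ l π2 d' → Distanceᶠ n π (c ℕ.+ suc d')
      distance⁺ {c} {d'} (w1 , min1) (w2 , min2) = joinWalks w1 w2 , lower
        where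
        lower : ∀ k → Walkᶠ n π k 0 (n ∸ 1) → c ℕ.+ suc d' ≤ k
        lower k w with split-walk w (ℕP.<-≤-trans (s≤s z≤n) 1≤m) m≤n-1
        ... | k1 , k2 , le , v1 , v2 = ℕP.≤-trans (ℕP.+-mono-≤ (min1 k1 v1) (s≤s (min2 k2 (subst (Walkᶠ l π2 k2 0) n-1-m v2)))) le

  noArcs : PartnerFn
  noArcs _ = nothing

  leftPart : ℕ → PartnerFn → PartnerFn
  leftPart m π = concatᶠ m π noArcs

  rightPart : ℕ → PartnerFn → PartnerFn
  rightPart m π k = Maybe.map (_∸ m) (π (m ℕ.+ k))

  SplitsAt : ℕ → PartnerFn → Set
  SplitsAt m π = ∀ k j → π k ≡ just j → (k < m → j < m) × (m ≤ k → m ≤ j)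

  module SplitProperties (m l : ℕ) (π : PartnerFn) (g : Fits (m ℕ.+ l) π) (blk : SplitsAt m π) where
    fitsˡ : Fits m (leftPart m π)
    fitsˡ = record { outside = o ; bounded = b }
      where
      o : ∀ k → m ≤ k → leftPart m π k ≡ nothing
      o k m≤k with position m k
      ... | before k<m = ⊥-elim (ℕP.<-irrefl refl (ℕP.<-≤-trans k<m m≤k))
      ... | after k' refl = concatᶠ-right m π noArcs k'
      b : BoundedBy m (leftPart m π)
      b k j e with position m k
      ... | before k<m = proj₁ (blk k j (trans (sym (concatᶠ-left m π noArcs k k<m)) e)) k<m
      ... | after k' refl = case (trans (sym (concatᶠ-right m π noArcs k')) e)
        where case : nothing ≡ just j → j < m
              case ()

    fitsʳ : Fits l (rightPart m π)
    fitsʳ = record { outside = o ; bounded = b }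
      where
      o : ∀ k → l ≤ k → rightPart m π k ≡ nothing
      o k l≤k = cong (Maybe.map (_∸ m)) (outside g (m ℕ.+ k) (ℕP.+-monoʳ-≤ m l≤k))
      b : BoundedBy l (rightPart m π)
      b k j e with π (m ℕ.+ k) in eq
      b k j refl | just j' = ℕP.+-cancelˡ-< m _ _
          (subst (_< m ℕ.+ l) (sym (ℕP.m+[n∸m]≡n (proj₂ (blk _ j' eq) (ℕP.m≤m+n m k)))) (bounded g _ j' eq))

    concat-split : concatᶠ m (leftPart m π) (rightPart m π) ≗ π
    concat-split k with position m k
    ... | before k<m = trans (concatᶠ-left m _ _ k k<m) (concatᶠ-left m π noArcs k k<m)
    ... | after k' refl = trans (concatᶠ-right m _ _ k') helper
      where
      helper : Maybe.map (m ℕ.+_) (Maybe.map (_∸ m) (π (m ℕ.+ k'))) ≡ π (m ℕ.+ k')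
      helper with π (m ℕ.+ k') in eq
      ... | nothing = refl
      ... | just j = cong just (ℕP.m+[n∸m]≡n (proj₂ (blk _ j eq) (ℕP.m≤m+n m k')))

  leftPart-concat : ∀ m π1 π2 → Fits m π1 → leftPart m (concatᶠ m π1 π2) ≗ π1
  leftPart-concat m π1 π2 g1 k with position m k
  ... | before k<m = trans (concatᶠ-left m _ noArcs k k<m) (concatᶠ-left m π1 π2 k k<m)
  ... | after k' refl = trans (concatᶠ-right m _ noArcs k') (sym (outside g1 _ (ℕP.m≤m+n m k')))

  rightPart-concat : ∀ m π1 π2 → rightPart m (concatᶠ m π1 π2) ≗ π2
  rightPart-concat m π1 π2 k rewrite concatᶠ-right m π1 π2 k with π2 k
  ... | nothing = refl
  ... | just j = cong just (ℕP.m+n∸m≡n m j)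

  concatᶠ-≗ : ∀ m {π1 π1' π2 π2'} → π1 ≗ π1' → π2 ≗ π2' → concatᶠ m π1 π2 ≗ concatᶠ m π1' π2'
  concatᶠ-≗ m {π1} {π1'} {π2} {π2'} e1 e2 k with position m k
  ... | before k<m = trans (concatᶠ-left m π1 π2 k k<m) (trans (e1 k) (sym (concatᶠ-left m π1' π2' k k<m)))
  ... | after k' refl = trans (concatᶠ-right m π1 π2 k') (trans (cong (Maybe.map (m ℕ.+_)) (e2 k')) (sym (concatᶠ-right m π1' π2' k')))

  closed⇒splits : ∀ m π → SecondaryStructureᶠ π → π 0 ≡ just (m ∸ 1) → SplitsAt m π
  closed⇒splits m π (dia , nc) e0 = λ k j e → part1 k j e , part2 k j e
    where
    m-1→0 : π (m ∸ 1) ≡ just 0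
    m-1→0 = proj₁ (dia 0 (m ∸ 1) e0)
    gap : 1 < m ∸ 1
    gap with proj₂ (dia 0 (m ∸ 1) e0)
    ... | inj₁ x = x
    ... | inj₂ ()
    m-1<m : m ∸ 1 < m
    m-1<m = ℕP.∸-monoʳ-< {m} {1} {0} (s≤s z≤n) (ℕP.≤-trans (ℕP.<-trans {0} {1} (s≤s z≤n) gap) (ℕP.m∸n≤m m 1))
    lt-pred : ∀ {k} → k < m → k ≤ m ∸ 1
    lt-pred {k} k<m = ℕP.≤-pred (subst (suc k ≤_) (sym (trans (ℕP.+-comm 1 (m ∸ 1)) (ℕP.m∸n+n≡m (ℕP.≤-trans (s≤s z≤n) k<m)))) k<m)
    part1 : ∀ k j → π k ≡ just j → k < m → j < m
    part1 zero j e k<m = subst (_< m) (MP.just-injective (trans (sym e0) e)) m-1<m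
    part1 (suc k) j e k<m with suc k ℕP.≟ (m ∸ 1)
    ... | yes eq = subst (_< m) (MP.just-injective (trans (sym m-1→0) (trans (cong π (sym eq)) e))) (ℕP.≤-<-trans z≤n m-1<m)
    ... | no neq with j <? m
    ...   | yes j<m = j<m
    ...   | no j≮m = ⊥-elim (nc 0 (m ∸ 1) (suc k) j (ℕP.<-trans {0} {1} (s≤s z≤n) gap , e0) (ℕP.<-≤-trans k<m (ℕP.≮⇒≥ j≮m) , e) (s≤s z≤n)
                       (ℕP.≤∧≢⇒< (lt-pred k<m) neq) (ℕP.<-≤-trans m-1<m (ℕP.≮⇒≥ j≮m)))
    part2 : ∀ k j → π k ≡ just j → m ≤ k → m ≤ j
    part2 k j e m≤k with j <? m
    ... | yes j<m = ⊥-elim (ℕP.<-irrefl refl (ℕP.<-≤-trans (part1 j k (proj₁ (dia k j e)) j<m) m≤k))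
    ... | no j≮m = ℕP.≮⇒≥ j≮m

module OuterArc where

  open import Data.Nat as ℕ using (ℕ; zero; suc; _<_; _≤_; _∸_; z≤n; s≤s; _<?_; _≤?_)
  import Data.Nat.Properties as ℕP
  open import Data.Maybe as Maybe using (Maybe; just; nothing)
  import Data.Maybe.Properties as MP
  open import Data.Product using (∃; _×_; _,_; proj₁; proj₂)
  open import Data.Sum using (_⊎_; inj₁; inj₂)
  open import Data.Empty using (⊥; ⊥-elim)
  open import Relation.Nullary using (Dec; yes; no; ¬_)
  open import Relation.Binary.PropositionalEquality
  open import Relation.Binary.Definitions using (tri<; tri≈; tri>)
  open PartnerFunction
  open Concatenation using (<∸⇒<)

  wrapᶠ : ℕ → PartnerFn → PartnerFn
  wrapᶠ q π zero = just (suc q)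
  wrapᶠ q π (suc i) with i <? q
  ... | yes _ = Maybe.map suc (π i)
  ... | no _ with i ℕ.≟ q
  ...   | yes _ = just 0
  ...   | no _ = nothing

  unwrapᶠ : ℕ → PartnerFn → PartnerFn
  unwrapᶠ q π i with i <? q
  ... | yes _ = Maybe.map ℕ.pred (π (suc i))
  ... | no _ = nothing

  wrapᶠ-inner : ∀ q π i → i < q → wrapᶠ q π (suc i) ≡ Maybe.map suc (π i)
  wrapᶠ-inner q π i i<q with i <? q
  ... | yes _ = refl
  ... | no n = ⊥-elim (n i<q)

  wrapᶠ-end : ∀ q π → wrapᶠ q π (suc q) ≡ just 0
  wrapᶠ-end q π with q <? q
  ... | yes lt = ⊥-elim (ℕP.<-irrefl refl lt)
  ... | no _ with q ℕ.≟ q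
  ...   | yes _ = refl
  ...   | no n = ⊥-elim (n refl)

  wrapᶠ-outside : ∀ q π i → suc q < i → wrapᶠ q π i ≡ nothing
  wrapᶠ-outside q π (suc i) (s≤s lt) with i <? q
  ... | yes i<q = ⊥-elim (ℕP.<-irrefl refl (ℕP.<-trans i<q lt))
  ... | no _ with i ℕ.≟ q
  ...   | yes refl = ⊥-elim (ℕP.<-irrefl refl lt)
  ...   | no _ = refl

  unwrapᶠ-inner : ∀ q π i → i < q → unwrapᶠ q π i ≡ Maybe.map ℕ.pred (π (suc i))
  unwrapᶠ-inner q π i i<q with i <? q
  ... | yes _ = refl
  ... | no n = ⊥-elim (n i<q)

  unwrapᶠ-outside : ∀ q π i → q ≤ i → unwrapᶠ q π i ≡ nothing
  unwrapᶠ-outside q π i q≤i with i <? q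
  ... | yes lt = ⊥-elim (ℕP.<-irrefl refl (ℕP.<-≤-trans lt q≤i))
  ... | no _ = refl

  data WrapView (q : ℕ) (π : PartnerFn) (i : ℕ) : Maybe ℕ → Set where
    wv-inner : i < q → ∀ {v} → π i ≡ v → WrapView q π i (Maybe.map suc v)
    wv-end : i ≡ q → WrapView q π i (just 0)
    wv-outside : q < i → WrapView q π i nothing

  wrapView : ∀ q π i → WrapView q π i (wrapᶠ q π (suc i))
  wrapView q π i with ℕP.<-cmp i q
  ... | tri< lt _ _ = subst (WrapView q π i) (sym (wrapᶠ-inner q π i lt)) (wv-inner lt refl)
  ... | tri≈ _ refl _ = subst (WrapView q π i) (sym (wrapᶠ-end q π)) (wv-end refl)
  ... | tri> _ _ gt = subst (WrapView q π i) (sym (wrapᶠ-outside q π (suc i) (s≤s gt))) (wv-outside gt)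

  module WrapProperties (q : ℕ) (π : PartnerFn) (g : Fits q π) where
    P : PartnerFn
    P = wrapᶠ q π

    fits : Fits (suc (suc q)) P
    fits = record { outside = o ; bounded = b }
      where
      o : ∀ k → suc (suc q) ≤ k → P k ≡ nothing
      o k le = wrapᶠ-outside q π k le
      b : BoundedBy (suc (suc q)) P
      b zero j refl = ℕP.n<1+n (suc q)
      b (suc i) j e = h (wrapView q π i) e
        where
        h : ∀ {x} → WrapView q π i x → x ≡ just j → j < suc (suc q)
        h (wv-inner lt {just v} eq) refl = s≤s (ℕP.<-trans (bounded g i v eq) (ℕP.n<1+n q))
        h (wv-end _) refl = s≤s z≤n

    arc-wrap⁺ : ∀ {a b} → Arcᶠ π a b → Arcᶠ P (suc a) (suc b)
    arc-wrap⁺ {a} {b} (lt , e) = s≤s lt , trans (wrapᶠ-inner q π a (fits-domain g e)) (cong (Maybe.map suc) e)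

    arc-wrap⁻ : ∀ {a b} → Arcᶠ P (suc a) (suc b) → Arcᶠ π a b
    arc-wrap⁻ {a} {b} (lt , e) = h (wrapView q π a) e
      where
      h : ∀ {x} → WrapView q π a x → x ≡ just (suc b) → Arcᶠ π a b
      h (wv-inner x {just v} eq) refl = ℕP.≤-pred lt , eq

    arc-from-suc : ∀ {a b} → Arcᶠ P (suc a) b → ∃ λ b' → b ≡ suc b'
    arc-from-suc {a} {zero} (() , _)
    arc-from-suc {a} {suc b} _ = b , refl

    outer-arc : Arcᶠ P 0 (suc q)
    outer-arc = s≤s z≤n , refl

    arc-from-0 : ∀ {b} → Arcᶠ P 0 b → b ≡ suc q
    arc-from-0 (_ , e) = sym (MP.just-injective e)

    secondary⁺ : 1 ≤ q → SecondaryStructureᶠ π → SecondaryStructureᶠ P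
    secondary⁺ 1≤q (dia , nc) = diaP , ncP
      where
      diaP : IsDiagramᶠ P
      diaP zero b refl = wrapᶠ-end q π , inj₁ (s≤s 1≤q)
      diaP (suc i) b e = h (wrapView q π i) e
        where
        h : ∀ {x} → WrapView q π i x → x ≡ just b → P b ≡ just (suc i) × (suc (suc i) < b ⊎ suc b < suc i)
        h (wv-inner lt {just v} eq) refl with dia i v eq
        ... | e' , gap = trans (wrapᶠ-inner q π v (bounded g i v eq)) (cong (Maybe.map suc) e') , gap' gap
          where
          gap' : suc i < v ⊎ suc v < i → suc (suc i) < suc v ⊎ suc (suc v) < suc i
          gap' (inj₁ x) = inj₁ (s≤s x)
          gap' (inj₂ x) = inj₂ (s≤s x)
        h (wv-end refl) refl = refl , inj₂ (s≤s 1≤q)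
      ncP : NonCrossingᶠ P
      ncP zero b c d ab cd a<c c<b b<d rewrite arc-from-0 ab = ℕP.<-irrefl refl (ℕP.<-≤-trans b<d (ℕP.≤-pred (bounded fits c d (proj₂ cd))))
      ncP (suc a) b (suc c) d ab cd (s≤s a<c) c<b b<d with arc-from-suc ab | arc-from-suc cd
      ... | b' , refl | d' , refl = nc a b' c d' (arc-wrap⁻ ab) (arc-wrap⁻ cd) a<c (ℕP.≤-pred c<b) (ℕP.≤-pred b<d)

    secondary⁻ : SecondaryStructureᶠ P → SecondaryStructureᶠ π
    secondary⁻ (dia , nc) = diaπ , ncπ
      where
      diaπ : IsDiagramᶠ π
      diaπ a b e with dia (suc a) (suc b) (trans (wrapᶠ-inner q π a (fits-domain g e)) (cong (Maybe.map suc) e))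
      ... | e' , gap = MP.map-injective ℕP.suc-injective (trans (sym (wrapᶠ-inner q π b (bounded g a b e))) e') , gap' gap
        where
        gap' : suc (suc a) < suc b ⊎ suc (suc b) < suc a → suc a < b ⊎ suc b < a
        gap' (inj₁ x) = inj₁ (ℕP.≤-pred x)
        gap' (inj₂ x) = inj₂ (ℕP.≤-pred x)
      ncπ : NonCrossingᶠ π
      ncπ a b c d ab cd a<c c<b b<d = nc _ _ _ _ (arc-wrap⁺ ab) (arc-wrap⁺ cd) (s≤s a<c) (s≤s c<b) (s≤s b<d)

    unwrapᶠ-wrapᶠ : unwrapᶠ q P ≗ π
    unwrapᶠ-wrapᶠ i = k (i <? q)
      where
      h : ∀ (x : Maybe ℕ) → Maybe.map ℕ.pred (Maybe.map suc x) ≡ x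
      h nothing = refl
      h (just x) = refl
      k : Dec (i < q) → unwrapᶠ q P i ≡ π i
      k (yes i<q) = trans (unwrapᶠ-inner q P i i<q) (trans (cong (Maybe.map ℕ.pred) (wrapᶠ-inner q π i i<q)) (h (π i)))
      k (no i≮q) = trans (unwrapᶠ-outside q P i (ℕP.≮⇒≥ i≮q)) (sym (outside g i (ℕP.≮⇒≥ i≮q)))

  module UnwrapProperties (q : ℕ) (P : PartnerFn) (g : Fits (suc (suc q)) P) (ss : SecondaryStructureᶠ P) (e0 : P 0 ≡ just (suc q)) where
    Q : PartnerFn
    Q = unwrapᶠ q P

    dia : IsDiagramᶠ P
    dia = proj₁ ss

    last-to-0 : P (suc q) ≡ just 0
    last-to-0 = proj₁ (dia 0 (suc q) e0)

    inner-partner : ∀ i j → i < q → P (suc i) ≡ just j → ∃ λ j' → j ≡ suc j' × j' < q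
    inner-partner i zero i<q e = ⊥-elim
        (ℕP.<-irrefl refl (subst (_< q) (sym (ℕP.suc-injective (MP.just-injective (trans (sym e0) (proj₁ (dia (suc i) 0 e)))))) i<q))
    inner-partner i (suc j') i<q e with j' <? q
    ... | yes lt = j' , refl , lt
    ... | no nlt with ℕP.m≤n⇒m<n∨m≡n (ℕP.≤-pred (bounded g (suc i) (suc j') e))
    ...   | inj₁ lt = ⊥-elim (nlt (ℕP.≤-pred lt))
    ...   | inj₂ refl = ⊥-elim (case (trans (sym last-to-0) (proj₁ (dia (suc i) (suc q) e))))
      where case : just 0 ≡ just (suc i) → ⊥
            case ()

    unwrap-fits : Fits q Q
    unwrap-fits = record { outside = λ k le → unwrapᶠ-outside q P k le ; bounded = b }
      where
      b : BoundedBy q Q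
      b k j e with k <? q
      ... | no _ = case e
        where case : nothing ≡ just j → j < q
              case ()
      ... | yes k<q with P (suc k) in eq
      ...   | just j0 with inner-partner k j0 k<q eq
      b k j refl | yes k<q | just .(suc j') | j' , refl , lt = lt

    wrapᶠ-unwrapᶠ : wrapᶠ q Q ≗ P
    wrapᶠ-unwrapᶠ zero = sym e0
    wrapᶠ-unwrapᶠ (suc i) = h (wrapView q Q i)
      where
      h : ∀ {x} → WrapView q Q i x → x ≡ P (suc i)
      h (wv-inner lt {v} refl) with P (suc i) in eq
      ... | nothing = trans (cong (Maybe.map suc) (trans (unwrapᶠ-inner q P i lt) (cong (Maybe.map ℕ.pred) eq))) refl
      ... | just j with inner-partner i j lt eq
      ...   | j' , refl , _ = trans (cong (Maybe.map suc) (trans (unwrapᶠ-inner q P i lt) (cong (Maybe.map ℕ.pred) eq))) refl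
      h (wv-end refl) = sym last-to-0
      h (wv-outside lt) = sym (outside g (suc i) (s≤s lt))

  -- Canonicity of a length-q structure sitting inside j further arcs that continue the stack of its
  -- outer arc (0 , q - 1): that stack then needs only r - j arcs of its own.
  CanonicalNested : ℕ → ℕ → ℕ → PartnerFn → Set
  CanonicalNested r j q π = ∀ a b → Arcᶠ π a b → ¬ (∃ λ a′ → a ≡ suc a′ × Arcᶠ π a′ (suc b)) →
    ∀ t → t < r → (a ≡ 0 → suc b ≡ q → j ℕ.+ t < r) → Arcᶠ π (a ℕ.+ t) (b ∸ t)

  suc-∸ : ∀ b t → t ≤ b → suc b ∸ t ≡ suc (b ∸ t)
  suc-∸ b t le = ℕP.+-∸-assoc 1 le

  nested0⇒canonical : ∀ {r q π} → CanonicalNested r 0 q π → Canonicalᶠ r π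
  nested0⇒canonical C a b ab ns t t<r = C a b ab ns t t<r (λ _ _ → t<r)

  canonical⇒nested0 : ∀ {r q π} → Canonicalᶠ r π → CanonicalNested r 0 q π
  canonical⇒nested0 C a b ab ns t t<r _ = C a b ab ns t t<r

  canonical⇒nested-open : ∀ {r j q π} → ¬ (π 0 ≡ just (q ∸ 1)) → Canonicalᶠ r π → CanonicalNested r j q π
  canonical⇒nested-open nc C a b ab ns t t<r _ = C a b ab ns t t<r

  nested⇒canonical-open : ∀ {r j q π} → ¬ (π 0 ≡ just (q ∸ 1)) → CanonicalNested r j q π → Canonicalᶠ r π
  nested⇒canonical-open {q = q} {π = π} nc C a b ab ns t t<r = C a b ab ns t t<r h
    where
    h : a ≡ 0 → suc b ≡ q → _
    h refl refl = ⊥-elim (nc (proj₂ ab))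

  nested-stable : ∀ {r j j' q π} → r ≤ j → r ≤ j' → CanonicalNested r j q π → CanonicalNested r j' q π
  nested-stable {r} {j} {j'} r≤j r≤j' C a b ab ns t t<r h = C a b ab ns t t<r
      (λ e1 e2 → ⊥-elim (ℕP.<-irrefl refl (ℕP.<-≤-trans (h e1 e2) (ℕP.≤-trans r≤j' (ℕP.m≤m+n j' t)))))

  module WrapCanonical (q : ℕ) (π : PartnerFn) (g : Fits q π) where
    open WrapProperties q π g

    nested-unwrap : ∀ {r j} → CanonicalNested r j (suc (suc q)) P →
      CanonicalNested r (suc j) q π × (π 0 ≡ just (q ∸ 1) ⊎ r ≤ suc j)
    nested-unwrap {r} {j} C = inner-nested , stack-closed-or-long
      where
      ns0 : ¬ (∃ λ a′ → 0 ≡ suc a′ × Arcᶠ P a′ (suc (suc q)))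
      ns0 (_ , () , _)
      inner-nested : CanonicalNested r (suc j) q π
      inner-nested a b ab ns t t<r h with a ℕ.≟ 0 | suc b ℕ.≟ q
      inner-nested .0 b ab ns t t<r h | yes refl | yes refl = arc-wrap⁻ (subst (Arcᶠ P (suc t)) (suc-∸ b t t≤b) arcP)
        where
        h' : j ℕ.+ suc t < r
        h' = subst (_< r) (sym (ℕP.+-suc j t)) (h refl refl)
        st<r : suc t < r
        st<r = ℕP.≤-<-trans (ℕP.+-monoˡ-≤ (suc t) z≤n) h'
        arcP : Arcᶠ P (suc t) (suc b ∸ t)
        arcP = C 0 (suc (suc b)) outer-arc ns0 (suc t) st<r (λ _ _ → h')
        t≤b : t ≤ b
        t≤b = ℕP.≤-pred (<∸⇒< (proj₁ arcP))
      inner-nested a b ab ns t t<r h | yes refl | no neq = arc-wrap⁻ (subst (Arcᶠ P (suc t)) (suc-∸ b t (ℕP.≤-pred (<∸⇒< (proj₁ arcP)))) arcP)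
        where
        nsP : ¬ (∃ λ a′ → 1 ≡ suc a′ × Arcᶠ P a′ (suc (suc b)))
        nsP (.0 , refl , arc) = neq (ℕP.suc-injective (trans (arc-from-0 arc) refl))
        arcP : Arcᶠ P (suc t) (suc b ∸ t)
        arcP = C 1 (suc b) (arc-wrap⁺ ab) nsP t t<r (λ ())
      inner-nested zero b ab ns t t<r h | no a≢0 | _ = ⊥-elim (a≢0 refl)
      inner-nested (suc a) b ab ns t t<r h | no a≢0 | _ = arc-wrap⁻
          (subst (Arcᶠ P (suc (suc a ℕ.+ t))) (suc-∸ b t (ℕP.≤-pred (<∸⇒< (proj₁ arcP)))) arcP)
        where
        nsP : ¬ (∃ λ a′ → suc (suc a) ≡ suc a′ × Arcᶠ P a′ (suc (suc b)))
        nsP (a′ , refl , arc) = ns (a , refl , arc-wrap⁻ arc)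
        arcP : Arcᶠ P (suc (suc a ℕ.+ t)) (suc b ∸ t)
        arcP = C (suc (suc a)) (suc b) (arc-wrap⁺ ab) nsP t t<r (λ ())
      stack-closed-or-long : π 0 ≡ just (q ∸ 1) ⊎ r ≤ suc j
      stack-closed-or-long with r ℕ.≤? suc j
      ... | yes le = inj₂ le
      ... | no nle = inj₁ (proj₂ (arc-wrap⁻ (subst (Arcᶠ P 1) (sym qeq) arcP)))
        where
        sj<r : suc j < r
        sj<r = ℕP.≰⇒> nle
        arcP : Arcᶠ P 1 (suc q ∸ 1)
        arcP = C 0 (suc q) outer-arc ns0 1 (ℕP.<-≤-trans (s≤s (s≤s z≤n)) sj<r) (λ _ _ → subst (_< r) (ℕP.+-comm 1 j) sj<r)
        1≤q : 1 ≤ q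
        1≤q = ℕP.<⇒≤ (proj₁ arcP)
        qeq : suc (q ∸ 1) ≡ q
        qeq = trans (ℕP.+-comm 1 (q ∸ 1)) (ℕP.m∸n+n≡m 1≤q)

    nested-wrap : ∀ {r j} → 1 ≤ q → IsDiagramᶠ π → CanonicalNested r (suc j) q π → (π 0 ≡ just (q ∸ 1) ⊎ r ≤ suc j) →
        CanonicalNested r j (suc (suc q)) P
    nested-wrap {r} {j} 1≤q dia C cl zero b' ab ns t t<r h rewrite arc-from-0 ab = outerCase cl t t<r (h refl refl)
      where
      qeq : suc (q ∸ 1) ≡ q
      qeq = trans (ℕP.+-comm 1 (q ∸ 1)) (ℕP.m∸n+n≡m 1≤q)
      outerCase : (π 0 ≡ just (q ∸ 1) ⊎ r ≤ suc j) → ∀ t → t < r → j ℕ.+ t < r → Arcᶠ P t (suc q ∸ t)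
      outerCase _ zero _ _ = outer-arc
      outerCase (inj₂ r≤sj) (suc t') t<r hh = ⊥-elim
          (ℕP.<-irrefl refl (ℕP.<-≤-trans hh (ℕP.≤-trans r≤sj (subst (suc j ≤_) (sym (ℕP.+-suc j t')) (s≤s (ℕP.m≤m+n j t'))))))
      outerCase (inj₁ e0) (suc t') t<r hh = subst (Arcᶠ P (suc t')) eqv (arc-wrap⁺ arcπ)
        where
        gap : 1 < q ∸ 1
        gap with proj₂ (dia 0 (q ∸ 1) e0)
        ... | inj₁ x = x
        ... | inj₂ ()
        ns0 : ¬ (∃ λ a′ → 0 ≡ suc a′ × Arcᶠ π a′ (suc (q ∸ 1)))
        ns0 (_ , () , _)
        arcπ : Arcᶠ π t' ((q ∸ 1) ∸ t')
        arcπ = C 0 (q ∸ 1) (ℕP.<-trans (s≤s z≤n) gap , e0) ns0 t' (ℕP.<-trans (ℕP.n<1+n t') t<r) (λ _ _ → subst (_< r) (ℕP.+-suc j t') hh)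
        eqv : suc ((q ∸ 1) ∸ t') ≡ suc q ∸ suc t'
        eqv = trans (sym (suc-∸ (q ∸ 1) t' (ℕP.<⇒≤ (<∸⇒< (proj₁ arcπ))))) (cong (_∸ t') qeq)
    nested-wrap {r} {j} 1≤q dia C cl (suc a) b' ab ns t t<r h with arc-from-suc ab
    ... | b , refl = subst (Arcᶠ P (suc (a ℕ.+ t))) (sym (suc-∸ b t (ℕP.<⇒≤ (<∸⇒< (proj₁ arcπ))))) (arc-wrap⁺ arcπ)
      where
      abπ : Arcᶠ π a b
      abπ = arc-wrap⁻ ab
      nsπ : ¬ (∃ λ a′ → a ≡ suc a′ × Arcᶠ π a′ (suc b))
      nsπ (a'' , refl , arc) = ns (suc a'' , refl , arc-wrap⁺ arc)
      hπ : a ≡ 0 → suc b ≡ q → suc j ℕ.+ t < r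
      hπ refl refl = ⊥-elim (ns (0 , refl , outer-arc))
      arcπ : Arcᶠ π (a ℕ.+ t) (b ∸ t)
      arcπ = C a b abπ nsπ t t<r hπ

  CanonicalNested-≗ : ∀ {r j q π π'} → π ≗ π' → CanonicalNested r j q π → CanonicalNested r j q π'
  CanonicalNested-≗ e C a b ab ns t t<r h = Arcᶠ-≗ e
      (C a b (Arcᶠ-≗ (λ k → sym (e k)) ab) (λ { (a' , eq , arc) → ns (a' , eq , Arcᶠ-≗ e arc) }) t t<r h)

  wrapᶠ-≗ : ∀ q {π π'} → π ≗ π' → wrapᶠ q π ≗ wrapᶠ q π'
  wrapᶠ-≗ q e zero = refl
  wrapᶠ-≗ q {π} {π'} e (suc i) with ℕP.<-cmp i q
  ... | tri< lt _ _ = trans (wrapᶠ-inner q π i lt) (trans (cong (Maybe.map suc) (e i)) (sym (wrapᶠ-inner q π' i lt)))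
  ... | tri≈ _ refl _ = trans (wrapᶠ-end q π) (sym (wrapᶠ-end q π'))
  ... | tri> _ _ gt = trans (wrapᶠ-outside q π (suc i) (s≤s gt)) (sym (wrapᶠ-outside q π' (suc i) (s≤s gt)))

  unwrapᶠ-≗ : ∀ q {π π'} → π ≗ π' → unwrapᶠ q π ≗ unwrapᶠ q π'
  unwrapᶠ-≗ q {π} {π'} e i = h (i <? q)
    where
    h : Dec (i < q) → unwrapᶠ q π i ≡ unwrapᶠ q π' i
    h (yes lt) = trans (unwrapᶠ-inner q π i lt) (trans (cong (Maybe.map ℕ.pred) (e (suc i))) (sym (unwrapᶠ-inner q π' i lt)))
    h (no nlt) = trans (unwrapᶠ-outside q π i (ℕP.≮⇒≥ nlt)) (sym (unwrapᶠ-outside q π' i (ℕP.≮⇒≥ nlt)))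

module Decidability where

  open import Data.Nat as ℕ using (ℕ; zero; suc; _<_; _∸_; _<?_)
  import Data.Nat.Properties as ℕP
  open import Data.Maybe using (Maybe; just)
  import Data.Maybe.Properties as MP
  open import Data.Product using (∃; _×_; _,_)
  open import Data.Empty using (⊥)
  open import Data.Sum using (_⊎_)
  open import Relation.Nullary using (Dec; no; ¬_)
  open import Relation.Nullary.Decidable using (_×-dec_; _⊎-dec_; _→-dec_; ¬?; map′)
  open import Relation.Binary.PropositionalEquality
  open PartnerFunction
  open OuterArc

  ≟-Maybe : (x y : Maybe ℕ) → Dec (x ≡ y)
  ≟-Maybe = MP.≡-dec ℕP._≟_

  arc? : ∀ π a b → Dec (Arcᶠ π a b)
  arc? π a b = (a <? b) ×-dec ≟-Maybe (π a) (just b)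

  extendsOutward? : ∀ π a b → Dec (∃ λ a′ → a ≡ suc a′ × Arcᶠ π a′ (suc b))
  extendsOutward? π zero b = no (λ { (_ , () , _) })
  extendsOutward? π (suc a) b = map′ (λ arc → a , refl , arc) (λ { (_ , refl , arc) → arc }) (arc? π a (suc b))

  -- All quantifiers range over vertices, hence below q, where they are decidable.
  module _ (q : ℕ) (π : PartnerFn) (fits : Fits q π) where

    private
      vertex-arc : ∀ {a b} → Arcᶠ π a b → a < q × b < q
      vertex-arc {a} {b} (_ , e) = fits-domain fits e , bounded fits a b e

    canonicalNested? : ∀ r j → Dec (CanonicalNested r j q π)
    canonicalNested? r j = map′ to from
      (ℕP.allUpTo? (λ a → ℕP.allUpTo? (λ b → ℕP.allUpTo? (λ t → stack? a b t) r) q) q)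
      where
      Stack : ℕ → ℕ → ℕ → Set
      Stack a b t = Arcᶠ π a b → ¬ (∃ λ a′ → a ≡ suc a′ × Arcᶠ π a′ (suc b)) → (a ≡ 0 → suc b ≡ q → j ℕ.+ t < r) →
        Arcᶠ π (a ℕ.+ t) (b ∸ t)
      stack? : ∀ a b t → Dec (Stack a b t)
      stack? a b t = arc? π a b →-dec (¬? (extendsOutward? π a b) →-dec
        (((a ℕ.≟ 0) →-dec ((suc b ℕ.≟ q) →-dec (j ℕ.+ t <? r))) →-dec arc? π (a ℕ.+ t) (b ∸ t)))
      to : (∀ {a} → a < q → ∀ {b} → b < q → ∀ {t} → t < r → Stack a b t) → CanonicalNested r j q π
      to f a b ab = let (a<q , b<q) = vertex-arc ab in λ outermost t t<r → f a<q b<q t<r ab outermost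
      from : CanonicalNested r j q π → (∀ {a} → a < q → ∀ {b} → b < q → ∀ {t} → t < r → Stack a b t)
      from C {a} _ {b} _ {t} t<r ab outermost = C a b ab outermost t t<r

    secondaryStructure? : Dec (SecondaryStructureᶠ π)
    secondaryStructure? = map′ to from
      (ℕP.allUpTo? (λ a → ℕP.allUpTo? (λ b → paired? a b) q) q ×-dec
       ℕP.allUpTo? (λ a → ℕP.allUpTo? (λ b → ℕP.allUpTo? (λ c → ℕP.allUpTo? (λ d → crossing? a b c d) q) q) q) q)
      where
      Paired : ℕ → ℕ → Set
      Paired a b = π a ≡ just b → π b ≡ just a × (suc a < b ⊎ suc b < a)
      paired? : ∀ a b → Dec (Paired a b)
      paired? a b = ≟-Maybe (π a) (just b) →-dec (≟-Maybe (π b) (just a) ×-dec ((suc a <? b) ⊎-dec (suc b <? a)))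
      Crossing : ℕ → ℕ → ℕ → ℕ → Set
      Crossing a b c d = Arcᶠ π a b → Arcᶠ π c d → a < c → c < b → b < d → ⊥
      crossing? : ∀ a b c d → Dec (Crossing a b c d)
      crossing? a b c d = arc? π a b →-dec (arc? π c d →-dec ((a <? c) →-dec ((c <? b) →-dec ((b <? d) →-dec no (λ ())))))
      to : (∀ {a} → a < q → ∀ {b} → b < q → Paired a b) ×
           (∀ {a} → a < q → ∀ {b} → b < q → ∀ {c} → c < q → ∀ {d} → d < q → Crossing a b c d) → SecondaryStructureᶠ π
      to (paired , noncrossing) =
        (λ a b e → paired (fits-domain fits e) (bounded fits a b e) e) ,
        (λ a b c d ab cd → let (a<q , b<q) = vertex-arc ab ; (c<q , d<q) = vertex-arc cd in noncrossing a<q b<q c<q d<q ab cd)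
      from : SecondaryStructureᶠ π → (∀ {a} → a < q → ∀ {b} → b < q → Paired a b) ×
             (∀ {a} → a < q → ∀ {b} → b < q → ∀ {c} → c < q → ∀ {d} → d < q → Crossing a b c d)
      from (dia , nc) = (λ {a} _ {b} _ → dia a b) , (λ {a} _ {b} _ {c} _ {d} _ → nc a b c d)

module ClosedStructures where

  open import Data.Nat as ℕ using (ℕ; zero; suc; _<_; _≤_; _∸_; z≤n; s≤s; _≤?_)
  import Data.Nat.Properties as ℕP
  open import Data.Maybe as Maybe using (just)
  import Data.Maybe.Properties as MP
  open import Data.Product using (_×_; _,_; proj₁; proj₂)
  open import Data.Sum using (_⊎_; inj₁; inj₂)
  open import Data.List using ([])
  open import Data.Vec as Vec using ()
  open import Relation.Nullary using (Dec; ¬_)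
  open import Relation.Nullary.Decidable using (_×-dec_; ¬?)
  open import Relation.Binary.PropositionalEquality
  open import Defs
  open PartnerFunction
  open OuterArc
  open Decidability
  open Counting

  suc-∸1 : ∀ {q} → 1 ≤ q → suc (q ∸ 1) ≡ q
  suc-∸1 {suc q} _ = refl

  shiftBy : ℕ → (ℕ → ℕ) → ℕ → ℕ
  shiftBy zero f m = f m
  shiftBy (suc a) f zero = 0
  shiftBy (suc a) f (suc m) = shiftBy a f m

  shiftBy-+ : ∀ a f y → shiftBy a f (a ℕ.+ y) ≡ f y
  shiftBy-+ zero f y = refl
  shiftBy-+ (suc a) f y = shiftBy-+ a f y

  shiftBy-< : ∀ a f m → m < a → shiftBy a f m ≡ 0
  shiftBy-< (suc a) f zero _ = refl
  shiftBy-< (suc a) f (suc m) (s≤s m<a) = shiftBy-< a f m m<a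

  double : ℕ → ℕ
  double zero = 0
  double (suc i) = suc (suc (double i))

  double≡+ : ∀ k → double k ≡ k ℕ.+ k
  double≡+ zero = refl
  double≡+ (suc k) = cong suc (trans (cong suc (double≡+ k)) (sym (ℕP.+-suc k k)))

  Closed : ∀ {q} → Struct q → Set
  Closed {q} p = partner p 0 ≡ just (q ∸ 1)

  closed? : ∀ {q} (p : Struct q) → Dec (Closed p)
  closed? {q} p = ≟-Maybe (partner p 0) (just (q ∸ 1))

  closed⇒3≤length : ∀ {q} (p : Struct q) → IsDiagramᶠ (partner p) → Closed p → 3 ≤ q
  closed⇒3≤length {q} p dia cl with proj₂ (dia 0 (q ∸ 1) cl) | vecPartner-bounded p (q ∸ 1) 0 (proj₁ (dia 0 (q ∸ 1) cl))
  ... | inj₁ 1<q-1 | 0<q = ℕP.≤-trans (s≤s 1<q-1) (ℕP.≤-reflexive (suc-∸1 0<q))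
  ... | inj₂ () | _

  wrap : ∀ q → Struct q → Struct (suc (suc q))
  wrap q Q = fromPartnerFn (suc (suc q)) (wrapᶠ q (partner Q))

  unwrap : ∀ q → Struct (suc (suc q)) → Struct q
  unwrap q p = fromPartnerFn q (unwrapᶠ q (partner p))

  partner-wrap : ∀ q (Q : Struct q) → partner (wrap q Q) ≗ wrapᶠ q (partner Q)
  partner-wrap q Q = partner-fromPartnerFn (suc (suc q)) _ (WrapProperties.fits q (partner Q) (partner-fits Q))

  unwrap-wrap : ∀ q (Q : Struct q) → unwrap q (wrap q Q) ≡ Q
  unwrap-wrap q Q = vecPartner-injective _ _ (λ k _ → trans (partner-fromPartnerFn q _ fitsQ k) (unwrap-wrap≗ k))
    where
    unwrap-wrap≗ : unwrapᶠ q (partner (wrap q Q)) ≗ partner Q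
    unwrap-wrap≗ k = trans (unwrapᶠ-≗ q (partner-wrap q Q) k) (WrapProperties.unwrapᶠ-wrapᶠ q (partner Q) (partner-fits Q) k)
    fitsQ : Fits q (unwrapᶠ q (partner (wrap q Q)))
    fitsQ = record
      { outside = λ k q≤k → unwrapᶠ-outside q _ k q≤k
      ; bounded = λ k j e → bounded (partner-fits Q) k j (trans (sym (unwrap-wrap≗ k)) e) }

  SecondClosed : ∀ q → Struct (suc (suc q)) → Set
  SecondClosed q p = partner p 1 ≡ just q

  secondClosed? : ∀ q (p : Struct (suc (suc q))) → Dec (SecondClosed q p)
  secondClosed? q p = ≟-Maybe (partner p 1) (just q)

  module Unwrapping (q : ℕ) (p : Struct (suc (suc q))) (ss : SecondaryStructureᶠ (partner p)) (cl : Closed p) where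

    open UnwrapProperties q (partner p) (partner-fits p) ss cl

    wrap-unwrap≗ : wrapᶠ q (partner (unwrap q p)) ≗ partner p
    wrap-unwrap≗ k = trans (wrapᶠ-≗ q (partner-fromPartnerFn q _ unwrap-fits) k) (wrapᶠ-unwrapᶠ k)

    wrap-unwrap : wrap q (unwrap q p) ≡ p
    wrap-unwrap = vecPartner-injective _ _ (λ k _ → trans (partner-wrap q (unwrap q p) k) (wrap-unwrap≗ k))

    unwrap-secondary : SecondaryStructureᶠ (partner (unwrap q p))
    unwrap-secondary = WrapProperties.secondary⁻ q _ (partner-fits (unwrap q p)) (SecondaryStructureᶠ-≗ (λ k → sym (wrap-unwrap≗ k)) ss)

    unwrap-nested : ∀ {r j} → CanonicalNested r j (suc (suc q)) (partner p) →
      CanonicalNested r (suc j) q (partner (unwrap q p)) × (Closed (unwrap q p) ⊎ r ≤ suc j)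
    unwrap-nested cj = WrapCanonical.nested-unwrap q _ (partner-fits (unwrap q p)) (CanonicalNested-≗ (λ k → sym (wrap-unwrap≗ k)) cj)

    unwrap-closed⇒secondClosed : Closed (unwrap q p) → SecondClosed q p
    unwrap-closed⇒secondClosed c = trans (sym (wrap-unwrap≗ 1))
      (trans (wrapᶠ-inner q _ 0 0<q) (trans (cong (Maybe.map suc) c) (cong just (suc-∸1 0<q))))
      where
      0<q : 0 < q
      0<q = vecPartner-domain (unwrap q p) 0 _ c

    secondClosed⇒unwrap-closed : 1 ≤ q → SecondClosed q p → Closed (unwrap q p)
    secondClosed⇒unwrap-closed 1≤q e = MP.map-injective ℕP.suc-injective
      (trans (sym (wrapᶠ-inner q _ 0 1≤q)) (trans (wrap-unwrap≗ 1) (trans e (cong just (sym (suc-∸1 1≤q))))))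

  module Wrapping (q : ℕ) (1≤q : 1 ≤ q) (Q : Struct q) (ssQ : SecondaryStructureᶠ (partner Q)) where

    private
      wrap≗ : wrapᶠ q (partner Q) ≗ partner (wrap q Q)
      wrap≗ k = sym (partner-wrap q Q k)

    wrap-secondary : SecondaryStructureᶠ (partner (wrap q Q))
    wrap-secondary = SecondaryStructureᶠ-≗ wrap≗ (WrapProperties.secondary⁺ q (partner Q) (partner-fits Q) 1≤q ssQ)

    wrap-nested : ∀ {r j} → CanonicalNested r (suc j) q (partner Q) → (Closed Q ⊎ r ≤ suc j) →
      CanonicalNested r j (suc (suc q)) (partner (wrap q Q))
    wrap-nested cj cl = CanonicalNested-≗ wrap≗ (WrapCanonical.nested-wrap q (partner Q) (partner-fits Q) 1≤q (proj₁ ssQ) cj cl)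

    wrap-closed : Closed (wrap q Q)
    wrap-closed = partner-wrap q Q 0

    closed⇒wrap-secondClosed : Closed Q → SecondClosed q (wrap q Q)
    closed⇒wrap-secondClosed c = trans (partner-wrap q Q 1)
      (trans (wrapᶠ-inner q (partner Q) 0 1≤q) (trans (cong (Maybe.map suc) c) (cong just (suc-∸1 1≤q))))

    open⇒wrap-secondOpen : ¬ Closed Q → ¬ SecondClosed q (wrap q Q)
    open⇒wrap-secondOpen ¬cl e = ¬cl (subst Closed (unwrap-wrap q Q)
      (Unwrapping.secondClosed⇒unwrap-closed q (wrap q Q) wrap-secondary wrap-closed 1≤q e))

  module Counts (r : ℕ) (decS : ∀ n (p : Struct n) → Dec (RCanonical r p)) where

    ClosedRC : (q : ℕ) → Struct q → Set
    ClosedRC q p = RCanonical r p × Closed p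

    closedRC? : ∀ q (p : Struct q) → Dec (ClosedRC q p)
    closedRC? q p = decS q p ×-dec closed? p

    closedCount : ℕ → ℕ
    closedCount q = count (closedRC? q) (structs q)

    OpenRC : (q : ℕ) → Struct q → Set
    OpenRC q p = RCanonical r p × (¬ Closed p) × 1 ≤ q

    openRC? : ∀ q (p : Struct q) → Dec (OpenRC q p)
    openRC? q p = decS q p ×-dec (¬? (closed? p) ×-dec (1 ≤? q))

    openCount : ℕ → ℕ
    openCount q = count (openRC? q) (structs q)

    openCount-0 : openCount 0 ≡ 0
    openCount-0 = count-empty (openRC? 0) (λ { p (_ , _ , ()) }) (structs 0)

    sCount-0 : sCount r decS 0 ≡ 1
    sCount-0 = count-cons-yes (decS 0) Vec.[] [] empty-rcanonical
      where
      empty-rcanonical : RCanonical r {0} Vec.[]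
      empty-rcanonical = ((λ { a b () }) , (λ { a b c d (_ , ()) _ _ _ _ })) , (λ { a b (_ , ()) _ _ _ })

    sCount-split : ∀ q → 1 ≤ q → sCount r decS q ≡ closedCount q ℕ.+ openCount q
    sCount-split q 1≤q = trans (count-partition (decS q) closed? (structs q))
      (cong (closedCount q ℕ.+_) (count-ext _ (openRC? q) (λ p (rc , ¬cl) → rc , ¬cl , 1≤q) (λ p (rc , ¬cl , _) → rc , ¬cl) (structs q)))

    NestedClosed : ℕ → (q : ℕ) → Struct q → Set
    NestedClosed j q p = SecondaryStructureᶠ (partner p) × CanonicalNested r j q (partner p) × Closed p

    nestedClosed? : ∀ j q (p : Struct q) → Dec (NestedClosed j q p)
    nestedClosed? j q p = secondaryStructure? q (partner p) (partner-fits p)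
      ×-dec (canonicalNested? q (partner p) (partner-fits p) r j ×-dec closed? p)

    nestedCount : ℕ → ℕ → ℕ
    nestedCount j q = count (nestedClosed? j q) (structs q)

    closedCount≡nestedCount0 : ∀ q → closedCount q ≡ nestedCount 0 q
    closedCount≡nestedCount0 q = count-ext _ (nestedClosed? 0 q)
      (λ p (rc , cl) → proj₁ rc , canonical⇒nested0 (proj₂ rc) , cl)
      (λ p (ss , cj , cl) → (ss , nested0⇒canonical cj) , cl) (structs q)

    nestedCount-short : ∀ j q → q < 3 → nestedCount j q ≡ 0
    nestedCount-short j q q<3 = count-empty (nestedClosed? j q)
      (λ p (ss , _ , cl) → ℕP.<-irrefl refl (ℕP.<-≤-trans q<3 (closed⇒3≤length p (proj₁ ss) cl))) (structs q)

    closedCount-short : ∀ m → m < 3 → closedCount m ≡ 0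
    closedCount-short m m<3 = trans (closedCount≡nestedCount0 m) (nestedCount-short 0 m m<3)

    nestedCount-saturates : ∀ j q → r ≤ j → nestedCount j q ≡ nestedCount r q
    nestedCount-saturates j q r≤j = count-ext (nestedClosed? j q) (nestedClosed? r q)
      (λ p (ss , cj , cl) → ss , nested-stable r≤j ℕP.≤-refl cj , cl)
      (λ p (ss , cj , cl) → ss , nested-stable ℕP.≤-refl r≤j cj , cl) (structs q)

    module _ (j q : ℕ) (1≤q : 1 ≤ q) where

      private
        continues? : ∀ p → Dec (NestedClosed j (suc (suc q)) p × SecondClosed q p)
        continues? p = nestedClosed? j (suc (suc q)) p ×-dec secondClosed? q p
        ends? : ∀ p → Dec (NestedClosed j (suc (suc q)) p × ¬ SecondClosed q p)
        ends? p = nestedClosed? j (suc (suc q)) p ×-dec ¬? (secondClosed? q p)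

      -- Removing the outer arc is a bijection onto the structures one level deeper in the stack ...
      count-stack-continues : count continues? (structs (suc (suc q))) ≡ nestedCount (suc j) q
      count-stack-continues = count-bijection (structEnumeration (suc (suc q))) (structEnumeration q) continues? (nestedClosed? (suc j) q)
        (unwrap q) (wrap q)
        (λ { {p} ((ss , cj , cl) , second) → let open Unwrapping q p ss cl in
             unwrap-secondary , proj₁ (unwrap-nested cj) , secondClosed⇒unwrap-closed 1≤q second })
        (λ { {Q} (ssQ , cj , cl) → let open Wrapping q 1≤q Q ssQ in
             (wrap-secondary , wrap-nested cj (inj₁ cl) , wrap-closed) , closed⇒wrap-secondClosed cl })
        (λ { {p} ((ss , _ , cl) , _) → Unwrapping.wrap-unwrap q p ss cl })
        (λ {Q} _ → unwrap-wrap q Q)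

      -- ... or onto the open structures, when the stack is already long enough ...
      count-stack-ends : r ≤ suc j → count ends? (structs (suc (suc q))) ≡ openCount q
      count-stack-ends r≤1+j = count-bijection (structEnumeration (suc (suc q))) (structEnumeration q) ends? (openRC? q)
        (unwrap q) (wrap q)
        (λ { {p} ((ss , cj , cl) , second-open) → let open Unwrapping q p ss cl in
             let ¬cl = λ c → second-open (unwrap-closed⇒secondClosed c) in
             (unwrap-secondary , nested⇒canonical-open ¬cl (proj₁ (unwrap-nested cj))) , ¬cl , 1≤q })
        (λ { {Q} ((ssQ , can) , ¬cl , _) → let open Wrapping q 1≤q Q ssQ in
             (wrap-secondary , wrap-nested (canonical⇒nested-open ¬cl can) (inj₂ r≤1+j) , wrap-closed) , open⇒wrap-secondOpen ¬cl })
        (λ { {p} ((ss , _ , cl) , _) → Unwrapping.wrap-unwrap q p ss cl })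
        (λ {Q} _ → unwrap-wrap q Q)

      -- ... and otherwise it cannot end there.
      count-stack-too-short : ¬ (r ≤ suc j) → count ends? (structs (suc (suc q))) ≡ 0
      count-stack-too-short r≰1+j = count-empty ends? too-short (structs (suc (suc q)))
        where
        too-short : ∀ p → ¬ (NestedClosed j (suc (suc q)) p × ¬ SecondClosed q p)
        too-short p ((ss , cj , cl) , second-open) with proj₂ (Unwrapping.unwrap-nested q p ss cl cj)
        ... | inj₁ c = second-open (Unwrapping.unwrap-closed⇒secondClosed q p ss cl c)
        ... | inj₂ r≤1+j = r≰1+j r≤1+j

    nestedCount-step-short : ∀ j q → ¬ (r ≤ suc j) → nestedCount j (suc (suc q)) ≡ nestedCount (suc j) q
    nestedCount-step-short j zero _ = trans (nestedCount-short j 2 (s≤s (s≤s (s≤s z≤n)))) (sym (nestedCount-short (suc j) 0 (s≤s z≤n)))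
    nestedCount-step-short j (suc q) r≰1+j = trans (count-partition (nestedClosed? j _) (secondClosed? (suc q)) (structs _))
      (trans (cong₂ ℕ._+_ (count-stack-continues j (suc q) (s≤s z≤n)) (count-stack-too-short j (suc q) (s≤s z≤n) r≰1+j))
        (ℕP.+-identityʳ _))

    nestedCount-step : ∀ j q → r ≤ suc j → nestedCount j (suc (suc q)) ≡ nestedCount (suc j) q ℕ.+ openCount q
    nestedCount-step j zero _ = trans (nestedCount-short j 2 (s≤s (s≤s (s≤s z≤n))))
      (sym (cong₂ ℕ._+_ (nestedCount-short (suc j) 0 (s≤s z≤n)) openCount-0))
    nestedCount-step j (suc q) r≤1+j = trans (count-partition (nestedClosed? j _) (secondClosed? (suc q)) (structs _))
      (cong₂ ℕ._+_ (count-stack-continues j (suc q) (s≤s z≤n)) (count-stack-ends j (suc q) (s≤s z≤n) r≤1+j))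

    -- Walking down a stack of r arcs: for j + i = r - 1, the count of j-nested closed structures
    -- grows by openCount (m - 2i) from length m to length m + 2.
    module _ (K : ℕ) (r≡1+K : r ≡ suc K) where

      private
        nestedCount-difference : ∀ i j → j ℕ.+ i ≡ K → ∀ m →
          nestedCount j (suc (suc m)) ≡ nestedCount j m ℕ.+ shiftBy (double i) openCount m
        nestedCount-difference zero j j+0≡K m rewrite ℕP.+-identityʳ j | j+0≡K = base m
          where
          stepK : ∀ q → nestedCount K (suc (suc q)) ≡ nestedCount r q ℕ.+ openCount q
          stepK q = trans (nestedCount-step K q (ℕP.≤-reflexive r≡1+K)) (cong (λ x → nestedCount x q ℕ.+ openCount q) (sym r≡1+K))
          stepr : ∀ q → nestedCount r (suc (suc q)) ≡ nestedCount r q ℕ.+ openCount q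
          stepr q = trans (nestedCount-step r q (ℕP.n≤1+n r)) (cong (ℕ._+ openCount q) (nestedCount-saturates (suc r) q (ℕP.n≤1+n r)))
          short : ∀ q → q < 3 → nestedCount r q ≡ nestedCount K q
          short q q<3 = trans (nestedCount-short r q q<3) (sym (nestedCount-short K q q<3))
          base : ∀ m → nestedCount K (suc (suc m)) ≡ nestedCount K m ℕ.+ openCount m
          base zero = trans (stepK 0) (cong (ℕ._+ openCount 0) (short 0 (s≤s z≤n)))
          base (suc zero) = trans (stepK 1) (cong (ℕ._+ openCount 1) (short 1 (s≤s (s≤s z≤n))))
          base (suc (suc m)) = trans (stepK (suc (suc m))) (cong (ℕ._+ openCount (suc (suc m))) (trans (stepr m) (sym (stepK m))))
        nestedCount-difference (suc i) j j+1+i≡K m = trans (nestedCount-step-short j m r≰1+j) (shifted m)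
          where
          1+j+i≡K : suc j ℕ.+ i ≡ K
          1+j+i≡K = trans (sym (ℕP.+-suc j i)) j+1+i≡K
          r≰1+j : ¬ (r ≤ suc j)
          r≰1+j r≤1+j = ℕP.<-irrefl refl (ℕP.<-≤-trans (s≤s (subst (suc j ≤_) 1+j+i≡K (ℕP.m≤m+n (suc j) i))) (subst (_≤ suc j) r≡1+K r≤1+j))
          shifted : ∀ m → nestedCount (suc j) m ≡ nestedCount j m ℕ.+ shiftBy (double (suc i)) openCount m
          shifted zero = trans (nestedCount-short (suc j) 0 (s≤s z≤n)) (sym (cong (ℕ._+ 0) (nestedCount-short j 0 (s≤s z≤n))))
          shifted (suc zero) = trans (nestedCount-short (suc j) 1 (s≤s (s≤s z≤n)))
              (sym (cong (ℕ._+ 0) (nestedCount-short j 1 (s≤s (s≤s z≤n)))))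
          shifted (suc (suc m)) = trans (nestedCount-difference i (suc j) 1+j+i≡K m)
            (cong (ℕ._+ shiftBy (double i) openCount m) (sym (nestedCount-step-short j m r≰1+j)))

      closedCount-recurrence : ∀ m → closedCount (suc (suc m)) ≡ closedCount m ℕ.+ shiftBy (double K) openCount m
      closedCount-recurrence m = begin
        closedCount (suc (suc m))                                ≡⟨ closedCount≡nestedCount0 (suc (suc m)) ⟩
        nestedCount 0 (suc (suc m))                              ≡⟨ nestedCount-difference K 0 refl m ⟩
        nestedCount 0 m ℕ.+ shiftBy (double K) openCount m       ≡⟨ cong (ℕ._+ shiftBy (double K) openCount m) (closedCount≡nestedCount0 m) ⟨
        closedCount m ℕ.+ shiftBy (double K) openCount m         ∎
        where open ≡-Reasoning

module FirstVertex where

  open import Data.Nat as ℕ using (ℕ; zero; suc; _<_; _≤_; _∸_; z≤n; s≤s)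
  import Data.Nat.Properties as ℕP
  open import Data.Maybe as Maybe using (Maybe; just; nothing)
  import Data.Maybe.Properties as MP
  open import Data.Product using (∃; _×_; _,_; proj₁; proj₂)
  open import Data.Sum using (inj₁; inj₂)
  open import Data.Empty using (⊥-elim)
  open import Data.Fin using () renaming (zero to fzero)
  open import Data.Vec as Vec using ()
  open import Data.Integer as ℤ using (+_)
  import Data.Integer.Properties as ℤP
  open import Relation.Nullary using (Dec; ¬_)
  open import Relation.Nullary.Decidable using (_×-dec_; ¬?)
  open import Relation.Binary.PropositionalEquality
  open import Function using (case_of_)
  open import Defs using (Struct; partner; RCanonical; Distance; structs; count; wCount; here; step)
  open FiniteSum using (∑)
  open PartnerFunction
  open Concatenation
  open ClosedStructures
  open Decidability using (≟-Maybe)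
  open Counting

  noArcs-fits : ∀ m → Fits m noArcs
  noArcs-fits m = record { outside = λ _ _ → refl ; bounded = λ _ _ () }

  noArcs-rcanonical : ∀ r → RCanonicalᶠ r noArcs
  noArcs-rcanonical r = ((λ { a b () }) , (λ { a b c d (_ , ()) _ _ _ _ })) , (λ { a b (_ , ()) _ _ _ })

  noArcs-distance : Distanceᶠ 1 noArcs 0
  noArcs-distance = here (s≤s z≤n) , (λ _ _ → z≤n)

  walk-length-0 : ∀ {n π a c} → Walkᶠ n π 0 a c → a ≡ c
  walk-length-0 (here _) = refl

  closed⇒distance-1 : ∀ n π → Fits n π → SecondaryStructureᶠ π → π 0 ≡ just (n ∸ 1) → Distanceᶠ n π 1
  closed⇒distance-1 n π fits (dia , _) e0 = step (inj₂ (inj₂ (inj₁ (0<n-1 , e0)))) (here (bounded fits 0 (n ∸ 1) e0)) , lower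
    where
    0<n-1 : 0 < n ∸ 1
    0<n-1 with proj₂ (dia 0 (n ∸ 1) e0)
    ... | inj₁ 1<n-1 = ℕP.<-trans (s≤s z≤n) 1<n-1
    ... | inj₂ ()
    lower : ∀ k → Walkᶠ n π k 0 (n ∸ 1) → 1 ≤ k
    lower zero w = ⊥-elim (ℕP.<-irrefl (walk-length-0 w) 0<n-1)
    lower (suc k) w = s≤s z≤n

  distance-unique : ∀ {n π d d′} → Distanceᶠ n π d → Distanceᶠ n π d′ → d ≡ d′
  distance-unique (w , min) (w′ , min′) = ℕP.≤-antisym (min _ w′) (min′ _ w)

  unpaired⇒splits : ∀ π → IsDiagramᶠ π → π 0 ≡ nothing → SplitsAt 1 π
  unpaired⇒splits π dia e0 k zero e with () ← trans (sym e0) (proj₁ (dia k 0 e))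
  unpaired⇒splits π dia e0 zero (suc j) e with () ← trans (sym e0) e
  unpaired⇒splits π dia e0 (suc k) (suc j) e = (λ { (s≤s ()) }) , (λ _ → s≤s z≤n)

  concat : ∀ m l n → Struct m → Struct l → Struct n
  concat m l n x y = fromPartnerFn n (concatᶠ m (partner x) (partner y))

  split : ∀ m l {n} → Struct n → Struct m × Struct l
  split m l p = fromPartnerFn m (leftPart m (partner p)) , fromPartnerFn l (rightPart m (partner p))

  module Concat (m l : ℕ) (x : Struct m) (y : Struct l) where

    open ConcatProperties m l (partner x) (partner y) (partner-fits x) (partner-fits y) public

    partner-concat : partner (concat m l (m ℕ.+ l) x y) ≗ concatᶠ m (partner x) (partner y)
    partner-concat = partner-fromPartnerFn (m ℕ.+ l) _ fits

    split-concat : split m l (concat m l (m ℕ.+ l) x y) ≡ (x , y)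
    split-concat = cong₂ _,_
      (vecPartner-injective _ _ (λ k _ → trans (partner-fromPartnerFn m _ fitsL k) (left≗ k)))
      (vecPartner-injective _ _ (λ k _ → trans (partner-fromPartnerFn l _ fitsR k) (right≗ k)))
      where
      left≗ : leftPart m (partner (concat m l (m ℕ.+ l) x y)) ≗ partner x
      left≗ k = trans (concatᶠ-≗ m partner-concat (λ _ → refl) k) (leftPart-concat m (partner x) (partner y) (partner-fits x) k)
      right≗ : rightPart m (partner (concat m l (m ℕ.+ l) x y)) ≗ partner y
      right≗ k = trans (cong (Maybe.map (_∸ m)) (partner-concat (m ℕ.+ k))) (rightPart-concat m (partner x) (partner y) k)
      fitsL : Fits m (leftPart m (partner (concat m l (m ℕ.+ l) x y)))
      fitsL = record { outside = λ k m≤k → trans (left≗ k) (outside (partner-fits x) k m≤k)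
                     ; bounded = λ k j e → bounded (partner-fits x) k j (trans (sym (left≗ k)) e) }
      fitsR : Fits l (rightPart m (partner (concat m l (m ℕ.+ l) x y)))
      fitsR = record { outside = λ k l≤k → trans (right≗ k) (outside (partner-fits y) k l≤k)
                     ; bounded = λ k j e → bounded (partner-fits y) k j (trans (sym (right≗ k)) e) }

    concat-rcanonical : ∀ {r} → RCanonicalᶠ r (partner x) → RCanonicalᶠ r (partner y) → RCanonical r (concat m l (m ℕ.+ l) x y)
    concat-rcanonical (ssx , cx) (ssy , cy) = RCanonicalᶠ-≗ (λ k → sym (partner-concat k)) (secondary⁺ ssx ssy , canonical⁺ cx cy)

    concat-distance : ∀ {c d′} → 1 ≤ m → 1 ≤ l → Distanceᶠ m (partner x) c → Distance y d′ →
      Distance (concat m l (m ℕ.+ l) x y) (c ℕ.+ suc d′)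
    concat-distance 1≤m 1≤l dx dy = fromDistanceᶠ _ (Distanceᶠ-≗ (λ k → sym (partner-concat k))
      (Distances.distance⁺ 1≤m 1≤l dx (toDistanceᶠ y dy)))

  module Split (m l : ℕ) (p : Struct (m ℕ.+ l)) (splits : SplitsAt m (partner p)) where

    open SplitProperties m l (partner p) (partner-fits p) splits

    left : Struct m
    left = proj₁ (split m l p)

    right : Struct l
    right = proj₂ (split m l p)

    partner-left : partner left ≗ leftPart m (partner p)
    partner-left = partner-fromPartnerFn m _ fitsˡ

    concatᶠ-parts : concatᶠ m (partner left) (partner right) ≗ partner p
    concatᶠ-parts k = trans (concatᶠ-≗ m partner-left (partner-fromPartnerFn l _ fitsʳ) k) (concat-split k)

    concat-parts : concat m l (m ℕ.+ l) left right ≡ p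
    concat-parts = vecPartner-injective _ _ (λ k _ → trans (Concat.partner-concat m l left right k) (concatᶠ-parts k))

    partner-left-0 : 1 ≤ m → partner left 0 ≡ partner p 0
    partner-left-0 1≤m = trans (partner-left 0) (concatᶠ-left m (partner p) noArcs 0 1≤m)

    private
      rc-parts : ∀ {r} → RCanonical r p → RCanonicalᶠ r (concatᶠ m (partner left) (partner right))
      rc-parts = RCanonicalᶠ-≗ (λ k → sym (concatᶠ-parts k))

    left-rcanonical : ∀ {r} → RCanonical r p → RCanonicalᶠ r (partner left)
    left-rcanonical rc =
      proj₁ (Concat.secondary⁻ m l left right (proj₁ (rc-parts rc))) , Concat.canonical⁻ˡ m l left right (proj₂ (rc-parts rc))

    right-rcanonical : ∀ {r} → RCanonical r p → RCanonicalᶠ r (partner right)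
    right-rcanonical rc =
      proj₂ (Concat.secondary⁻ m l left right (proj₁ (rc-parts rc))) , Concat.canonical⁻ʳ m l left right (proj₂ (rc-parts rc))

    right-distance : ∀ {c d} → 1 ≤ m → 1 ≤ l → Distanceᶠ m (partner left) c → Distance p d →
      ∃ λ d′ → Distance right d′ × d ≡ c ℕ.+ suc d′
    right-distance 1≤m 1≤l dl dp with Concat.Distances.distance⁻ m l left right 1≤m 1≤l dl
                                         (Distanceᶠ-≗ (λ k → sym (concatᶠ-parts k)) (toDistanceᶠ p dp))
    ... | d′ , dr , d≡ = d′ , fromDistanceᶠ right dr , d≡

  module Decomposition (r : ℕ) (decS : ∀ n (p : Struct n) → Dec (RCanonical r p))
                       (decW : ∀ n d (p : Struct n) → Dec (RCanonical r p × Distance p d)) where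

    open Counts r decS

    RCDistance : ∀ n → ℕ → Struct n → Set
    RCDistance n d p = RCanonical r p × Distance p d

    w : ℕ → ℕ → ℕ
    w = wCount r decW

    FirstPartner : ∀ {n} → Maybe ℕ → Struct n → Set
    FirstPartner v p = partner p 0 ≡ v

    firstPartner? : ∀ {n} (v : Maybe ℕ) (p : Struct n) → Dec (FirstPartner v p)
    firstPartner? v p = ≟-Maybe (partner p 0) v

    firstPartnerCount : ℕ → ℕ → Maybe ℕ → ℕ
    firstPartnerCount n d v = count (λ p → decW n d p ×-dec firstPartner? v p) (structs n)

    -- The first vertex paired with j: a closed block of length j + 1, then the rest.
    module Block (j l′ : ℕ) where

      private
        m l n : ℕ
        m = suc j
        l = suc l′
        n = m ℕ.+ l

        block-splits : ∀ {p : Struct n} → RCanonical r p → FirstPartner (just j) p → SplitsAt m (partner p)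
        block-splits {p} rc e0 = closed⇒splits m (partner p) (proj₁ rc) e0

        module Parts (p : Struct n) (rc : RCanonical r p) (e0 : FirstPartner (just j) p) where
          open Split m l p (block-splits {p} rc e0) public

          left-closed : Closed left
          left-closed = trans (partner-left-0 (s≤s z≤n)) e0

          left-distance : Distanceᶠ m (partner left) 1
          left-distance = closed⇒distance-1 m _ (partner-fits left) (proj₁ (left-rcanonical rc)) left-closed

      module _ (d′ : ℕ) where

        BlockParts : Struct m × Struct l → Set
        BlockParts (x , y) = ClosedRC m x × RCDistance l d′ y

        blockParts? : ∀ xy → Dec (BlockParts xy)
        blockParts? (x , y) = closedRC? m x ×-dec decW l d′ y

        count-block : firstPartnerCount n (suc (suc d′)) (just j) ≡ closedCount m ℕ.* w l d′
        count-block = trans (count-bijection (structEnumeration n) (×-enumeration (structEnumeration m) (structEnumeration l))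
          (λ p → decW n (suc (suc d′)) p ×-dec firstPartner? (just j) p) blockParts?
          (split m l) (λ xy → concat m l n (proj₁ xy) (proj₂ xy)) (λ {p} → parts⇒ {p}) (λ {xy} → ⇒parts {xy})
          (λ { {p} ((rc , _) , e0) → Parts.concat-parts p rc e0 })
          (λ { {x , y} _ → Concat.split-concat m l x y }))
          (count-× (closedRC? m) (decW l d′) (structs m) (structs l))
          where
          parts⇒ : ∀ {p} → RCDistance n (suc (suc d′)) p × FirstPartner (just j) p → BlockParts (split m l p)
          parts⇒ {p} ((rc , dp) , e0) with right-distance (s≤s z≤n) (s≤s z≤n) left-distance dp
            where open Parts p rc e0
          ... | d″ , dr , d≡ = (left-rcanonical rc , left-closed) ,
                               (right-rcanonical rc , subst (Distance right) (sym (ℕP.suc-injective (ℕP.suc-injective d≡))) dr)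
            where open Parts p rc e0
          ⇒parts : ∀ {xy} → BlockParts xy → RCDistance n (suc (suc d′)) (concat m l n (proj₁ xy) (proj₂ xy)) ×
                                             FirstPartner (just j) (concat m l n (proj₁ xy) (proj₂ xy))
          ⇒parts {x , y} ((rcx , clx) , (rcy , dy)) =
            (concat-rcanonical rcx rcy , concat-distance (s≤s z≤n) (s≤s z≤n) (closed⇒distance-1 m _ (partner-fits x) (proj₁ rcx) clx) dy) ,
            trans (partner-concat 0) (trans (concatᶠ-left m (partner x) (partner y) 0 (s≤s z≤n)) clx)
            where open Concat m l x y

      count-block-near : ∀ d → d < 2 → firstPartnerCount n d (just j) ≡ 0
      count-block-near d d<2 = count-empty _ near (structs n)
        where
        near : ∀ p → ¬ (RCDistance n d p × FirstPartner (just j) p)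
        near p ((rc , dp) , e0) with Parts.right-distance p rc e0 (s≤s z≤n) (s≤s z≤n) (Parts.left-distance p rc e0) dp
        ... | _ , _ , d≡ = ℕP.<⇒≱ d<2 (subst (2 ≤_) (sym d≡) (s≤s (s≤s z≤n)))

    vertex : Struct 1
    vertex = fromPartnerFn 1 noArcs

    partner-vertex : partner vertex ≗ noArcs
    partner-vertex = partner-fromPartnerFn 1 noArcs (noArcs-fits 1)

    vertex-rcanonical : RCanonicalᶠ r (partner vertex)
    vertex-rcanonical = RCanonicalᶠ-≗ (λ k → sym (partner-vertex k)) (noArcs-rcanonical r)

    vertex-distance : Distanceᶠ 1 (partner vertex) 0
    vertex-distance = Distanceᶠ-≗ (λ k → sym (partner-vertex k)) noArcs-distance

    -- The first vertex unpaired: a single vertex, then the rest.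
    module Unpaired (l′ : ℕ) where

      private
        l n : ℕ
        l = suc l′
        n = 1 ℕ.+ l

        module Parts (p : Struct n) (rc : RCanonical r p) (e0 : FirstPartner nothing p) where
          open Split 1 l p (unpaired⇒splits (partner p) (proj₁ (proj₁ rc)) e0) public

          left≡vertex : left ≡ vertex
          left≡vertex = vecPartner-injective _ _
            (λ { zero _ → trans (partner-left-0 (s≤s z≤n)) (trans e0 (sym (partner-vertex 0))) ; (suc k) (s≤s ()) })

          left-distance : Distanceᶠ 1 (partner left) 0
          left-distance = subst (λ x → Distanceᶠ 1 (partner x) 0) (sym left≡vertex) vertex-distance

      count-unpaired : ∀ d′ → firstPartnerCount n (suc d′) nothing ≡ w l d′
      count-unpaired d′ = count-bijection (structEnumeration n) (structEnumeration l) _ (decW l d′)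
        (λ p → proj₂ (split 1 l p)) (concat 1 l n vertex) (λ {p} → rest⇒ {p}) (λ {y} → ⇒rest {y})
        (λ { {p} ((rc , _) , e0) → let open Parts p rc e0 in trans (cong (λ x → concat 1 l n x right) (sym left≡vertex)) concat-parts })
        (λ {y} _ → cong proj₂ (Concat.split-concat 1 l vertex y))
        where
        rest⇒ : ∀ {p} → RCDistance n (suc d′) p × FirstPartner nothing p → RCDistance l d′ (proj₂ (split 1 l p))
        rest⇒ {p} ((rc , dp) , e0) with right-distance (s≤s z≤n) (s≤s z≤n) left-distance dp
          where open Parts p rc e0
        ... | d″ , dr , d≡ = right-rcanonical rc , subst (Distance right) (sym (ℕP.suc-injective d≡)) dr
          where open Parts p rc e0
        ⇒rest : ∀ {y} → RCDistance l d′ y → RCDistance n (suc d′) (concat 1 l n vertex y) × FirstPartner nothing (concat 1 l n vertex y)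
        ⇒rest {y} (rcy , dy) =
          (concat-rcanonical vertex-rcanonical rcy , concat-distance (s≤s z≤n) (s≤s z≤n) vertex-distance dy) ,
          trans (partner-concat 0) (trans (concatᶠ-left 1 (partner vertex) (partner y) 0 (s≤s z≤n)) (partner-vertex 0))
          where open Concat 1 l vertex y

      count-unpaired-0 : firstPartnerCount n 0 nothing ≡ 0
      count-unpaired-0 = count-empty _ at-0 (structs n)
        where
        at-0 : ∀ p → ¬ (RCDistance n 0 p × FirstPartner nothing p)
        at-0 p ((rc , dp) , e0) with Parts.right-distance p rc e0 (s≤s z≤n) (s≤s z≤n) (Parts.left-distance p rc e0) dp
        ... | _ , _ , ()

    -- The first vertex paired with the last one: the 5'-3' distance is 1.
    module Enclosing (n′ : ℕ) where

      private
        n : ℕ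
        n = suc n′

        distance-1 : ∀ {p : Struct n} → RCanonical r p → FirstPartner (just n′) p → Distance p 1
        distance-1 {p} rc e0 = fromDistanceᶠ p (closed⇒distance-1 n (partner p) (partner-fits p) (proj₁ rc) e0)

      count-enclosing-1 : firstPartnerCount n 1 (just n′) ≡ closedCount n
      count-enclosing-1 = count-ext _ (closedRC? n) (λ p ((rc , _) , e0) → rc , e0)
        (λ p (rc , e0) → (rc , distance-1 rc e0) , e0) (structs n)

      count-enclosing : ∀ d → d ≢ 1 → firstPartnerCount n d (just n′) ≡ 0
      count-enclosing d d≢1 = count-empty _
        (λ p ((rc , dp) , e0) → d≢1 (distance-unique (toDistanceᶠ p dp) (toDistanceᶠ p (distance-1 rc e0)))) (structs n)

    w-1-0 : w 1 0 ≡ 1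
    w-1-0 = trans (count-cons-yes (decW 1 0) _ _ (single , fromDistanceᶠ _ (here (s≤s z≤n) , λ _ _ → z≤n)))
                  (cong suc (count-cons-no (decW 1 0) _ _ loop))
      where
      single : RCanonical r {1} (nothing Vec.∷ Vec.[])
      single = ((λ { zero b () ; (suc a) b () }) , (λ { zero b c d (_ , ()) _ _ _ _ ; (suc a) b c d (_ , ()) _ _ _ _ })) ,
               (λ { zero b (_ , ()) _ _ _ ; (suc a) b (_ , ()) _ _ _ })
      loop : ¬ (RCanonical r {1} (just fzero Vec.∷ Vec.[]) × Distance (just fzero Vec.∷ Vec.[]) 0)
      loop (((dia , _) , _) , _) with proj₂ (dia 0 0 refl)
      ... | inj₁ ()
      ... | inj₂ ()

    w-1-suc : ∀ d → w 1 (suc d) ≡ 0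
    w-1-suc d = count-empty (decW 1 (suc d)) (λ { p (_ , (_ , min)) → case min 0 (here (s≤s z≤n)) of λ () }) (structs 1)

    w-by-firstPartner : ∀ n d → + w n d ≡ + firstPartnerCount n d nothing ℤ.+ ∑ n (λ j → + firstPartnerCount n d (just j))
    w-by-firstPartner n d = begin
      + w n d
        ≡⟨ cong +_ (count-partition (decW n d) (firstPartner? nothing) (structs n)) ⟩
      + (firstPartnerCount n d nothing ℕ.+ count paired? (structs n))
        ≡⟨ ℤP.pos-+ (firstPartnerCount n d nothing) (count paired? (structs n)) ⟩
      + firstPartnerCount n d nothing ℤ.+ + count paired? (structs n)
        ≡⟨ cong (λ x → + firstPartnerCount n d nothing ℤ.+ x)
             (count-by-index (λ j p → RCDistance n d p × FirstPartner (just j) p) paired?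
                 (λ j p → decW n d p ×-dec firstPartner? (just j) p) n
               which (λ j p _ (rd , e0) → rd , λ e0′ → case trans (sym e0′) e0 of λ ()) partner-unique (structs n)) ⟩
      + firstPartnerCount n d nothing ℤ.+ ∑ n (λ j → + firstPartnerCount n d (just j))
        ∎
      where
      open ≡-Reasoning
      paired? : ∀ p → Dec (RCDistance n d p × ¬ FirstPartner nothing p)
      paired? p = decW n d p ×-dec ¬? (firstPartner? nothing p)
      which : ∀ p → RCDistance n d p × ¬ FirstPartner nothing p → ∃ λ j → j < n × (RCDistance n d p × FirstPartner (just j) p)
      which p (rd , unpaired) with partner p 0 in e0
      ... | nothing = ⊥-elim (unpaired refl)
      ... | just j = j , vecPartner-bounded p 0 j e0 , rd , refl
      partner-unique : ∀ j j′ p → RCDistance n d p × FirstPartner (just j) p → RCDistance n d p × FirstPartner (just j′) p → j ≡ j′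
      partner-unique j j′ p (_ , e) (_ , e′) = MP.just-injective (trans (sym e) e′)

module Coefficients where

  open import Data.Nat as ℕ using (ℕ; zero; suc; _<_; _≤_; _∸_; z≤n; s≤s)
  import Data.Nat.Properties as ℕP
  open import Data.Maybe using (just; nothing)
  open import Data.Integer using (ℤ; +_; _+_; _*_; _-_; 0ℤ; 1ℤ)
  import Data.Integer.Properties as ℤP
  open import Data.Product using (_×_)
  open import Relation.Nullary using (Dec)
  open import Relation.Binary.PropositionalEquality
  open import Data.Integer.Solver using (module +-*-Solver)
  open import Defs
  open FiniteSum
  open PowerSeries
  open SeriesRing using (solve; _:+_; _:*_; _:-_; _:=_; con)
  open Concatenation using (before; after; position)
  open ClosedStructures
  open FirstVertex

  Z⊛-suc : ∀ f n d → (Z ⊛ f) (suc n) d ≡ f n d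
  Z⊛-suc f n d = mono-⊛ 1 0 f (suc n) d (s≤s z≤n) z≤n

  Z⊛-zero : ∀ f d → (Z ⊛ f) 0 d ≡ 0ℤ
  Z⊛-zero f d = mono-⊛-belowˡ 1 0 f 0 d (s≤s z≤n)

  U⊛-suc : ∀ f n d → (U ⊛ f) n (suc d) ≡ f n d
  U⊛-suc f n d = mono-⊛ 0 1 f n (suc d) z≤n (s≤s z≤n)

  U⊛-zero : ∀ f n → (U ⊛ f) n 0 ≡ 0ℤ
  U⊛-zero f n = mono-⊛-belowʳ 0 1 f n 0 (s≤s z≤n)

  mono-⊛-+ : ∀ a f y d → (mono a 0 ⊛ f) (a ℕ.+ y) d ≡ f y d
  mono-⊛-+ a f y d = trans (mono-⊛ a 0 f (a ℕ.+ y) d (ℕP.m≤m+n a y) z≤n) (cong (λ k → f k d) (ℕP.m+n∸m≡n a y))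

  liftZ-⊛ : ∀ a f n d → (liftZ a ⊛ f) n d ≡ ∑ (suc n) (λ i → a i * f (n ∸ i) d)
  liftZ-⊛ a f n d = trans (⊛-coeff (liftZ a) f n d) (∑-ext (suc n) (λ i →
    trans (∑-suc d _) (trans (cong (λ x → a i * f (n ∸ i) d + x) (∑-zero d (λ _ _ → refl))) (ℤP.+-identityʳ _))))

  FreeOfU : Series → Set
  FreeOfU f = ∀ n d → f n (suc d) ≡ 0ℤ

  liftZ-freeOfU : ∀ s → FreeOfU (liftZ s)
  liftZ-freeOfU s n d = refl

  ⊖-freeOfU : ∀ {f g} → FreeOfU f → FreeOfU g → FreeOfU (f ⊖ g)
  ⊖-freeOfU f-free g-free n d = cong₂ _-_ (f-free n d) (g-free n d)

  𝟙-freeOfU : FreeOfU 𝟙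
  𝟙-freeOfU n d = mono-missʳ 0 0 n (suc d) (λ ())

  mono-⊛-freeOfU : ∀ a {f} → FreeOfU f → FreeOfU (mono a 0 ⊛ f)
  mono-⊛-freeOfU a {f} f-free m d with position a m
  ... | before m<a = mono-⊛-belowˡ a 0 f m (suc d) m<a
  ... | after y refl = trans (mono-⊛-+ a f y (suc d)) (f-free y d)

  module Equations (r : ℕ) (1≤r : 1 ≤ r) (decS : ∀ n (p : Struct n) → Dec (RCanonical r p))
                   (decW : ∀ n d (p : Struct n) → Dec (RCanonical r p × Distance p d)) where

    open Counts r decS
    open Decomposition r decS decW

    S W T z²ʳ : Series
    S = 𝐒 r decS
    W = 𝐖 r decW
    T = liftZ (λ m → + closedCount m)
    z²ʳ = mono (r ℕ.+ r) 0

    T-short : ∀ m d → m < 3 → T m d ≡ 0ℤ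
    T-short m zero m<3 = cong +_ (closedCount-short m m<3)
    T-short m (suc d) _ = refl

    T00 : T 0 0 ≡ 0ℤ
    T00 = T-short 0 0 (s≤s z≤n)

    S-1-coeff : ∀ y → (S ⊖ 𝟙) y 0 ≡ + closedCount y + + openCount y
    S-1-coeff zero = begin
      + sCount r decS 0 - 1ℤ                ≡⟨ cong (λ x → + x - 1ℤ) sCount-0 ⟩
      0ℤ                                    ≡⟨ cong₂ (λ x y → + x + + y) (closedCount-short 0 (s≤s z≤n)) openCount-0 ⟨
      + closedCount 0 + + openCount 0       ∎
      where open ≡-Reasoning
    S-1-coeff (suc y) = begin
      + sCount r decS (suc y) - 0ℤ                           ≡⟨ ℤP.+-identityʳ _ ⟩
      + sCount r decS (suc y)                                ≡⟨ cong +_ (sCount-split (suc y) (s≤s z≤n)) ⟩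
      + (closedCount (suc y) ℕ.+ openCount (suc y))          ≡⟨ ℤP.pos-+ (closedCount (suc y)) (openCount (suc y)) ⟩
      + closedCount (suc y) + + openCount (suc y)            ∎
      where open ≡-Reasoning

    private
      K : ℕ
      K = r ∸ 1

      r≡1+K : r ≡ suc K
      r≡1+K = sym (suc-∸1 1≤r)

      r+r≡2+2K : r ℕ.+ r ≡ suc (suc (double K))
      r+r≡2+2K = trans (cong (λ x → x ℕ.+ x) r≡1+K) (cong suc (trans (ℕP.+-suc K K) (cong suc (sym (double≡+ K)))))

      open +-*-Solver using () renaming (solve to ℤ-solve; _:+_ to _⊕′_; _:-_ to _⊖′_; _:=_ to _≡′_)

      -- The coefficient of z^(m+2) is closedCount-recurrence; below z²ʳ both sides vanish.
      T-step : ∀ m → + closedCount (suc (suc m)) - + closedCount m + (z²ʳ ⊛ T) (suc (suc m)) 0 ≡ (z²ʳ ⊛ (S ⊖ 𝟙)) (suc (suc m)) 0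
      T-step m with position (double K) m
      ... | before m<2K = begin
        + closedCount (suc (suc m)) - + closedCount m + (z²ʳ ⊛ T) (suc (suc m)) 0
          ≡⟨ cong₂ (λ x y → + x - + closedCount m + y)
               (trans (closedCount-recurrence K r≡1+K m) (cong (closedCount m ℕ.+_) (shiftBy-< (double K) openCount m m<2K)))
               (mono-⊛-belowˡ (r ℕ.+ r) 0 T (suc (suc m)) 0 below) ⟩
        + (closedCount m ℕ.+ 0) - + closedCount m + 0ℤ
          ≡⟨ cong (λ x → + x - + closedCount m + 0ℤ) (ℕP.+-identityʳ (closedCount m)) ⟩
        + closedCount m - + closedCount m + 0ℤ
          ≡⟨ trans (ℤP.+-identityʳ _) (ℤP.+-inverseʳ (+ closedCount m)) ⟩
        0ℤ
          ≡⟨ mono-⊛-belowˡ (r ℕ.+ r) 0 (S ⊖ 𝟙) (suc (suc m)) 0 below ⟨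
        (z²ʳ ⊛ (S ⊖ 𝟙)) (suc (suc m)) 0 ∎
        where
        open ≡-Reasoning
        below : suc (suc m) < r ℕ.+ r
        below = subst (suc (suc m) <_) (sym r+r≡2+2K) (s≤s (s≤s m<2K))
      ... | after y refl = begin
        + closedCount (suc (suc (double K ℕ.+ y))) - + closedCount (double K ℕ.+ y) + (z²ʳ ⊛ T) (suc (suc (double K ℕ.+ y))) 0
          ≡⟨ cong₂ (λ x z → + x - + closedCount (double K ℕ.+ y) + z)
               (trans (closedCount-recurrence K r≡1+K (double K ℕ.+ y))
                   (cong (closedCount (double K ℕ.+ y) ℕ.+_) (shiftBy-+ (double K) openCount y)))
               (trans (cong (λ k → (z²ʳ ⊛ T) k 0) 2r+y) (mono-⊛-+ (r ℕ.+ r) T y 0)) ⟩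
        + (closedCount (double K ℕ.+ y) ℕ.+ openCount y) - + closedCount (double K ℕ.+ y) + + closedCount y
          ≡⟨ cong (λ x → x - + closedCount (double K ℕ.+ y) + + closedCount y) (ℤP.pos-+ (closedCount (double K ℕ.+ y)) (openCount y)) ⟩
        + closedCount (double K ℕ.+ y) + + openCount y - + closedCount (double K ℕ.+ y) + + closedCount y
          ≡⟨ ℤ-solve 3 (λ a b c → a ⊕′ b ⊖′ a ⊕′ c ≡′ c ⊕′ b) refl (+ closedCount (double K ℕ.+ y)) (+ openCount y) (+ closedCount y) ⟩
        + closedCount y + + openCount y
          ≡⟨ trans (cong (λ k → (z²ʳ ⊛ (S ⊖ 𝟙)) k 0) 2r+y) (trans (mono-⊛-+ (r ℕ.+ r) (S ⊖ 𝟙) y 0) (S-1-coeff y)) ⟨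
        (z²ʳ ⊛ (S ⊖ 𝟙)) (suc (suc (double K ℕ.+ y))) 0 ∎
        where
        open ≡-Reasoning
        2r+y : suc (suc (double K ℕ.+ y)) ≡ r ℕ.+ r ℕ.+ y
        2r+y = cong (ℕ._+ y) (sym r+r≡2+2K)

      T-equation′ : T ⊖ Z ⊛ (Z ⊛ T) ⊕ z²ʳ ⊛ T ≈ z²ʳ ⊛ (S ⊖ 𝟙)
      T-equation′ m (suc d) = trans
        (cong₂ (λ x y → 0ℤ - x + y) (mono-⊛-freeOfU 1 {Z ⊛ T} (mono-⊛-freeOfU 1 {T} T-free) m d) (mono-⊛-freeOfU (r ℕ.+ r) {T} T-free m d))
        (sym (mono-⊛-freeOfU (r ℕ.+ r) {S ⊖ 𝟙} (⊖-freeOfU {S} {𝟙} (liftZ-freeOfU (λ n → + sCount r decS n)) 𝟙-freeOfU) m d))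
        where
        T-free : FreeOfU T
        T-free = liftZ-freeOfU (λ m → + closedCount m)
      T-equation′ 0 0 = trans
        (cong₂ (λ x y → T 0 0 - x + y) (Z⊛-zero (Z ⊛ T) 0) (mono-⊛-belowˡ (r ℕ.+ r) 0 T 0 0 0<2r))
        (trans (cong (λ x → x - 0ℤ + 0ℤ) T00) (sym (mono-⊛-belowˡ (r ℕ.+ r) 0 (S ⊖ 𝟙) 0 0 0<2r)))
        where
        0<2r : 0 < r ℕ.+ r
        0<2r = ℕP.<-≤-trans (s≤s z≤n) (ℕP.≤-trans 1≤r (ℕP.m≤m+n r r))
      T-equation′ 1 0 = trans
        (cong₂ (λ x y → T 1 0 - x + y) (trans (Z⊛-suc (Z ⊛ T) 0 0) (Z⊛-zero T 0)) (mono-⊛-belowˡ (r ℕ.+ r) 0 T 1 0 1<2r))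
        (trans (cong (λ x → x - 0ℤ + 0ℤ) (T-short 1 0 (s≤s (s≤s z≤n)))) (sym (mono-⊛-belowˡ (r ℕ.+ r) 0 (S ⊖ 𝟙) 1 0 1<2r)))
        where
        1<2r : 1 < r ℕ.+ r
        1<2r = subst (1 <_) (sym r+r≡2+2K) (s≤s (s≤s z≤n))
      T-equation′ (suc (suc m)) 0 = trans
        (cong (λ x → + closedCount (suc (suc m)) - x + (z²ʳ ⊛ T) (suc (suc m)) 0) (trans (Z⊛-suc (Z ⊛ T) (suc m) 0) (Z⊛-suc T m 0)))
        (T-step m)

    T-equation : T ⊛ (𝟙 ⊖ Z ⊛ Z ⊕ z²ʳ) ≈ z²ʳ ⊛ (S ⊖ 𝟙)
    T-equation n d = trans
      (solve 3 (λ t z w → t :* (con 1ℤ :- z :* z :+ w) := t :- z :* (z :* t) :+ w :* t) (λ _ _ → refl) T Z z²ʳ n d)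
      (T-equation′ n d)

    unpairedPart blockPart enclosingPart : Series
    unpairedPart = Z ⊛ (U ⊛ W)
    blockPart = U ⊛ (U ⊛ (T ⊛ W))
    enclosingPart = U ⊛ T

    blockPart-0 : ∀ n → blockPart n 0 ≡ 0ℤ
    blockPart-0 n = U⊛-zero (U ⊛ (T ⊛ W)) n

    blockPart-1 : ∀ n → blockPart n 1 ≡ 0ℤ
    blockPart-1 n = trans (U⊛-suc (U ⊛ (T ⊛ W)) n 0) (U⊛-zero (T ⊛ W) n)

    blockPart-2+ : ∀ n d′ → blockPart n (suc (suc d′)) ≡ ∑ (suc n) (λ i → + closedCount i * W (n ∸ i) d′)
    blockPart-2+ n d′ = trans (U⊛-suc (U ⊛ (T ⊛ W)) n (suc d′)) (trans (U⊛-suc (T ⊛ W) n d′) (liftZ-⊛ (λ m → + closedCount m) W n d′))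

    blockPart-short : ∀ n d → n < 3 → blockPart n d ≡ 0ℤ
    blockPart-short n zero _ = blockPart-0 n
    blockPart-short n (suc zero) _ = blockPart-1 n
    blockPart-short n (suc (suc d′)) n<3 = trans (blockPart-2+ n d′) (∑-zero (suc n) (λ { i (s≤s i≤n) →
      trans (cong (_* W (n ∸ i) d′) (T-short i 0 (ℕP.≤-<-trans i≤n n<3))) (ℤP.*-zeroˡ (W (n ∸ i) d′)) }))

    enclosingPart-short : ∀ n d → n < 3 → enclosingPart n d ≡ 0ℤ
    enclosingPart-short n zero _ = U⊛-zero T n
    enclosingPart-short n (suc d) n<3 = trans (U⊛-suc T n d) (T-short n d n<3)

    unpairedPart-1 : ∀ d → unpairedPart 1 d ≡ 0ℤ
    unpairedPart-1 zero = trans (Z⊛-suc (U ⊛ W) 0 0) (U⊛-zero W 0)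
    unpairedPart-1 (suc d) = trans (Z⊛-suc (U ⊛ W) 0 (suc d)) (U⊛-suc W 0 d)

    module Long (n′ : ℕ) where

      private
        n : ℕ
        n = suc (suc n′)

        split-length : ∀ j → j ≤ n′ → n ≡ suc j ℕ.+ suc (n′ ∸ j)
        split-length j j≤n′ = cong suc (sym (trans (ℕP.+-suc j (n′ ∸ j)) (cong suc (ℕP.m+[n∸m]≡n j≤n′))))

        blockCount : ℕ → ℕ → ℤ
        blockCount d j = + firstPartnerCount n d (just j)

        blockCount-split : ∀ d j → j ≤ n′ → blockCount d j ≡ + firstPartnerCount (suc j ℕ.+ suc (n′ ∸ j)) d (just j)
        blockCount-split d j j≤n′ = cong (λ k → + firstPartnerCount k d (just j)) (split-length j j≤n′)

      unpairedPart-coeff : ∀ d → unpairedPart n d ≡ + firstPartnerCount n d nothing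
      unpairedPart-coeff zero = trans (Z⊛-suc (U ⊛ W) (suc n′) 0)
        (trans (U⊛-zero W (suc n′)) (sym (cong +_ (Unpaired.count-unpaired-0 n′))))
      unpairedPart-coeff (suc d′) = trans (Z⊛-suc (U ⊛ W) (suc n′) (suc d′))
        (trans (U⊛-suc W (suc n′) d′) (sym (cong +_ (Unpaired.count-unpaired n′ d′))))

      enclosingPart-coeff : ∀ d → enclosingPart n d ≡ + firstPartnerCount n d (just (suc n′))
      enclosingPart-coeff zero = trans (U⊛-zero T n) (sym (cong +_ (Enclosing.count-enclosing (suc n′) 0 (λ ()))))
      enclosingPart-coeff (suc zero) = trans (U⊛-suc T n 0) (sym (cong +_ (Enclosing.count-enclosing-1 (suc n′))))
      enclosingPart-coeff (suc (suc d′)) = trans (U⊛-suc T n (suc d′))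
        (sym (cong +_ (Enclosing.count-enclosing (suc n′) (suc (suc d′)) (λ ()))))

      -- Only the blocks j < n - 1 remain: the term i = 0 has closedCount 0 = 0 and the term i = n has W 0 _ = 0.
      blockPart-coeff : ∀ d → blockPart n d ≡ ∑ (suc n′) (blockCount d)
      blockPart-coeff zero = trans (blockPart-0 n) (sym (∑-zero (suc n′) (λ { j (s≤s j≤n′) →
        trans (blockCount-split 0 j j≤n′) (cong +_ (Block.count-block-near j (n′ ∸ j) 0 (s≤s z≤n))) })))
      blockPart-coeff (suc zero) = trans (blockPart-1 n) (sym (∑-zero (suc n′) (λ { j (s≤s j≤n′) →
        trans (blockCount-split 1 j j≤n′) (cong +_ (Block.count-block-near j (n′ ∸ j) 1 (s≤s (s≤s z≤n)))) })))
      blockPart-coeff (suc (suc d′)) = begin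
        blockPart n (suc (suc d′))
          ≡⟨ blockPart-2+ n d′ ⟩
        ∑ (suc n) (λ i → + closedCount i * W (n ∸ i) d′)
          ≡⟨ trans (∑-suc n _) (cong (λ x → + closedCount 0 * W n d′ + x) (∑-last (suc n′) _)) ⟩
        + closedCount 0 * W n d′ + (∑ (suc n′) (λ j → + closedCount (suc j) * W (n ∸ suc j) d′) + + closedCount n * W (n ∸ n) d′)
          ≡⟨ cong₂ (λ x y → x + (∑ (suc n′) (λ j → + closedCount (suc j) * W (n ∸ suc j) d′) + y))
               (trans (cong (_* W n d′) T00) (ℤP.*-zeroˡ (W n d′)))
               (trans (cong (λ k → + closedCount n * W k d′) (ℕP.n∸n≡0 n′)) (ℤP.*-zeroʳ (+ closedCount n))) ⟩
        0ℤ + (∑ (suc n′) (λ j → + closedCount (suc j) * W (n ∸ suc j) d′) + 0ℤ)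
          ≡⟨ trans (ℤP.+-identityˡ _) (ℤP.+-identityʳ _) ⟩
        ∑ (suc n′) (λ j → + closedCount (suc j) * W (n ∸ suc j) d′)
          ≡⟨ ∑-cong (suc n′) (λ { j (s≤s j≤n′) → block j j≤n′ }) ⟩
        ∑ (suc n′) (blockCount (suc (suc d′))) ∎
        where
        open ≡-Reasoning
        block : ∀ j → j ≤ n′ → + closedCount (suc j) * W (n ∸ suc j) d′ ≡ blockCount (suc (suc d′)) j
        block j j≤n′ = begin
          + closedCount (suc j) * W (suc n′ ∸ j) d′                ≡⟨ cong (λ k → + closedCount (suc j) * W k d′) (ℕP.+-∸-assoc 1 j≤n′) ⟩
          + closedCount (suc j) * + w (suc (n′ ∸ j)) d′            ≡⟨ ℤP.pos-* (closedCount (suc j)) _ ⟨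
          + (closedCount (suc j) ℕ.* w (suc (n′ ∸ j)) d′)          ≡⟨ cong +_ (Block.count-block j (n′ ∸ j) d′) ⟨
          + firstPartnerCount (suc j ℕ.+ suc (n′ ∸ j)) (suc (suc d′)) (just j)   ≡⟨ blockCount-split (suc (suc d′)) j j≤n′ ⟨
          blockCount (suc (suc d′)) j                               ∎

      W-coeff : ∀ d → W n d ≡ unpairedPart n d + blockPart n d + Z n d + enclosingPart n d
      W-coeff d = begin
        + w n d
          ≡⟨ w-by-firstPartner n d ⟩
        + firstPartnerCount n d nothing + ∑ n (blockCount d)
          ≡⟨ cong (λ x → + firstPartnerCount n d nothing + x) (∑-last (suc n′) (blockCount d)) ⟩
        + firstPartnerCount n d nothing + (∑ (suc n′) (blockCount d) + blockCount d (suc n′))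
          ≡⟨ ℤP.+-assoc (+ firstPartnerCount n d nothing) (∑ (suc n′) (blockCount d)) (blockCount d (suc n′)) ⟨
        + firstPartnerCount n d nothing + ∑ (suc n′) (blockCount d) + blockCount d (suc n′)
          ≡⟨ cong₂ _+_ (trans (ℤP.+-identityʳ (unpairedPart n d + blockPart n d)) (cong₂ _+_ (unpairedPart-coeff d) (blockPart-coeff d)))
                       (enclosingPart-coeff d) ⟨
        unpairedPart n d + blockPart n d + Z n d + enclosingPart n d ∎
        where open ≡-Reasoning

    private
      W-equation′ : W ≈ unpairedPart ⊕ blockPart ⊕ Z ⊕ enclosingPart
      W-equation′ zero d = sym (cong₂ _+_ (cong₂ (λ x y → x + y + 0ℤ) (Z⊛-zero (U ⊛ W) d) (blockPart-short 0 d (s≤s z≤n)))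
                                          (enclosingPart-short 0 d (s≤s z≤n)))
      W-equation′ (suc zero) zero = trans (cong +_ w-1-0)
          (sym (cong₂ _+_ (cong₂ (λ x y → x + y + 1ℤ) (unpairedPart-1 0) (blockPart-short 1 0 (s≤s (s≤s z≤n))))
                                                                        (enclosingPart-short 1 0 (s≤s (s≤s z≤n)))))
      W-equation′ (suc zero) (suc d) = trans (cong +_ (w-1-suc d)) (sym (cong₂ _+_
        (cong₂ (λ x y → x + y + 0ℤ) (unpairedPart-1 (suc d)) (blockPart-short 1 (suc d) (s≤s (s≤s z≤n))))
        (enclosingPart-short 1 (suc d) (s≤s (s≤s z≤n)))))
      W-equation′ (suc (suc n′)) d = Long.W-coeff n′ d

    W-equation : W ≈ Z ⊛ U ⊛ W ⊕ U ⊛ U ⊛ T ⊛ W ⊕ Z ⊕ U ⊛ T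
    W-equation n d = trans (W-equation′ n d)
      (solve 4 (λ w z u t → z :* (u :* w) :+ u :* (u :* (t :* w)) :+ z :+ u :* t := z :* u :* w :+ u :* u :* t :* w :+ z :+ u :* t)
        (λ _ _ → refl) W Z U T n d)

open import Defs
open import Data.Nat using (ℕ; _≤_)
open import Data.Product using (_×_)
open import Relation.Nullary using (Dec)
open import Relation.Binary.PropositionalEquality using (_≡_)
open FunctionalEquations using (W≈RHS)
open Coefficients using (module Equations)

theorem5 : (r : ℕ) → 1 ≤ r →
    (decS : ∀ n (p : Struct n) → Dec (RCanonical r p)) →
    (decW : ∀ n d (p : Struct n) → Dec (RCanonical r p × Distance p d)) →
    ∀ n d → 𝐖 r decW n d ≡ RHS r (𝐒 r decS) n d
theorem5 r 1≤r decS decW = W≈RHS r 1≤r S T W T-equation W-equation T00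
  where open Equations r 1≤r decS decW
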